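{- Let $n\ge1$ and $p=\lfloor (n+1)/2\rfloor$. Let $\phi:B_p\to A_n$ be the homomorphism defined as follows: if $n=2p-1$, $\phi(r_i)=s_is_{2p-i}$ for $i\neq p$ and $\phi(r_p)=s_p$; if $n=2p$, $\phi(r_i)=s_is_{2p+1-i}$ for $i\ne p$ and $\phi(r_p)=s_ps_{p+1}s_p$. Let $\ell_A$ and $\ell_B$ denote the Coxeter length functions of $A_n$ and $B_p$. Then $$\sum_{(v,w)\in B_p\times B_p}(-1)^{\ell_B(w)}q^{\ell_B(w)+\ell_A(\phi(v))}=\sum_{(x,y)\in A_n\times B_p}(-1)^{\ell_A(x)}q^{\ell_A(x)+\ell_B(y)}.$$
   Context: $A_n$ is the Coxeter group generated by $s_1,\dots,s_n$ with $s_i^2=e$, $(s_is_{i+1})^3=e$, $(s_is_j)^2=e$ for $|i-j|\ge2$. $B_p$ is the Coxeter group generated by $r_1,\dots,r_p$ with $r_i^2=e$, $(r_ir_{i+1})^3=e$ for $1\le i<p-1$, $(r_{p-1}r_p)^4=e$, and $(r_ir_j)^2=e$ otherwise (for $p=1$, $B_1=\{e,r_1\}$). The assignment on generators extends to an injective group homomorphism $\phi$. Length is with respect to the respective Coxeter generators. -}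

module Defs where

open import Data.Nat using (ℕ; zero; suc; _∸_; _≤_; _*_; _<ᵇ_; _≡ᵇ_)
open import Data.Bool using (Bool; true; false; if_then_else_; _xor_)
open import Data.Fin using (Fin; zero; suc; toℕ)
open import Data.Fin.Properties using () renaming (_≟_ to _≟F_)
open import Data.Vec using (Vec; []; _∷_; lookup; tabulate; toList)
import Data.Vec as V
open import Data.List using (List; []; _∷_; [_]; map; concatMap; filter; foldr; length; allFin; cartesianProduct)
open import Data.List.Relation.Unary.Unique.Propositional using (Unique)
import Data.List.Relation.Unary.Unique.DecPropositional as UD
open import Data.Product using (_×_; _,_; proj₁; proj₂; ∃)
open import Data.Integer using (ℤ; +_; -_; _+_)
import Data.Integer as Z
open import Relation.Binary.PropositionalEquality using (_≡_)

vecs : {A : Set} → List A → (n : ℕ) → List (Vec A n)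
vecs xs zero = [ [] ]
vecs xs (suc n) = concatMap (λ v → map (λ a → a ∷ v) xs) (vecs xs n)

sumℤ : List ℤ → ℤ
sumℤ = foldr _+_ (+ 0)

sgn : ℕ → ℤ
sgn zero = + 1
sgn (suc k) = - sgn k

IsLengthFunction : {G Gen : Set} → (List Gen → G) → (G → Set) → (G → ℕ) → Set
IsLengthFunction {G} {Gen} eval isElt ℓ =
  (x : G) → isElt x →
    (∃ λ (w : List Gen) → (eval w ≡ x) × (length w ≡ ℓ x))
    × ((w : List Gen) → eval w ≡ x → ℓ x ≤ length w)

-- A_n realised as the symmetric group on Fin (suc n); a permutation x is
-- the vector of images (x k = lookup x k).

Perm : ℕ → Set
Perm m = Vec (Fin m) m

IsPerm : {m : ℕ} → Perm m → Set
IsPerm x = Unique (toList x)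

_·A_ : {m : ℕ} → Perm m → Perm m → Perm m
x ·A y = tabulate (λ k → lookup x (lookup y k))

idA : {m : ℕ} → Perm m
idA = tabulate (λ k → k)

-- adjacent transposition exchanging (0-indexed) points i and i+1
-- (identity if i+1 is out of range)
adj : ℕ → {m : ℕ} → Fin m → Fin m
adj zero {suc (suc m)} zero = suc zero
adj zero {suc (suc m)} (suc zero) = zero
adj zero {suc (suc m)} (suc (suc x)) = suc (suc x)
adj zero {suc zero} x = x
adj (suc i) zero = zero
adj (suc i) (suc x) = suc (adj i x)

-- sN i is the Coxeter generator s_{i+1} of A_n (0-indexed)
sN : {m : ℕ} → ℕ → Perm m
sN i = tabulate (adj i)

sA : (n : ℕ) → Fin n → Perm (suc n)
sA n i = sN (toℕ i)

evalA : (n : ℕ) → List (Fin n) → Perm (suc n)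
evalA n w = foldr (λ i x → sA n i ·A x) idA w

elemsA : (n : ℕ) → List (Perm (suc n))
elemsA n = filter (λ x → UD.unique? _≟F_ (toList x)) (vecs (allFin (suc n)) (suc n))

-- B_p realised as the group of signed permutations of {1..p}:
-- x k = (j , b) means x(k+1) = ±(j+1), with the minus sign iff b = true.

SPerm : ℕ → Set
SPerm p = Vec (Fin p × Bool) p

IsSPerm : {p : ℕ} → SPerm p → Set
IsSPerm x = Unique (toList (V.map proj₁ x))

_·B_ : {p : ℕ} → SPerm p → SPerm p → SPerm p
x ·B y = tabulate (λ k → let jb = lookup y k ; lc = lookup x (proj₁ jb)
                          in proj₁ lc , (proj₂ jb xor proj₂ lc))

idB : {p : ℕ} → SPerm p
idB = tabulate (λ k → k , false)

-- generators r_1..r_p of B_p (0-indexed by Fin p): r_i (i < p) exchanges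
-- i and i+1, r_p changes the sign of p.
rB : (p : ℕ) → Fin p → SPerm p
rB p j = if suc (toℕ j) ≡ᵇ p
           then tabulate (λ k → k , (suc (toℕ k) ≡ᵇ p))
           else tabulate (λ k → adj (toℕ j) k , false)

evalB : (p : ℕ) → List (Fin p) → SPerm p
evalB p w = foldr (λ i x → rB p i ·B x) idB w

elemsB : (p : ℕ) → List (SPerm p)
elemsB p = filter (λ x → UD.unique? _≟F_ (toList (V.map proj₁ x)))
                  (vecs (cartesianProduct (allFin p) (Data.Bool.true ∷ false ∷ [])) p)

-- Prescribed images φ(r_i) of the generators (0-indexed j = i - 1):
--   i < p          : s_i s_{n+1-i}   (= s_i s_{2p-i} if n = 2p-1, s_i s_{2p+1-i} if n = 2p)
--   i = p, n = 2p-1: s_p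
--   i = p, n = 2p  : s_p s_{p+1} s_p
φgen : (n p : ℕ) → Fin p → Perm (suc n)
φgen n p j =
  if suc (toℕ j) <ᵇ p
    then sN (toℕ j) ·A sN (n ∸ suc (toℕ j))
    else (if n ≡ᵇ (2 * p ∸ 1)
            then sN (p ∸ 1)
            else sN (p ∸ 1) ·A (sN p ·A sN (p ∸ 1)))

IsPhi : (n p : ℕ) → (SPerm p → Perm (suc n)) → Set
IsPhi n p φ =
  ((x y : SPerm p) → IsSPerm x → IsSPerm y → φ (x ·B y) ≡ φ x ·A φ y)
  × ((j : Fin p) → φ (rB p j) ≡ φgen n p j)

LHS : (n p : ℕ) → (SPerm p → Perm (suc n)) → (Perm (suc n) → ℕ) → (SPerm p → ℕ) → ℤ → ℤ
LHS n p φ ℓA ℓB q =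
  sumℤ (map (λ v → sumℤ (map (λ w → sgn (ℓB w) Z.* (q Z.^ (ℓB w Data.Nat.+ ℓA (φ v))))
                               (elemsB p)))
            (elemsB p))

RHS : (n p : ℕ) → (Perm (suc n) → ℕ) → (SPerm p → ℕ) → ℤ → ℤ
RHS n p ℓA ℓB q =
  sumℤ (map (λ x → sumℤ (map (λ y → sgn (ℓA x) Z.* (q Z.^ (ℓA x Data.Nat.+ ℓB y)))
                               (elemsB p)))
            (elemsA n))

-- The Coxeter lengths are inversion statistics: ℓ_A is the number of inversions of a permutation and ℓ_B
-- the type-B inversion number invB of a signed permutation, since each statistic vanishes only at the
-- identity, changes by at most one under a generator, and has a descent wherever it is positive.
-- The homomorphism φ is the folding ψ, which lays v out on the positions 0 … n symmetrically about n/2.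
-- Walking down descents of v gives ℓ_A(ψ v) = 2 invB v ∓ (number of negative letters of v), with - for
-- n odd and + for n even. Each side of the identity is a product of two sums over a group, and Lehmer
-- codes (insert a new least letter, with a sign in type B, anywhere) turn every such sum into a product
-- of one-level sums: ∏ [k]_t for A_n, ∏ [2k]_t for B_p and ∏_{m<p} (1 + q^(2m + c)) [m + 1]_{q²} for ψ,
-- where c = 1 or 3 is the length of φ(r_p).
-- The identity then holds level by level, by [2k]_q = (1 + q) [k]_{q²} and
-- (1 + q) [2m + 1]_{-q} = 1 + q^(2m + 1).

module Submission where

open import Defs
open import Data.Nat as ℕ using (ℕ; zero; suc; _+_; _*_; _∸_; _≤_; _<_; z≤n; s≤s; s≤s⁻¹; _<ᵇ_; _≡ᵇ_; _/_)
open import Data.Nat.Properties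
open import Data.Nat.DivMod using (m/n≡1+[m∸n]/n)
open import Data.Nat.Tactic.RingSolver using (solve-∀)
open import Algebra.Properties.CommutativeSemigroup +-commutativeSemigroup using (x∙yz≈y∙xz)
open import Data.Integer using (ℤ; 0ℤ; 1ℤ; -_) renaming (_+_ to _+ℤ_; _*_ to _*ℤ_; _^_ to _^ℤ_; _-_ to _-ℤ_)
import Data.Integer.Properties as ℤP
import Data.Integer.Tactic.RingSolver as ℤSolver
open import Data.Bool as Bool using (Bool; true; false; T; if_then_else_; not; _xor_)
open import Data.Bool.Properties using (¬-not; T-≡; xor-assoc; xor-identityʳ; not-involutive)
open import Data.Empty using (⊥; ⊥-elim)
open import Data.Unit using (⊤; tt)
open import Data.Product using (Σ; _×_; _,_; proj₁; proj₂)
open import Data.Sum as Sum using (_⊎_; inj₁; inj₂; [_,_]; [_,_]′)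
open import Data.Fin using (Fin; zero; suc; toℕ; fromℕ<; fromℕ; punchIn; punchOut)
import Data.Fin.Properties as Fin
open import Data.Vec as V using (Vec; []; _∷_; lookup; toList)
import Data.Vec.Properties as VP
open import Data.List as L using (List; []; _∷_; length; foldr; foldl; _++_)
import Data.List.Properties as LP
open import Data.List.Membership.Propositional using (_∈_)
import Data.List.Membership.Propositional.Properties as ∈ₚ
open import Data.List.Membership.Propositional.Properties.WithK using (unique∧set⇒bag)
open import Data.List.Relation.Unary.All as All using (All; []; _∷_)
import Data.List.Relation.Unary.All.Properties as Allₚ
open import Data.List.Relation.Unary.Any as Any using (Any; here; there)
open import Data.List.Relation.Unary.AllPairs as AllPairs using ([]; _∷_)
import Data.List.Relation.Unary.AllPairs.Properties as AllPairsₚ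
open import Data.List.Relation.Unary.Unique.Propositional using (Unique)
import Data.List.Relation.Unary.Unique.Propositional.Properties as Uniqueₚ
import Data.List.Relation.Unary.Unique.DecPropositional as UD
open import Data.List.Relation.Binary.Disjoint.Propositional using (Disjoint)
open import Data.List.Relation.Binary.Permutation.Propositional as ↭ using (_↭_)
import Data.List.Relation.Binary.Permutation.Propositional.Properties as ↭ₚ
open import Data.List.Relation.Binary.BagAndSetEquality using (∼bag⇒↭)
open import Function using (_∘_)
open import Function.Bundles using (Equivalence; _⇔_; mk⇔)
open import Relation.Binary.PropositionalEquality hiding ([_])
open import Relation.Nullary using (Dec; yes; no; contradiction)

𝟙 : Bool → ℕ
𝟙 true = 1
𝟙 false = 0

𝟙≤1 : ∀ b → 𝟙 b ≤ 1
𝟙≤1 true = s≤s z≤n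
𝟙≤1 false = z≤n

<ᵇ-true : ∀ {m n} → m < n → (m <ᵇ n) ≡ true
<ᵇ-true m<n = Equivalence.to T-≡ (<⇒<ᵇ m<n)

<ᵇ-false : ∀ {m n} → n ≤ m → (m <ᵇ n) ≡ false
<ᵇ-false {m} {zero} _ = refl
<ᵇ-false {suc m} {suc n} (s≤s n≤m) = <ᵇ-false n≤m

<ᵇ-true⁻¹ : ∀ m n → (m <ᵇ n) ≡ true → m < n
<ᵇ-true⁻¹ m n eq = <ᵇ⇒< m n (Equivalence.from T-≡ eq)

<ᵇ-false⁻¹ : ∀ m n → (m <ᵇ n) ≡ false → n ≤ m
<ᵇ-false⁻¹ m n eq = ≮⇒≥ (λ m<n → subst T eq (<⇒<ᵇ m<n))

≡ᵇ-refl : ∀ n → (n ≡ᵇ n) ≡ true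
≡ᵇ-refl n = Equivalence.to T-≡ (≡⇒≡ᵇ n n refl)

≡ᵇ-false : ∀ {m n} → m ≢ n → (m ≡ᵇ n) ≡ false
≡ᵇ-false {m} {n} m≢n with m ≡ᵇ n in eq
... | true = contradiction (≡ᵇ⇒≡ m n (subst T (sym eq) _)) m≢n
... | false = refl

≡ᵇ-false⁻¹ : ∀ m n → (m ≡ᵇ n) ≡ false → m ≢ n
≡ᵇ-false⁻¹ m .m eq refl = subst T eq (≡⇒≡ᵇ m m refl)

-- Word length

module WordLength {G Gen : Set} (_∙_ : G → G → G) (e : G) (gen : Gen → G)
  (∙-assoc : ∀ x y z → (x ∙ y) ∙ z ≡ x ∙ (y ∙ z))
  (∙-identityˡ : ∀ x → e ∙ x ≡ x) (∙-identityʳ : ∀ x → x ∙ e ≡ x)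
  (IsElt : G → Set) (IsElt-step : ∀ x i → IsElt x → IsElt (x ∙ gen i))
  (stat : G → ℕ)
  (stat-e : stat e ≡ 0)
  (stat-step : ∀ x i → stat (x ∙ gen i) ≤ suc (stat x))
  (stat-descent : ∀ x m → IsElt x → stat x ≡ suc m →
                  Σ Gen λ i → stat (x ∙ gen i) ≡ m × (x ∙ gen i) ∙ gen i ≡ x)
  (stat≡0⇒e : ∀ x → IsElt x → stat x ≡ 0 → x ≡ e)
  where

  eval : List Gen → G
  eval w = foldr (λ i x → gen i ∙ x) e w

  step : G → Gen → G
  step x i = x ∙ gen i

  foldl-step : ∀ w x → foldl step x w ≡ x ∙ eval w
  foldl-step [] x = sym (∙-identityʳ x)
  foldl-step (i ∷ w) x = trans (foldl-step w (x ∙ gen i)) (∙-assoc x (gen i) (eval w))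

  eval≡foldl : ∀ w → eval w ≡ foldl step e w
  eval≡foldl w = trans (sym (∙-identityˡ (eval w))) (sym (foldl-step w e))

  stat-foldl : ∀ w x → stat (foldl step x w) ≤ stat x + length w
  stat-foldl [] x = ≤-reflexive (sym (+-identityʳ _))
  stat-foldl (i ∷ w) x = begin
    stat (foldl step (x ∙ gen i) w) ≤⟨ stat-foldl w (x ∙ gen i) ⟩
    stat (x ∙ gen i) + length w     ≤⟨ +-monoˡ-≤ (length w) (stat-step x i) ⟩
    suc (stat x) + length w         ≡⟨ sym (+-suc (stat x) (length w)) ⟩
    stat x + suc (length w)         ∎
    where open ≤-Reasoning

  stat-eval≤length : ∀ w → stat (eval w) ≤ length w
  stat-eval≤length w = subst (λ k → stat (eval w) ≤ k + length w) stat-e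
    (subst (λ x → stat x ≤ stat e + length w) (sym (eval≡foldl w)) (stat-foldl w e))

  eval-snoc : ∀ w i → eval (w ++ i ∷ []) ≡ eval w ∙ gen i
  eval-snoc [] i = trans (∙-identityʳ (gen i)) (sym (∙-identityˡ (gen i)))
  eval-snoc (j ∷ w) i = trans (cong (gen j ∙_) (eval-snoc w i)) (sym (∙-assoc (gen j) (eval w) (gen i)))

  word-of-length-stat : ∀ m x → IsElt x → stat x ≡ m → Σ (List Gen) λ w → eval w ≡ x × length w ≡ m
  word-of-length-stat zero x x∈G stat≡0 = [] , sym (stat≡0⇒e x x∈G stat≡0) , refl
  word-of-length-stat (suc m) x x∈G stat≡1+m with stat-descent x m x∈G stat≡1+m
  ... | i , stat-xi≡m , xii≡x with word-of-length-stat m (x ∙ gen i) (IsElt-step x i x∈G) stat-xi≡m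
  ...   | w , eval-w≡xi , length-w≡m =
    w ++ i ∷ [] ,
    trans (eval-snoc w i) (trans (cong (_∙ gen i) eval-w≡xi) xii≡x) ,
    trans (LP.length-++ w) (trans (+-comm (length w) 1) (cong suc length-w≡m))

  -- stat ≤ ℓ since a generator raises stat by at most one; ℓ ≤ stat by descending from x to e.
  length≡stat : (ℓ : G → ℕ) → IsLengthFunction eval IsElt ℓ → ∀ x → IsElt x → ℓ x ≡ stat x
  length≡stat ℓ isℓ x x∈G = ≤-antisym ℓ≤stat stat≤ℓ
    where
      ℓ≤stat : ℓ x ≤ stat x
      ℓ≤stat with word-of-length-stat (stat x) x x∈G refl
      ... | w , eval-w≡x , length-w≡stat = subst (ℓ x ≤_) length-w≡stat (proj₂ (isℓ x x∈G) w eval-w≡x)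
      stat≤ℓ : stat x ≤ ℓ x
      stat≤ℓ with proj₁ (isℓ x x∈G)
      ... | w , eval-w≡x , length-w≡ℓ =
        subst (λ y → stat y ≤ ℓ x) eval-w≡x (subst (stat (eval w) ≤_) length-w≡ℓ (stat-eval≤length w))

-- Vectors and pair statistics

transpose : ℕ → ℕ → ℕ
transpose k i = if i ≡ᵇ k then suc k else (if i ≡ᵇ suc k then k else i)

transpose-k : ∀ k → transpose k k ≡ suc k
transpose-k k rewrite ≡ᵇ-refl k = refl

transpose-suc-k : ∀ k → transpose k (suc k) ≡ k
transpose-suc-k k rewrite ≡ᵇ-false (>⇒≢ (n<1+n k)) | ≡ᵇ-refl k = refl

transpose-fix : ∀ {k i} → i ≢ k → i ≢ suc k → transpose k i ≡ i
transpose-fix i≢k i≢1+k rewrite ≡ᵇ-false i≢k | ≡ᵇ-false i≢1+k = refl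

transpose-fix< : ∀ {k i} → i < k → transpose k i ≡ i
transpose-fix< i<k = transpose-fix (<⇒≢ i<k) (<⇒≢ (m<n⇒m<1+n i<k))

transpose-fix> : ∀ {k i} → suc k < i → transpose k i ≡ i
transpose-fix> 1+k<i = transpose-fix (>⇒≢ (<-trans (n<1+n _) 1+k<i)) (>⇒≢ 1+k<i)

transpose-cases : ∀ k i → (i ≡ k × transpose k i ≡ suc k)
                        ⊎ (i ≡ suc k × transpose k i ≡ k)
                        ⊎ (i ≢ k × i ≢ suc k × transpose k i ≡ i)
transpose-cases k i with i ℕ.≟ k | i ℕ.≟ suc k
... | yes refl | _ = inj₁ (refl , transpose-k k)
... | no _ | yes refl = inj₂ (inj₁ (refl , transpose-suc-k k))
... | no i≢k | no i≢1+k = inj₂ (inj₂ (i≢k , i≢1+k , transpose-fix i≢k i≢1+k))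

suc-transpose : ∀ k i → suc (transpose k i) ≡ transpose (suc k) (suc i)
suc-transpose k i with i ≡ᵇ k | i ≡ᵇ suc k
... | true | _ = refl
... | false | true = refl
... | false | false = refl

toℕ-adj : ∀ k {m} (i : Fin m) → suc k < m → toℕ (adj k i) ≡ transpose k (toℕ i)
toℕ-adj zero {suc (suc m)} zero _ = refl
toℕ-adj zero {suc (suc m)} (suc zero) _ = refl
toℕ-adj zero {suc (suc m)} (suc (suc i)) _ = refl
toℕ-adj zero {suc zero} zero (s≤s ())
toℕ-adj (suc k) {suc m} zero _ = refl
toℕ-adj (suc k) {suc m} (suc i) (s≤s k<m) = trans (cong suc (toℕ-adj k i k<m)) (suc-transpose k (toℕ i))

lookup-ext : ∀ {A : Set} {l} (x y : Vec A l) → (∀ i → lookup x i ≡ lookup y i) → x ≡ y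
lookup-ext x y eq = trans (sym (VP.tabulate∘lookup x)) (trans (VP.tabulate-cong eq) (VP.tabulate∘lookup y))

All-toList⁺ : ∀ {A : Set} {P : A → Set} {l} (v : Vec A l) → (∀ i → P (lookup v i)) → All P (toList v)
All-toList⁺ [] _ = []
All-toList⁺ (a ∷ v) p = p zero ∷ All-toList⁺ v (p ∘ suc)

All-toList⁻ : ∀ {A : Set} {P : A → Set} {l} (v : Vec A l) → All P (toList v) → ∀ i → P (lookup v i)
All-toList⁻ (a ∷ v) (pa ∷ _) zero = pa
All-toList⁻ (a ∷ v) (_ ∷ ps) (suc i) = All-toList⁻ v ps i

Unique⇒lookup-injective : ∀ {A : Set} {l} (v : Vec A l) → Unique (toList v) →
                          ∀ i j → lookup v i ≡ lookup v j → i ≡ j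
Unique⇒lookup-injective (a ∷ v) u zero zero _ = refl
Unique⇒lookup-injective (a ∷ v) (a∉v ∷ u) zero (suc j) eq = contradiction eq (All-toList⁻ v a∉v j)
Unique⇒lookup-injective (a ∷ v) (a∉v ∷ u) (suc i) zero eq = contradiction (sym eq) (All-toList⁻ v a∉v i)
Unique⇒lookup-injective (a ∷ v) (_ ∷ u) (suc i) (suc j) eq = cong suc (Unique⇒lookup-injective v u i j eq)

lookup-injective⇒Unique : ∀ {A : Set} {l} (v : Vec A l) → (∀ i j → lookup v i ≡ lookup v j → i ≡ j) →
                          Unique (toList v)
lookup-injective⇒Unique [] _ = []
lookup-injective⇒Unique (a ∷ v) inj =
  All-toList⁺ v (λ j eq → Fin.0≢1+n (inj zero (suc j) eq)) ∷
  lookup-injective⇒Unique v (λ i j eq → Fin.suc-injective (inj (suc i) (suc j) eq))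

swapAt : ∀ {A : Set} {l} → ℕ → Vec A l → Vec A l
swapAt zero [] = []
swapAt zero (a ∷ []) = a ∷ []
swapAt zero (a ∷ b ∷ v) = b ∷ a ∷ v
swapAt (suc k) [] = []
swapAt (suc k) (a ∷ v) = a ∷ swapAt k v

swapAt-involutive : ∀ {A : Set} {l} k (v : Vec A l) → swapAt k (swapAt k v) ≡ v
swapAt-involutive zero [] = refl
swapAt-involutive zero (a ∷ []) = refl
swapAt-involutive zero (a ∷ b ∷ v) = refl
swapAt-involutive (suc k) [] = refl
swapAt-involutive (suc k) (a ∷ v) = cong (a ∷_) (swapAt-involutive k v)

lookup-swapAt : ∀ {A : Set} {l} k (v : Vec A l) (i : Fin l) → lookup (swapAt k v) i ≡ lookup v (adj k i)
lookup-swapAt zero (a ∷ []) zero = refl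
lookup-swapAt zero (a ∷ b ∷ v) zero = refl
lookup-swapAt zero (a ∷ b ∷ v) (suc zero) = refl
lookup-swapAt zero (a ∷ b ∷ v) (suc (suc i)) = refl
lookup-swapAt (suc k) (a ∷ v) zero = refl
lookup-swapAt (suc k) (a ∷ v) (suc i) = lookup-swapAt k v i

map-swapAt : ∀ {A B : Set} {l} (f : A → B) k (v : Vec A l) → V.map f (swapAt k v) ≡ swapAt k (V.map f v)
map-swapAt f zero [] = refl
map-swapAt f zero (a ∷ []) = refl
map-swapAt f zero (a ∷ b ∷ v) = refl
map-swapAt f (suc k) [] = refl
map-swapAt f (suc k) (a ∷ v) = cong (f a ∷_) (map-swapAt f k v)

All-swapAt : ∀ {A : Set} {P : A → Set} {l} k (v : Vec A l) → All P (toList v) → All P (toList (swapAt k v))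
All-swapAt zero [] ps = ps
All-swapAt zero (a ∷ []) ps = ps
All-swapAt zero (a ∷ b ∷ v) (pa ∷ pb ∷ ps) = pb ∷ pa ∷ ps
All-swapAt (suc k) [] ps = ps
All-swapAt (suc k) (a ∷ v) (pa ∷ ps) = pa ∷ All-swapAt k v ps

Unique-swapAt : ∀ {A : Set} {l} k (v : Vec A l) → Unique (toList v) → Unique (toList (swapAt k v))
Unique-swapAt zero [] u = u
Unique-swapAt zero (a ∷ []) u = u
Unique-swapAt zero (a ∷ b ∷ v) ((a≢b ∷ a∉v) ∷ (b∉v ∷ u)) = (≢-sym a≢b ∷ b∉v) ∷ (a∉v ∷ u)
Unique-swapAt (suc k) [] u = u
Unique-swapAt (suc k) (a ∷ v) (a∉v ∷ u) = All-swapAt k v a∉v ∷ Unique-swapAt k v u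

lookupℕ : ∀ {A : Set} {l} → A → Vec A l → ℕ → A
lookupℕ d [] _ = d
lookupℕ d (a ∷ v) zero = a
lookupℕ d (a ∷ v) (suc k) = lookupℕ d v k

lookupℕ-swapAt : ∀ {A : Set} {l} (d : A) k (v : Vec A l) → suc k < l →
                 ∀ i → lookupℕ d (swapAt k v) i ≡ lookupℕ d v (transpose k i)
lookupℕ-swapAt d zero (a ∷ b ∷ v) _ zero = refl
lookupℕ-swapAt d zero (a ∷ b ∷ v) _ (suc zero) = refl
lookupℕ-swapAt d zero (a ∷ b ∷ v) _ (suc (suc i)) = refl
lookupℕ-swapAt d zero (a ∷ []) (s≤s ()) i
lookupℕ-swapAt d (suc k) (a ∷ v) _ zero = refl
lookupℕ-swapAt d (suc k) (a ∷ v) (s≤s k<l) (suc i) =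
  trans (lookupℕ-swapAt d k v k<l i) (cong (lookupℕ d (a ∷ v)) (suc-transpose k i))

lookupℕ-tabulate : ∀ {A : Set} {l} (d : A) (f : Fin l → A) i (i<l : i < l) →
                   lookupℕ d (V.tabulate f) i ≡ f (fromℕ< i<l)
lookupℕ-tabulate {l = suc l} d f zero _ = refl
lookupℕ-tabulate {l = suc l} d f (suc i) (s≤s i<l) = lookupℕ-tabulate d (f ∘ suc) i i<l

-- pairStat x = Σ_{i<j} P (x i) (x j) + Σ_i S (x i); both Coxeter lengths, and the length of the
-- folding, have this form.
module PairStatistic {A : ℕ → Set} (P : ∀ {m} → A m → A m → ℕ) (S : ∀ {m} → A m → ℕ) where

  rowSum : ∀ {m l} → A m → Vec (A m) l → ℕ
  rowSum h [] = 0
  rowSum h (x ∷ t) = P h x + rowSum h t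

  pairStat : ∀ {m l} → Vec (A m) l → ℕ
  pairStat [] = 0
  pairStat (h ∷ t) = rowSum h t + S h + pairStat t

  rowSum-swapAt : ∀ {m l} (h : A m) k (t : Vec (A m) l) → rowSum h (swapAt k t) ≡ rowSum h t
  rowSum-swapAt h zero [] = refl
  rowSum-swapAt h zero (a ∷ []) = refl
  rowSum-swapAt h zero (a ∷ b ∷ t) = x∙yz≈y∙xz (P h b) (P h a) (rowSum h t)
  rowSum-swapAt h (suc k) [] = refl
  rowSum-swapAt h (suc k) (a ∷ t) = cong (P h a +_) (rowSum-swapAt h k t)

  pairStat-swapAt : ∀ {m l} (d : A m) k (x : Vec (A m) l) → suc k < l →
    pairStat (swapAt k x) + P (lookupℕ d x k) (lookupℕ d x (suc k))
      ≡ pairStat x + P (lookupℕ d x (suc k)) (lookupℕ d x k)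
  pairStat-swapAt d zero (a ∷ []) (s≤s ())
  pairStat-swapAt d zero (a ∷ b ∷ x) _ =
    shuffle (P b a) (P a b) (rowSum b x) (rowSum a x) (S a) (S b) (pairStat x)
    where
      shuffle : ∀ ba ab rb ra sa sb s → (ba + rb + sb + (ra + sa + s)) + ab ≡ (ab + ra + sa + (rb + sb + s)) + ba
      shuffle = solve-∀
  pairStat-swapAt d (suc k) (a ∷ x) (s≤s k<l) = begin
    rowSum a (swapAt k x) + S a + pairStat (swapAt k x) + _ ≡⟨ cong (λ r → r + S a + pairStat (swapAt k x) + _) (rowSum-swapAt a k x) ⟩
    rowSum a x + S a + pairStat (swapAt k x) + _            ≡⟨ +-assoc (rowSum a x + S a) (pairStat (swapAt k x)) _ ⟩
    rowSum a x + S a + (pairStat (swapAt k x) + _)          ≡⟨ cong (rowSum a x + S a +_) (pairStat-swapAt d k x k<l) ⟩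
    rowSum a x + S a + (pairStat x + _)                     ≡⟨ sym (+-assoc (rowSum a x + S a) (pairStat x) _) ⟩
    rowSum a x + S a + pairStat x + _                       ∎
    where open ≡-Reasoning

  pairStat-map : ∀ {m m′ l} (f : A m → A m′) → (∀ h x → P (f h) (f x) ≡ P h x) → (∀ h → S (f h) ≡ S h) →
                 (x : Vec (A m) l) → pairStat (V.map f x) ≡ pairStat x
  pairStat-map f P-f S-f [] = refl
  pairStat-map f P-f S-f (h ∷ t) =
    cong₂ _+_ (cong₂ _+_ (rowSum-map t) (S-f h)) (pairStat-map f P-f S-f t)
    where
      rowSum-map : ∀ {l} (t : Vec (A _) l) → rowSum (f h) (V.map f t) ≡ rowSum h t
      rowSum-map [] = refl
      rowSum-map (x ∷ t) = cong₂ _+_ (P-f h x) (rowSum-map t)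

  rowSum-insertAt : ∀ {m l} (h : A m) (t : Vec (A m) l) i e → rowSum h (V.insertAt t i e) ≡ rowSum h t + P h e
  rowSum-insertAt h t zero e = +-comm (P h e) (rowSum h t)
  rowSum-insertAt h (x ∷ t) (suc i) e =
    trans (cong (P h x +_) (rowSum-insertAt h t i e)) (sym (+-assoc (P h x) (rowSum h t) (P h e)))

  rowSum-const : ∀ {m m′ l} (f : A m → A m′) (e : A m′) c (u : Vec (A m) l) → (∀ h → P e (f h) ≡ c) →
                 rowSum e (V.map f u) ≡ l * c
  rowSum-const f e c [] _ = refl
  rowSum-const f e c (h ∷ u) P-e = cong₂ _+_ (P-e h) (rowSum-const f e c u P-e)

  pairStat-insertAt : ∀ {m m′ l} (f : A m → A m′) (u : Vec (A m) l) (i : Fin (suc l)) (e : A m′) cˡ cʳ →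
    (∀ h → P (f h) e ≡ cˡ) → (∀ h → P e (f h) ≡ cʳ) →
    pairStat (V.insertAt (V.map f u) i e) ≡ pairStat (V.map f u) + toℕ i * cˡ + (l ∸ toℕ i) * cʳ + S e
  pairStat-insertAt {l = l} f u zero e cˡ cʳ P-·e P-e· =
    trans (cong (λ r → r + S e + pairStat (V.map f u)) (rowSum-const f e cʳ u P-e·))
          (shuffle (l * cʳ) (S e) (pairStat (V.map f u)))
    where
      shuffle : ∀ r s t → r + s + t ≡ t + 0 + r + s
      shuffle = solve-∀
  pairStat-insertAt {l = suc l} f (h ∷ u) (suc i) e cˡ cʳ P-·e P-e· = begin
    rowSum (f h) (V.insertAt t i e) + S (f h) + pairStat (V.insertAt t i e)
      ≡⟨ cong (λ r → r + S (f h) + pairStat (V.insertAt t i e))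
              (trans (rowSum-insertAt (f h) t i e) (cong (rowSum (f h) t +_) (P-·e h))) ⟩
    rowSum (f h) t + cˡ + S (f h) + pairStat (V.insertAt t i e)
      ≡⟨ cong (rowSum (f h) t + cˡ + S (f h) +_) (pairStat-insertAt f u i e cˡ cʳ P-·e P-e·) ⟩
    rowSum (f h) t + cˡ + S (f h) + (pairStat t + toℕ i * cˡ + (l ∸ toℕ i) * cʳ + S e)
      ≡⟨ shuffle (rowSum (f h) t) cˡ (S (f h)) (pairStat t) (toℕ i * cˡ) ((l ∸ toℕ i) * cʳ) (S e) ⟩
    rowSum (f h) t + S (f h) + pairStat t + (cˡ + toℕ i * cˡ) + (l ∸ toℕ i) * cʳ + S e ∎
    where
      open ≡-Reasoning
      t = V.map f u
      shuffle : ∀ r c s t x y se → r + c + s + (t + x + y + se) ≡ r + s + t + (c + x) + y + se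
      shuffle = solve-∀

-- Type A: inversions

lookup-·A : ∀ {m} (x y : Perm m) i → lookup (x ·A y) i ≡ lookup x (lookup y i)
lookup-·A x y i = VP.lookup∘tabulate _ i

lookup-idA : ∀ {m} (i : Fin m) → lookup idA i ≡ i
lookup-idA i = VP.lookup∘tabulate (λ k → k) i

·A-assoc : ∀ {m} (x y z : Perm m) → (x ·A y) ·A z ≡ x ·A (y ·A z)
·A-assoc x y z = lookup-ext _ _ λ i → begin
  lookup ((x ·A y) ·A z) i         ≡⟨ lookup-·A (x ·A y) z i ⟩
  lookup (x ·A y) (lookup z i)     ≡⟨ lookup-·A x y (lookup z i) ⟩
  lookup x (lookup y (lookup z i)) ≡⟨ cong (lookup x) (lookup-·A y z i) ⟨
  lookup x (lookup (y ·A z) i)     ≡⟨ lookup-·A x (y ·A z) i ⟨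
  lookup (x ·A (y ·A z)) i         ∎
  where open ≡-Reasoning

·A-identityˡ : ∀ {m} (x : Perm m) → idA ·A x ≡ x
·A-identityˡ x = lookup-ext _ _ λ i → trans (lookup-·A idA x i) (lookup-idA (lookup x i))

·A-identityʳ : ∀ {m} (x : Perm m) → x ·A idA ≡ x
·A-identityʳ x = lookup-ext _ _ λ i → trans (lookup-·A x idA i) (cong (lookup x) (lookup-idA i))

·A-sN : ∀ {m} (x : Perm m) k → x ·A sN k ≡ swapAt k x
·A-sN x k = lookup-ext _ _ λ i → begin
  lookup (x ·A sN k) i       ≡⟨ lookup-·A x (sN k) i ⟩
  lookup x (lookup (sN k) i) ≡⟨ cong (lookup x) (VP.lookup∘tabulate (adj k) i) ⟩
  lookup x (adj k i)         ≡⟨ lookup-swapAt k x i ⟨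
  lookup (swapAt k x) i      ∎
  where open ≡-Reasoning

IsPerm-·A : ∀ {m} (x y : Perm m) → IsPerm x → IsPerm y → IsPerm (x ·A y)
IsPerm-·A x y x-perm y-perm = lookup-injective⇒Unique (x ·A y) λ i j eq →
  Unique⇒lookup-injective y y-perm i j
    (Unique⇒lookup-injective x x-perm _ _ (trans (sym (lookup-·A x y i)) (trans eq (lookup-·A x y j))))

IsPerm-idA : ∀ {m} → IsPerm (idA {m})
IsPerm-idA = lookup-injective⇒Unique idA λ i j eq → trans (sym (lookup-idA i)) (trans eq (lookup-idA j))

IsPerm-sN : ∀ {m} k → IsPerm (sN {m} k)
IsPerm-sN k = subst IsPerm (trans (sym (·A-sN idA k)) (·A-identityˡ (sN k))) (Unique-swapAt k idA IsPerm-idA)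

inverted : ∀ {m} → Fin m → Fin m → ℕ
inverted h x = 𝟙 (toℕ x <ᵇ toℕ h)

open PairStatistic {Fin} inverted (λ _ → 0) using ()
  renaming (rowSum to invRow; pairStat to inv; pairStat-swapAt to inv-swapAt;
            pairStat-map to inv-map; pairStat-insertAt to inv-insertAt)

inv-idA : ∀ m → inv (idA {m}) ≡ 0
inv-idA zero = refl
inv-idA (suc m) = begin
  inv (idA {suc m})
    ≡⟨ cong (λ t → inv (zero ∷ t)) (VP.tabulate-∘ suc (λ (k : Fin m) → k)) ⟩
  invRow zero (V.map suc ids) + 0 + inv (V.map suc ids)
    ≡⟨ cong (λ r → r + 0 + inv (V.map suc ids)) (invRow-zero (V.map suc ids)) ⟩
  inv (V.map suc ids)
    ≡⟨ inv-map suc (λ _ _ → refl) (λ _ → refl) ids ⟩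
  inv ids
    ≡⟨ inv-idA m ⟩
  0 ∎
  where
    open ≡-Reasoning
    ids = idA {m}
    invRow-zero : ∀ {l} (t : Vec (Fin (suc m)) l) → invRow zero t ≡ 0
    invRow-zero [] = refl
    invRow-zero (x ∷ t) = invRow-zero t

IsDescent : ∀ {m l} → Vec (Fin (suc m)) l → ℕ → Set
IsDescent {l = l} x k = suc k < l × toℕ (lookupℕ zero x (suc k)) < toℕ (lookupℕ zero x k)

inv-swapAt≤ : ∀ {m l} (d : Fin m) k (x : Vec (Fin m) l) → suc k < l → inv (swapAt k x) ≤ suc (inv x)
inv-swapAt≤ d k x k<l = begin
  inv (swapAt k x)                ≤⟨ m≤m+n _ _ ⟩
  inv (swapAt k x) + inverted a b ≡⟨ inv-swapAt d k x k<l ⟩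
  inv x + inverted b a            ≤⟨ +-monoʳ-≤ (inv x) (𝟙≤1 _) ⟩
  inv x + 1                       ≡⟨ +-comm (inv x) 1 ⟩
  suc (inv x)                     ∎
  where
    open ≤-Reasoning
    a = lookupℕ d x k
    b = lookupℕ d x (suc k)

inv-swapAt-descent : ∀ {m l} (x : Vec (Fin (suc m)) l) k → IsDescent x k → inv (swapAt k x) + 1 ≡ inv x
inv-swapAt-descent x k (k<l , desc) = begin
  inv (swapAt k x) + 1            ≡⟨ cong (λ b → inv (swapAt k x) + 𝟙 b) (<ᵇ-true desc) ⟨
  inv (swapAt k x) + inverted a b ≡⟨ inv-swapAt zero k x k<l ⟩
  inv x + inverted b a            ≡⟨ cong (λ b → inv x + 𝟙 b) (<ᵇ-false (<⇒≤ desc)) ⟩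
  inv x + 0                       ≡⟨ +-identityʳ (inv x) ⟩
  inv x                           ∎
  where
    open ≡-Reasoning
    a = lookupℕ zero x k
    b = lookupℕ zero x (suc k)

invRow≡0-mono : ∀ {m l} (h h′ : Fin m) (t : Vec (Fin m) l) → toℕ h ≤ toℕ h′ → invRow h′ t ≡ 0 → invRow h t ≡ 0
invRow≡0-mono h h′ [] _ _ = refl
invRow≡0-mono h h′ (u ∷ t) h≤h′ row≡0 with toℕ u <ᵇ toℕ h′ in u<h′
... | false = cong₂ _+_ (cong 𝟙 (<ᵇ-false (≤-trans h≤h′ (<ᵇ-false⁻¹ _ _ u<h′)))) (invRow≡0-mono h h′ t h≤h′ row≡0)

descent-cons : ∀ {m l} (h h′ : Fin (suc m)) (t : Vec (Fin (suc m)) l) → inv (h ∷ h′ ∷ t) ≢ 0 →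
               (inv (h′ ∷ t) ≢ 0 → Σ ℕ (IsDescent (h′ ∷ t))) → Σ ℕ (IsDescent (h ∷ h′ ∷ t))
descent-cons h h′ t inv≢0 descent-t with inv (h′ ∷ t) ℕ.≟ 0
... | no inv-t≢0 with descent-t inv-t≢0
...   | k , k<l , desc = suc k , s≤s k<l , desc
descent-cons h h′ t inv≢0 descent-t | yes inv-t≡0 with toℕ h′ ℕ.<? toℕ h
...   | yes h′<h = zero , s≤s (s≤s z≤n) , h′<h
...   | no h′≮h = contradiction inv≡0 inv≢0
  where
    row-t≡0 : invRow h′ t ≡ 0
    row-t≡0 = m+n≡0⇒m≡0 _ (m+n≡0⇒m≡0 _ inv-t≡0)
    row≡0 : invRow h (h′ ∷ t) ≡ 0
    row≡0 = cong₂ _+_ (cong 𝟙 (<ᵇ-false (≮⇒≥ h′≮h))) (invRow≡0-mono h h′ t (≮⇒≥ h′≮h) row-t≡0)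
    inv≡0 : inv (h ∷ h′ ∷ t) ≡ 0
    inv≡0 = cong₂ (λ r s → r + 0 + s) row≡0 inv-t≡0

inv≢0⇒descent : ∀ {m l} (x : Vec (Fin (suc m)) l) → inv x ≢ 0 → Σ ℕ (IsDescent x)
inv≢0⇒descent [] inv≢0 = contradiction refl inv≢0
inv≢0⇒descent (h ∷ []) inv≢0 = contradiction refl inv≢0
inv≢0⇒descent (h ∷ h′ ∷ t) inv≢0 = descent-cons h h′ t inv≢0 (inv≢0⇒descent (h′ ∷ t))

Increasing : ∀ {m l} → Vec (Fin m) l → Set
Increasing [] = ⊤
Increasing (h ∷ t) = All (λ u → toℕ h < toℕ u) (toList t) × Increasing t

invRow≡0⇒All> : ∀ {m l} (h : Fin m) (t : Vec (Fin m) l) → invRow h t ≡ 0 → All (h ≢_) (toList t) →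
                All (λ u → toℕ h < toℕ u) (toList t)
invRow≡0⇒All> h [] _ _ = []
invRow≡0⇒All> h (u ∷ t) row≡0 (h≢u ∷ h∉t) with toℕ u <ᵇ toℕ h in u<h
... | false = ≤∧≢⇒< (<ᵇ-false⁻¹ _ _ u<h) (h≢u ∘ Fin.toℕ-injective) ∷ invRow≡0⇒All> h t row≡0 h∉t

inv≡0⇒Increasing : ∀ {m l} (x : Vec (Fin m) l) → inv x ≡ 0 → Unique (toList x) → Increasing x
inv≡0⇒Increasing [] _ _ = tt
inv≡0⇒Increasing (h ∷ t) inv≡0 (h∉t ∷ u) =
  invRow≡0⇒All> h t (m+n≡0⇒m≡0 _ (m+n≡0⇒m≡0 _ inv≡0)) h∉t ,
  inv≡0⇒Increasing t (m+n≡0⇒n≡0 (invRow h t + 0) inv≡0) u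

Increasing⇒Any≥ : ∀ {m l} (h : Fin m) (t : Vec (Fin m) l) → Increasing (h ∷ t) →
                  Any (λ u → toℕ h + l ≤ toℕ u) (toList (h ∷ t))
Increasing⇒Any≥ h [] _ = here (≤-reflexive (+-identityʳ _))
Increasing⇒Any≥ {l = suc l} h (h′ ∷ t) ((h<h′ ∷ _) , inc) =
  there (Any.map (λ h′+l≤u → ≤-trans (≤-reflexive (+-suc (toℕ h) l)) (≤-trans (+-monoˡ-≤ l h<h′) h′+l≤u))
                 (Increasing⇒Any≥ h′ t inc))

Increasing-within⇒consecutive : ∀ {m l} lo (x : Vec (Fin m) l) → Increasing x →
  All (λ u → lo ≤ toℕ u) (toList x) → All (λ u → toℕ u < lo + l) (toList x) →
  ∀ i → toℕ (lookup x i) ≡ lo + toℕ i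
Increasing-within⇒consecutive {l = suc l} lo (h ∷ t) (h<t , inc) (lo≤h ∷ lo≤t) (h<lo+l ∷ t<lo+l) = go
  where
    h≡lo : toℕ h ≡ lo
    h≡lo with toℕ h ℕ.≟ lo
    ... | yes eq = eq
    ... | no h≢lo = ⊥-elim (no-room (All.lookupAny (h<lo+l ∷ t<lo+l) (Increasing⇒Any≥ h t (h<t , inc))))
      where
        no-room : ∀ {u : Fin _} → toℕ u < lo + suc l × toℕ h + l ≤ toℕ u → ⊥
        no-room (u<lo+1+l , h+l≤u) = <-irrefl refl (begin-strict
          toℕ h + l  ≤⟨ h+l≤u ⟩
          toℕ _      <⟨ u<lo+1+l ⟩
          lo + suc l ≡⟨ +-suc lo l ⟩
          suc lo + l ≤⟨ +-monoˡ-≤ l (≤∧≢⇒< lo≤h (h≢lo ∘ sym)) ⟩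
          toℕ h + l  ∎)
          where open ≤-Reasoning
    go : ∀ i → toℕ (lookup (h ∷ t) i) ≡ lo + toℕ i
    go zero = trans h≡lo (sym (+-identityʳ lo))
    go (suc i) = trans
      (Increasing-within⇒consecutive (suc lo) t inc (All.map (subst (_< _) h≡lo) h<t)
        (All.map (λ u<lo+l → ≤-trans u<lo+l (≤-reflexive (+-suc lo l))) t<lo+l) i)
      (sym (+-suc lo (toℕ i)))

inv≡0⇒idA : ∀ {m} (x : Perm m) → IsPerm x → inv x ≡ 0 → x ≡ idA
inv≡0⇒idA x x-perm inv≡0 = lookup-ext _ _ λ i → Fin.toℕ-injective (trans
  (Increasing-within⇒consecutive 0 x (inv≡0⇒Increasing x inv≡0 x-perm)
     (All.universal (λ _ → z≤n) (toList x)) (All.universal Fin.toℕ<n (toList x)) i)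
  (cong toℕ (sym (lookup-idA i))))

length≡inv : ∀ n (ℓA : Perm (suc n) → ℕ) → IsLengthFunction (evalA n) IsPerm ℓA →
             ∀ x → IsPerm x → ℓA x ≡ inv x
length≡inv n = WordLength.length≡stat _·A_ idA (sA n) ·A-assoc ·A-identityˡ ·A-identityʳ
  IsPerm IsPerm-step inv (inv-idA (suc n)) inv-step≤ inv-descent inv≡0⇒idA
  where
    ·sA≡swapAt : ∀ (x : Perm (suc n)) i → x ·A sA n i ≡ swapAt (toℕ i) x
    ·sA≡swapAt x i = ·A-sN x (toℕ i)

    IsPerm-step : ∀ x i → IsPerm x → IsPerm (x ·A sA n i)
    IsPerm-step x i x-perm = subst IsPerm (sym (·sA≡swapAt x i)) (Unique-swapAt (toℕ i) x x-perm)

    inv-step≤ : ∀ x i → inv (x ·A sA n i) ≤ suc (inv x)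
    inv-step≤ x i = subst (λ y → inv y ≤ suc (inv x)) (sym (·sA≡swapAt x i))
      (inv-swapAt≤ zero (toℕ i) x (s≤s (Fin.toℕ<n i)))

    inv-descent : ∀ x m → IsPerm x → inv x ≡ suc m →
                  Σ (Fin n) λ i → inv (x ·A sA n i) ≡ m × (x ·A sA n i) ·A sA n i ≡ x
    inv-descent x m _ inv≡1+m with inv≢0⇒descent x (λ inv≡0 → 1+n≢0 (trans (sym inv≡1+m) inv≡0))
    ... | k , desc@(s≤s k<n , _) = i , inv-xi≡m , xii≡x
      where
        i = fromℕ< k<n
        xi≡swapAt : x ·A sA n i ≡ swapAt k x
        xi≡swapAt = trans (·sA≡swapAt x i) (cong (λ j → swapAt j x) (Fin.toℕ-fromℕ< k<n))
        inv-xi≡m : inv (x ·A sA n i) ≡ m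
        inv-xi≡m = +-cancelʳ-≡ 1 _ _ (begin
          inv (x ·A sA n i) + 1 ≡⟨ cong (λ y → inv y + 1) xi≡swapAt ⟩
          inv (swapAt k x) + 1  ≡⟨ inv-swapAt-descent x k desc ⟩
          inv x                 ≡⟨ inv≡1+m ⟩
          suc m                 ≡⟨ +-comm 1 m ⟩
          m + 1                 ∎)
          where open ≡-Reasoning
        xii≡x : (x ·A sA n i) ·A sA n i ≡ x
        xii≡x = begin
          (x ·A sA n i) ·A sA n i ≡⟨ cong (_·A sA n i) xi≡swapAt ⟩
          swapAt k x ·A sA n i    ≡⟨ trans (·sA≡swapAt (swapAt k x) i) (cong (λ j → swapAt j (swapAt k x)) (Fin.toℕ-fromℕ< k<n)) ⟩
          swapAt k (swapAt k x)   ≡⟨ swapAt-involutive k x ⟩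
          x                       ∎
          where open ≡-Reasoning

-- Type B: signed inversions

Signed : ℕ → Set
Signed m = Fin m × Bool

flipSign : ∀ {m} → Signed m → Signed m
flipSign (j , b) = (j , not b)

infixr 5 _⊙_
_⊙_ : ∀ {p} → SPerm p → Signed p → Signed p
x ⊙ c = proj₁ (lookup x (proj₁ c)) , (proj₂ c xor proj₂ (lookup x (proj₁ c)))

lookup-·B : ∀ {p} (x y : SPerm p) i → lookup (x ·B y) i ≡ x ⊙ lookup y i
lookup-·B x y i = VP.lookup∘tabulate (λ k → x ⊙ lookup y k) i

lookup-idB : ∀ {p} (i : Fin p) → lookup (idB {p}) i ≡ (i , false)
lookup-idB i = VP.lookup∘tabulate _ i

·B-⊙ : ∀ {p} (x y : SPerm p) c → (x ·B y) ⊙ c ≡ x ⊙ y ⊙ c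
·B-⊙ x y (j , b) = cong₂ _,_ (cong proj₁ (lookup-·B x y j))
  (trans (cong (b xor_) (cong proj₂ (lookup-·B x y j))) (sym (xor-assoc b _ _)))

·B-assoc : ∀ {p} (x y z : SPerm p) → (x ·B y) ·B z ≡ x ·B (y ·B z)
·B-assoc x y z = lookup-ext _ _ λ i → begin
  lookup ((x ·B y) ·B z) i   ≡⟨ lookup-·B (x ·B y) z i ⟩
  (x ·B y) ⊙ lookup z i      ≡⟨ ·B-⊙ x y (lookup z i) ⟩
  x ⊙ y ⊙ lookup z i         ≡⟨ cong (x ⊙_) (lookup-·B y z i) ⟨
  x ⊙ lookup (y ·B z) i      ≡⟨ lookup-·B x (y ·B z) i ⟨
  lookup (x ·B (y ·B z)) i   ∎
  where open ≡-Reasoning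

·B-identityˡ : ∀ {p} (x : SPerm p) → idB ·B x ≡ x
·B-identityˡ x = lookup-ext _ _ λ i → trans (lookup-·B idB x i)
  (trans (cong (λ c → proj₁ c , (proj₂ (lookup x i) xor proj₂ c)) (lookup-idB (proj₁ (lookup x i))))
         (cong (proj₁ (lookup x i) ,_) (xor-identityʳ _)))

·B-identityʳ : ∀ {p} (x : SPerm p) → x ·B idB ≡ x
·B-identityʳ x = lookup-ext _ _ λ i → trans (lookup-·B x idB i) (cong (x ⊙_) (lookup-idB i))

IsSPerm-idB : ∀ {p} → IsSPerm (idB {p})
IsSPerm-idB {p} = subst (λ v → Unique (toList v)) (VP.tabulate-∘ proj₁ (λ i → i , false)) (IsPerm-idA {p})

negateLast : ∀ {m l} → Vec (Signed m) (suc l) → Vec (Signed m) (suc l)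
negateLast (a ∷ []) = flipSign a ∷ []
negateLast (a ∷ b ∷ v) = a ∷ negateLast (b ∷ v)

lastEntry : ∀ {A : Set} {l} → Vec A (suc l) → A
lastEntry (a ∷ []) = a
lastEntry (a ∷ b ∷ v) = lastEntry (b ∷ v)

lookup-negateLast : ∀ {m l} (x : Vec (Signed m) (suc l)) i →
  lookup (negateLast x) i ≡ (proj₁ (lookup x i) , ((suc (toℕ i) ≡ᵇ suc l) xor proj₂ (lookup x i)))
lookup-negateLast (a ∷ []) zero = refl
lookup-negateLast (a ∷ b ∷ v) zero = refl
lookup-negateLast (a ∷ b ∷ v) (suc i) = lookup-negateLast (b ∷ v) i

map-proj₁-negateLast : ∀ {m l} (x : Vec (Signed m) (suc l)) → V.map proj₁ (negateLast x) ≡ V.map proj₁ x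
map-proj₁-negateLast (a ∷ []) = refl
map-proj₁-negateLast (a ∷ b ∷ v) = cong (proj₁ a ∷_) (map-proj₁-negateLast (b ∷ v))

negateLast-involutive : ∀ {m l} (x : Vec (Signed m) (suc l)) → negateLast (negateLast x) ≡ x
negateLast-involutive ((a , b) ∷ []) = cong (λ c → (a , c) ∷ []) (not-involutive b)
negateLast-involutive (a ∷ b ∷ c ∷ v) = cong (a ∷_) (negateLast-involutive (b ∷ c ∷ v))
negateLast-involutive (a ∷ (b , c) ∷ []) = cong (λ d → a ∷ (b , d) ∷ []) (not-involutive c)

rB-last : ∀ p (j : Fin p) → (suc (toℕ j) ≡ᵇ p) ≡ true → rB p j ≡ V.tabulate (λ i → i , (suc (toℕ i) ≡ᵇ p))
rB-last p j eq rewrite eq = refl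

rB-adjacent : ∀ p (j : Fin p) → (suc (toℕ j) ≡ᵇ p) ≡ false → rB p j ≡ V.tabulate (λ i → adj (toℕ j) i , false)
rB-adjacent p j eq rewrite eq = refl

·rB≡negateLast : ∀ {l} (x : SPerm (suc l)) (j : Fin (suc l)) → (suc (toℕ j) ≡ᵇ suc l) ≡ true →
                 x ·B rB (suc l) j ≡ negateLast x
·rB≡negateLast {l} x j eq = trans (cong (x ·B_) (rB-last (suc l) j eq)) (lookup-ext _ _ λ i →
  trans (lookup-·B x r i)
    (trans (cong (x ⊙_) (VP.lookup∘tabulate (λ k → k , (suc (toℕ k) ≡ᵇ suc l)) i))
      (sym (lookup-negateLast x i))))
  where r = V.tabulate (λ i → i , (suc (toℕ i) ≡ᵇ suc l))

·rB≡swapAt : ∀ {p} (x : SPerm p) (j : Fin p) → (suc (toℕ j) ≡ᵇ p) ≡ false → x ·B rB p j ≡ swapAt (toℕ j) x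
·rB≡swapAt {p} x j eq = trans (cong (x ·B_) (rB-adjacent p j eq)) (lookup-ext _ _ λ i →
  trans (lookup-·B x r i)
    (trans (cong (x ⊙_) (VP.lookup∘tabulate (λ k → adj (toℕ j) k , false) i))
      (sym (lookup-swapAt (toℕ j) x i))))
  where r = V.tabulate (λ i → adj (toℕ j) i , false)

infixl 30 _‼_
_‼_ : ∀ {m l} → Vec (Signed (suc m)) l → ℕ → Signed (suc m)
v ‼ i = lookupℕ (zero , false) v i

-- a ≺ᵇ b decides a < b in the order +1 < +2 < ⋯ < +p < -p < ⋯ < -1 of signed letters,
-- which the folding ψ below turns into the order of ℕ.
_≺ᵇ_ : ∀ {m} → Signed m → Signed m → Bool
(j , false) ≺ᵇ (j′ , false) = toℕ j <ᵇ toℕ j′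
(j , false) ≺ᵇ (j′ , true) = true
(j , true) ≺ᵇ (j′ , false) = false
(j , true) ≺ᵇ (j′ , true) = toℕ j′ <ᵇ toℕ j

negPair : ∀ {m} → Signed m → Signed m → Bool
negPair (j , false) (j′ , false) = false
negPair (j , false) (j′ , true) = toℕ j′ <ᵇ toℕ j
negPair (j , true) (j′ , false) = toℕ j <ᵇ toℕ j′
negPair (j , true) (j′ , true) = true

invertedB : ∀ {m} → Signed m → Signed m → ℕ
invertedB h x = 𝟙 (x ≺ᵇ h) + 𝟙 (negPair h x)

open PairStatistic {Signed} invertedB (𝟙 ∘ proj₂) using ()
  renaming (rowSum to invRowB; pairStat to invB; pairStat-swapAt to invB-swapAt;
            pairStat-map to invB-map; pairStat-insertAt to invB-insertAt)

negPair-sym : ∀ {m} (a b : Signed m) → negPair a b ≡ negPair b a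
negPair-sym (j , false) (j′ , false) = refl
negPair-sym (j , false) (j′ , true) = refl
negPair-sym (j , true) (j′ , false) = refl
negPair-sym (j , true) (j′ , true) = refl

≺ᵇ-asym : ∀ {m} (a b : Signed m) → (a ≺ᵇ b) ≡ true → (b ≺ᵇ a) ≡ false
≺ᵇ-asym (j , false) (j′ , false) a≺b = <ᵇ-false (<⇒≤ (<ᵇ-true⁻¹ (toℕ j) (toℕ j′) a≺b))
≺ᵇ-asym (j , false) (j′ , true) _ = refl
≺ᵇ-asym (j , true) (j′ , true) a≺b = <ᵇ-false (<⇒≤ (<ᵇ-true⁻¹ (toℕ j′) (toℕ j) a≺b))

invertedB-swap≤ : ∀ {m} (a b : Signed m) → invertedB b a ≤ 1 + invertedB a b
invertedB-swap≤ a b rewrite negPair-sym b a =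
  ≤-trans (+-monoˡ-≤ (𝟙 (negPair a b)) (𝟙≤1 (a ≺ᵇ b))) (+-monoʳ-≤ 1 (m≤n+m _ _))

invertedB-descent : ∀ {m} (a b : Signed m) → (b ≺ᵇ a) ≡ true → invertedB a b ≡ 1 + invertedB b a
invertedB-descent a b b≺a rewrite b≺a | ≺ᵇ-asym b a b≺a | negPair-sym b a = refl

invertedB-flipSign : ∀ {m} (h x : Signed m) → invertedB h (flipSign x) ≡ invertedB h x
invertedB-flipSign (j , false) (j′ , false) = +-comm 0 (𝟙 (toℕ j′ <ᵇ toℕ j))
invertedB-flipSign (j , false) (j′ , true) = +-comm (𝟙 (toℕ j′ <ᵇ toℕ j)) 0
invertedB-flipSign (j , true) (j′ , false) = +-comm (𝟙 (toℕ j <ᵇ toℕ j′)) 1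
invertedB-flipSign (j , true) (j′ , true) = +-comm 1 (𝟙 (toℕ j <ᵇ toℕ j′))

invRowB-negateLast : ∀ {m l} (h : Signed m) (t : Vec (Signed m) (suc l)) → invRowB h (negateLast t) ≡ invRowB h t
invRowB-negateLast h (a ∷ []) = cong (_+ 0) (invertedB-flipSign h a)
invRowB-negateLast h (a ∷ b ∷ t) = cong (invertedB h a +_) (invRowB-negateLast h (b ∷ t))

invB-negateLast : ∀ {m l} (x : Vec (Signed m) (suc l)) →
  invB (negateLast x) + 𝟙 (proj₂ (lastEntry x)) ≡ invB x + 𝟙 (not (proj₂ (lastEntry x)))
invB-negateLast ((j , false) ∷ []) = refl
invB-negateLast ((j , true) ∷ []) = refl
invB-negateLast (a ∷ b ∷ x) = begin
  r′ + s + invB (negateLast (b ∷ x)) + c  ≡⟨ cong (λ r → r + s + invB (negateLast (b ∷ x)) + c) (invRowB-negateLast a (b ∷ x)) ⟩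
  r + s + invB (negateLast (b ∷ x)) + c   ≡⟨ +-assoc (r + s) _ c ⟩
  r + s + (invB (negateLast (b ∷ x)) + c) ≡⟨ cong (r + s +_) (invB-negateLast (b ∷ x)) ⟩
  r + s + (invB (b ∷ x) + c′)             ≡⟨ +-assoc (r + s) _ c′ ⟨
  r + s + invB (b ∷ x) + c′               ∎
  where
    open ≡-Reasoning
    r′ = invRowB a (negateLast (b ∷ x))
    r = invRowB a (b ∷ x)
    s = 𝟙 (proj₂ a)
    c = 𝟙 (proj₂ (lastEntry (b ∷ x)))
    c′ = 𝟙 (not (proj₂ (lastEntry (b ∷ x))))

Positive : ∀ {m} → Signed m → Set
Positive u = proj₂ u ≡ false

invB≡0⇒positive : ∀ {m l} (t : Vec (Signed m) l) → invB t ≡ 0 → All Positive (toList t)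
invB≡0⇒positive [] _ = []
invB≡0⇒positive ((j , false) ∷ t) invB≡0 = refl ∷ invB≡0⇒positive t (m+n≡0⇒n≡0 (invRowB (j , false) t + 0) invB≡0)
invB≡0⇒positive ((j , true) ∷ t) invB≡0 =
  contradiction (m+n≡0⇒n≡0 (invRowB (j , true) t) (m+n≡0⇒m≡0 _ invB≡0)) λ ()

invRowB≡0⇒All≤ : ∀ {m l} (j : Fin m) (t : Vec (Signed m) l) → All Positive (toList t) →
                 invRowB (j , false) t ≡ 0 → All (λ u → toℕ j ≤ toℕ (proj₁ u)) (toList t)
invRowB≡0⇒All≤ j [] _ _ = []
invRowB≡0⇒All≤ j ((j′ , .false) ∷ t) (refl ∷ pos) row≡0 with toℕ j′ <ᵇ toℕ j in j′<j
... | false = <ᵇ-false⁻¹ _ _ j′<j ∷ invRowB≡0⇒All≤ j t pos (m+n≡0⇒n≡0 _ row≡0)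

All≤⇒invRowB≡0 : ∀ {m l} (j : Fin m) (t : Vec (Signed m) l) → All Positive (toList t) →
                 All (λ u → toℕ j ≤ toℕ (proj₁ u)) (toList t) → invRowB (j , false) t ≡ 0
All≤⇒invRowB≡0 j [] _ _ = refl
All≤⇒invRowB≡0 j ((j′ , .false) ∷ t) (refl ∷ pos) (j≤j′ ∷ j≤t) =
  cong₂ (λ b r → 𝟙 b + 0 + r) (<ᵇ-false j≤j′) (All≤⇒invRowB≡0 j t pos j≤t)

-- a right descent of x: at r_p, or at the adjacent transposition r_{k+1}
HasDescentB : ∀ {m l} → Vec (Signed (suc m)) (suc l) → Set
HasDescentB {l = l} x = (proj₂ (lastEntry x) ≡ true)
  ⊎ Σ ℕ λ k → suc k < suc l × (x ‼ suc k ≺ᵇ x ‼ k) ≡ true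

invB≡0-cons : ∀ {m l} (h h′ : Signed (suc m)) (t : Vec (Signed (suc m)) l) → (h′ ≺ᵇ h) ≡ false →
              invB (h′ ∷ t) ≡ 0 → invB (h ∷ h′ ∷ t) ≡ 0
invB≡0-cons h h′ t h′⊀h invB≡0 with invB≡0⇒positive (h′ ∷ t) invB≡0
invB≡0-cons (j , true) (j′ , .false) t () invB≡0 | refl ∷ pos
invB≡0-cons (j , false) (j′ , .false) t h′⊀h invB≡0 | refl ∷ pos =
  cong₂ (λ r s → r + 0 + s) row≡0 invB≡0
  where
    j≤t : All (λ u → toℕ j ≤ toℕ (proj₁ u)) (toList t)
    j≤t = All.map (≤-trans (<ᵇ-false⁻¹ _ _ h′⊀h)) (invRowB≡0⇒All≤ j′ t pos (m+n≡0⇒m≡0 _ (m+n≡0⇒m≡0 _ invB≡0)))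
    row≡0 : invRowB (j , false) ((j′ , false) ∷ t) ≡ 0
    row≡0 = cong₂ (λ b r → 𝟙 b + 0 + r) h′⊀h (All≤⇒invRowB≡0 j t pos j≤t)

descentB-cons : ∀ {m l} (h h′ : Signed (suc m)) (t : Vec (Signed (suc m)) l) → invB (h ∷ h′ ∷ t) ≢ 0 →
                (invB (h′ ∷ t) ≢ 0 → HasDescentB (h′ ∷ t)) → HasDescentB (h ∷ h′ ∷ t)
descentB-cons h h′ t invB≢0 descent-t with invB (h′ ∷ t) ℕ.≟ 0
... | no invB-t≢0 with descent-t invB-t≢0
...   | inj₁ last-neg = inj₁ last-neg
...   | inj₂ (k , k<l , desc) = inj₂ (suc k , s≤s k<l , desc)
descentB-cons h h′ t invB≢0 descent-t | yes invB-t≡0 with (h′ ≺ᵇ h) Bool.≟ true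
...   | yes h′≺h = inj₂ (zero , s≤s (s≤s z≤n) , h′≺h)
...   | no h′⊀h = contradiction (invB≡0-cons h h′ t (¬-not h′⊀h) invB-t≡0) invB≢0

invB≢0⇒descent : ∀ {m l} (x : Vec (Signed (suc m)) (suc l)) → invB x ≢ 0 → HasDescentB x
invB≢0⇒descent ((j , true) ∷ []) _ = inj₁ refl
invB≢0⇒descent ((j , false) ∷ []) invB≢0 = contradiction refl invB≢0
invB≢0⇒descent (h ∷ h′ ∷ t) invB≢0 = descentB-cons h h′ t invB≢0 (invB≢0⇒descent (h′ ∷ t))

invB-positive : ∀ {m l} (v : Vec (Signed m) l) → All Positive (toList v) → invB v ≡ inv (V.map proj₁ v)
invB-positive [] _ = refl
invB-positive ((j , .false) ∷ t) (refl ∷ pos) = cong₂ (λ r s → r + 0 + s) (invRowB-positive t pos) (invB-positive t pos)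
  where
    invRowB-positive : ∀ {l} (t : Vec _ l) → All Positive (toList t) → invRowB (j , false) t ≡ invRow j (V.map proj₁ t)
    invRowB-positive [] _ = refl
    invRowB-positive ((j′ , .false) ∷ t) (refl ∷ pos) = cong₂ _+_ (+-identityʳ _) (invRowB-positive t pos)

invB≡0⇒idB : ∀ {p} (v : SPerm p) → IsSPerm v → invB v ≡ 0 → v ≡ idB
invB≡0⇒idB v v-perm invB≡0 = lookup-ext _ _ λ i → begin
  lookup v i                         ≡⟨ cong₂ _,_ (sym (VP.lookup-map i proj₁ v)) (All-toList⁻ v pos i) ⟩
  (lookup (V.map proj₁ v) i , false) ≡⟨ cong (λ w → lookup w i , false) proj₁-v≡idA ⟩
  (lookup idA i , false)             ≡⟨ cong (_, false) (lookup-idA i) ⟩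
  (i , false)                        ≡⟨ lookup-idB i ⟨
  lookup idB i                       ∎
  where
    open ≡-Reasoning
    pos = invB≡0⇒positive v invB≡0
    proj₁-v≡idA : V.map proj₁ v ≡ idA
    proj₁-v≡idA = inv≡0⇒idA (V.map proj₁ v) v-perm (trans (sym (invB-positive v pos)) invB≡0)

positive-idB : ∀ {p} → All Positive (toList (idB {p}))
positive-idB = All-toList⁺ idB λ i → cong proj₂ (lookup-idB i)

invB-idB : ∀ p → invB (idB {p}) ≡ 0
invB-idB p = begin
  invB {p} (idB {p})          ≡⟨ invB-positive {p} idB positive-idB ⟩
  inv (V.map proj₁ (idB {p})) ≡⟨ cong inv (VP.tabulate-∘ proj₁ (λ (i : Fin p) → i , false)) ⟨
  inv (idA {p})               ≡⟨ inv-idA p ⟩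
  0                           ∎
  where open ≡-Reasoning

rB-cases : ∀ {l} (j : Fin (suc l)) → (suc (toℕ j) ≡ᵇ suc l) ≡ true ⊎ (suc (toℕ j) ≡ᵇ suc l) ≡ false
rB-cases {l} j with suc (toℕ j) ≡ᵇ suc l
... | true = inj₁ refl
... | false = inj₂ refl

≡ᵇ-false⇒< : ∀ {l} (j : Fin (suc l)) → (suc (toℕ j) ≡ᵇ suc l) ≡ false → suc (toℕ j) < suc l
≡ᵇ-false⇒< j eq = ≤∧≢⇒< (Fin.toℕ<n j) (≡ᵇ-false⁻¹ _ _ eq)

IsSPerm-swapAt : ∀ {p} k (x : SPerm p) → IsSPerm x → IsSPerm (swapAt k x)
IsSPerm-swapAt k x x-perm =
  subst (λ w → Unique (toList w)) (sym (map-swapAt proj₁ k x)) (Unique-swapAt k (V.map proj₁ x) x-perm)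

IsSPerm-negateLast : ∀ {l} (x : SPerm (suc l)) → IsSPerm x → IsSPerm (negateLast x)
IsSPerm-negateLast x = subst (λ w → Unique (toList w)) (sym (map-proj₁-negateLast x))

IsSPerm-·rB : ∀ {l} (x : SPerm (suc l)) j → IsSPerm x → IsSPerm (x ·B rB (suc l) j)
IsSPerm-·rB x j x-perm with rB-cases j
... | inj₁ last = subst IsSPerm (sym (·rB≡negateLast x j last)) (IsSPerm-negateLast x x-perm)
... | inj₂ adjacent = subst IsSPerm (sym (·rB≡swapAt x j adjacent)) (IsSPerm-swapAt (toℕ j) x x-perm)

·rB-involutive : ∀ {l} (x : SPerm (suc l)) j → (x ·B rB (suc l) j) ·B rB (suc l) j ≡ x
·rB-involutive x j with rB-cases j
... | inj₁ last = trans (cong (_·B rB _ j) (·rB≡negateLast x j last))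
                        (trans (·rB≡negateLast (negateLast x) j last) (negateLast-involutive x))
... | inj₂ adjacent = trans (cong (_·B rB _ j) (·rB≡swapAt x j adjacent))
                        (trans (·rB≡swapAt (swapAt (toℕ j) x) j adjacent) (swapAt-involutive (toℕ j) x))

invB-swapAt-descent : ∀ {m l} (x : Vec (Signed (suc m)) l) k → suc k < l →
  (x ‼ suc k ≺ᵇ x ‼ k) ≡ true → invB (swapAt k x) + 1 ≡ invB x
invB-swapAt-descent x k k<l b≺a = +-cancelʳ-≡ (invertedB b a) _ _ (begin
  invB (swapAt k x) + 1 + invertedB b a   ≡⟨ +-assoc (invB (swapAt k x)) 1 _ ⟩
  invB (swapAt k x) + (1 + invertedB b a) ≡⟨ cong (invB (swapAt k x) +_) (invertedB-descent a b b≺a) ⟨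
  invB (swapAt k x) + invertedB a b       ≡⟨ invB-swapAt (zero , false) k x k<l ⟩
  invB x + invertedB b a                  ∎)
  where
    open ≡-Reasoning
    a = x ‼ k
    b = x ‼ suc k

invB-negateLast-descent : ∀ {m l} (x : Vec (Signed m) (suc l)) → proj₂ (lastEntry x) ≡ true →
                          invB (negateLast x) + 1 ≡ invB x
invB-negateLast-descent x last-neg = begin
  invB (negateLast x) + 1                       ≡⟨ cong (λ b → invB (negateLast x) + 𝟙 b) last-neg ⟨
  invB (negateLast x) + 𝟙 (proj₂ (lastEntry x)) ≡⟨ invB-negateLast x ⟩
  invB x + 𝟙 (not (proj₂ (lastEntry x)))        ≡⟨ cong (λ b → invB x + 𝟙 (not b)) last-neg ⟩
  invB x + 0                                    ≡⟨ +-identityʳ (invB x) ⟩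
  invB x                                        ∎
  where open ≡-Reasoning

invB-·rB≤ : ∀ {l} (x : SPerm (suc l)) j → invB (x ·B rB (suc l) j) ≤ suc (invB x)
invB-·rB≤ x j with rB-cases j
... | inj₁ last = subst (λ y → invB y ≤ suc (invB x)) (sym (·rB≡negateLast x j last)) (begin
  invB (negateLast x)                           ≤⟨ m≤m+n _ _ ⟩
  invB (negateLast x) + 𝟙 (proj₂ (lastEntry x)) ≡⟨ invB-negateLast x ⟩
  invB x + 𝟙 (not (proj₂ (lastEntry x)))        ≤⟨ +-monoʳ-≤ (invB x) (𝟙≤1 _) ⟩
  invB x + 1                                    ≡⟨ +-comm (invB x) 1 ⟩
  suc (invB x)                                  ∎)
  where open ≤-Reasoning
... | inj₂ adjacent = subst (λ y → invB y ≤ suc (invB x)) (sym (·rB≡swapAt x j adjacent))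
  (+-cancelʳ-≤ (invertedB a b) _ _ (begin
    invB (swapAt k x) + invertedB a b ≡⟨ invB-swapAt (zero , false) k x (≡ᵇ-false⇒< j adjacent) ⟩
    invB x + invertedB b a            ≤⟨ +-monoʳ-≤ (invB x) (invertedB-swap≤ a b) ⟩
    invB x + (1 + invertedB a b)      ≡⟨ +-assoc (invB x) 1 _ ⟨
    invB x + 1 + invertedB a b        ≡⟨ cong (_+ invertedB a b) (+-comm (invB x) 1) ⟩
    suc (invB x) + invertedB a b      ∎))
  where
    open ≤-Reasoning
    k = toℕ j
    a = x ‼ k
    b = x ‼ suc k

invB-descent : ∀ {l} (x : SPerm (suc l)) m → IsSPerm x → invB x ≡ suc m →
               Σ (Fin (suc l)) λ j → invB (x ·B rB (suc l) j) ≡ m × (x ·B rB (suc l) j) ·B rB (suc l) j ≡ x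
invB-descent {l} x m _ invB≡1+m with invB≢0⇒descent x (λ invB≡0 → 1+n≢0 (trans (sym invB≡1+m) invB≡0))
... | inj₁ last-neg = j , +-cancelʳ-≡ 1 _ _ (begin
  invB (x ·B rB (suc l) j) + 1 ≡⟨ cong (λ y → invB y + 1) (·rB≡negateLast x j last) ⟩
  invB (negateLast x) + 1      ≡⟨ invB-negateLast-descent x last-neg ⟩
  invB x                       ≡⟨ trans invB≡1+m (+-comm 1 m) ⟩
  m + 1                        ∎) , ·rB-involutive x j
  where
    open ≡-Reasoning
    j = fromℕ l
    last : (suc (toℕ j) ≡ᵇ suc l) ≡ true
    last = trans (cong (λ i → suc i ≡ᵇ suc l) (Fin.toℕ-fromℕ l)) (≡ᵇ-refl (suc l))
... | inj₂ (k , s≤s k<l , b≺a) = j , +-cancelʳ-≡ 1 _ _ (begin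
  invB (x ·B rB (suc l) j) + 1 ≡⟨ cong (λ y → invB y + 1) (trans (·rB≡swapAt x j adjacent) (cong (λ i → swapAt i x) toℕ-j)) ⟩
  invB (swapAt k x) + 1        ≡⟨ invB-swapAt-descent x k (s≤s k<l) b≺a ⟩
  invB x                       ≡⟨ trans invB≡1+m (+-comm 1 m) ⟩
  m + 1                        ∎) , ·rB-involutive x j
  where
    open ≡-Reasoning
    j = fromℕ< (m<n⇒m<1+n k<l)
    toℕ-j : toℕ j ≡ k
    toℕ-j = Fin.toℕ-fromℕ< (m<n⇒m<1+n k<l)
    adjacent : (suc (toℕ j) ≡ᵇ suc l) ≡ false
    adjacent = trans (cong (λ i → suc i ≡ᵇ suc l) toℕ-j) (≡ᵇ-false (<⇒≢ k<l))

module WordLengthB (l : ℕ) = WordLength _·B_ idB (rB (suc l)) ·B-assoc ·B-identityˡ ·B-identityʳ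
  IsSPerm IsSPerm-·rB invB (invB-idB (suc l)) invB-·rB≤ (invB-descent {l}) invB≡0⇒idB

length≡invB : ∀ l (ℓB : SPerm (suc l) → ℕ) → IsLengthFunction (evalB (suc l)) IsSPerm ℓB →
              ∀ x → IsSPerm x → ℓB x ≡ invB x
length≡invB l = WordLengthB.length≡stat l

-- The folding ψ

fold : ℕ → ∀ {m} → Signed m → ℕ
fold n (j , false) = toℕ j
fold n (j , true) = n ∸ toℕ j

fold-flipSign : ∀ n {m} (a : Signed m) → toℕ (proj₁ a) ≤ n → fold n (flipSign a) ≡ n ∸ fold n a
fold-flipSign n (j , false) _ = refl
fold-flipSign n (j , true) j≤n = sym (m∸[m∸n]≡n j≤n)

fold≤ : ∀ n {m} (a : Signed m) → toℕ (proj₁ a) ≤ n → fold n a ≤ n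
fold≤ n (j , false) j≤n = j≤n
fold≤ n (j , true) _ = m∸n≤m n (toℕ j)

‼-negateLast : ∀ {m l} (x : Vec (Signed (suc m)) (suc l)) a → a ≢ l → negateLast x ‼ a ≡ x ‼ a
‼-negateLast (u ∷ []) zero a≢0 = contradiction refl a≢0
‼-negateLast (u ∷ []) (suc a) _ = refl
‼-negateLast (u ∷ w ∷ x) zero _ = refl
‼-negateLast (u ∷ w ∷ x) (suc a) a≢l = ‼-negateLast (w ∷ x) a (a≢l ∘ cong suc)

‼-negateLast-last : ∀ {m l} (x : Vec (Signed (suc m)) (suc l)) → negateLast x ‼ l ≡ flipSign (x ‼ l)
‼-negateLast-last (u ∷ []) = refl
‼-negateLast-last (u ∷ w ∷ x) = ‼-negateLast-last (w ∷ x)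

‼-last : ∀ {m l} (x : Vec (Signed (suc m)) (suc l)) → x ‼ l ≡ lastEntry x
‼-last (u ∷ []) = refl
‼-last (u ∷ w ∷ x) = ‼-last (w ∷ x)

toℕ-‼< : ∀ {m l} (v : Vec (Signed (suc m)) l) a → toℕ (proj₁ (v ‼ a)) < suc m
toℕ-‼< [] a = s≤s z≤n
toℕ-‼< (u ∷ v) zero = Fin.toℕ<n (proj₁ u)
toℕ-‼< (u ∷ v) (suc a) = toℕ-‼< v a

fold-idB : ∀ n {l} a → a < suc l → fold n (idB {suc l} ‼ a) ≡ a
fold-idB n a a<p = trans (cong (fold n) (lookupℕ-tabulate (zero , false) (λ i → i , false) a a<p)) (Fin.toℕ-fromℕ< a<p)

-- ψ v is the permutation of {0, …, n} commuting with i ↦ n ∸ i whose first p values are read off v: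
-- +(j + 1) becomes j and -(j + 1) becomes n ∸ j.  For n = 2p the middle point p is fixed.
ψℕ : ℕ → ∀ {l} → SPerm (suc l) → ℕ → ℕ
ψℕ n {l} v i = if i <ᵇ suc l then fold n (v ‼ i)
               else (if n <ᵇ i + suc l then n ∸ fold n (v ‼ (n ∸ i)) else i)

-- junk value zero outside 0 … n
toFin : (n : ℕ) → ℕ → Fin (suc n)
toFin n zero = zero
toFin zero (suc k) = zero
toFin (suc n) (suc k) = suc (toFin n k)

toℕ-toFin : ∀ n k → k ≤ n → toℕ (toFin n k) ≡ k
toℕ-toFin n zero _ = refl
toℕ-toFin (suc n) (suc k) (s≤s k≤n) = cong suc (toℕ-toFin n k k≤n)

toFin-toℕ : ∀ n (i : Fin (suc n)) → toFin n (toℕ i) ≡ i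
toFin-toℕ n i = Fin.toℕ-injective (toℕ-toFin n (toℕ i) (s≤s⁻¹ (Fin.toℕ<n i)))

ψ : ∀ n {l} → SPerm (suc l) → Perm (suc n)
ψ n v = V.tabulate (λ i → toFin n (ψℕ n v (toℕ i)))

lookup-ψ : ∀ n {l} (v : SPerm (suc l)) i → lookup (ψ n v) i ≡ toFin n (ψℕ n v (toℕ i))
lookup-ψ n v i = VP.lookup∘tabulate (λ i → toFin n (ψℕ n v (toℕ i))) i

toℕ-lookup-sN : ∀ {n} k (i : Fin (suc n)) → k < n → toℕ (lookup (sN {suc n} k) i) ≡ transpose k (toℕ i)
toℕ-lookup-sN k i k<n = trans (cong toℕ (VP.lookup∘tabulate (adj k) i)) (toℕ-adj k i (s≤s k<n))

ψ≡ψ·A : ∀ n {l} (x y : SPerm (suc l)) (g : Perm (suc n)) (f : ℕ → ℕ) →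
  (∀ i → toℕ (lookup g i) ≡ f (toℕ i)) → (∀ i → i ≤ n → ψℕ n y i ≡ ψℕ n x (f i)) → ψ n y ≡ ψ n x ·A g
ψ≡ψ·A n x y g f g≗f y≗x∘f = lookup-ext _ _ λ i → begin
  lookup (ψ n y) i                    ≡⟨ lookup-ψ n y i ⟩
  toFin n (ψℕ n y (toℕ i))            ≡⟨ cong (toFin n) (y≗x∘f (toℕ i) (s≤s⁻¹ (Fin.toℕ<n i))) ⟩
  toFin n (ψℕ n x (f (toℕ i)))        ≡⟨ cong (λ k → toFin n (ψℕ n x k)) (g≗f i) ⟨
  toFin n (ψℕ n x (toℕ (lookup g i))) ≡⟨ lookup-ψ n x (lookup g i) ⟨
  lookup (ψ n x) (lookup g i)         ≡⟨ lookup-·A (ψ n x) g i ⟨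
  lookup (ψ n x ·A g) i               ∎
  where open ≡-Reasoning

module Folding (l n : ℕ) (parity : n ≡ l + suc l ⊎ n ≡ suc l + suc l) where

  p : ℕ
  p = suc l

  p+l≡2p-1 : p + l ≡ l + suc l
  p+l≡2p-1 = sym (+-suc l l)

  p+l≤n : p + l ≤ n
  p+l≤n = ≤-trans (≤-reflexive p+l≡2p-1)
    ([ ≤-reflexive ∘ sym , (λ n≡2p → ≤-trans (n≤1+n _) (≤-reflexive (sym n≡2p))) ]′ parity)

  n≤p+p : n ≤ p + p
  n≤p+p = [ (λ n≡2p-1 → ≤-trans (≤-reflexive n≡2p-1) (n≤1+n _)) , ≤-reflexive ]′ parity

  p≤n : p ≤ n
  p≤n = ≤-trans (m≤m+n p l) p+l≤n

  l<n : l < n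
  l<n = p≤n

  data Region (i : ℕ) : Set where
    left : i < p → Region i
    right : ∀ a → a < p → i + a ≡ n → Region i
    middle : i ≡ p → n ≡ p + p → Region i

  right⇒p≤ : ∀ {i a} → a < p → i + a ≡ n → p ≤ i
  right⇒p≤ {i} {a} (s≤s a≤l) i+a≡n = +-cancelʳ-≤ a p i (begin
    p + a ≤⟨ +-monoʳ-≤ p a≤l ⟩
    p + l ≤⟨ p+l≤n ⟩
    n     ≡⟨ i+a≡n ⟨
    i + a ∎)
    where open ≤-Reasoning

  region : ∀ i → i ≤ n → Region i
  region i i≤n with i ℕ.<? p
  ... | yes i<p = left i<p
  ... | no i≮p with (n ∸ i) ℕ.<? p
  ...   | yes n-i<p = right (n ∸ i) n-i<p (m+[n∸m]≡n i≤n)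
  ...   | no n-i≮p = middle i≡p n≡p+p
    where
      i+p≤n : i + p ≤ n
      i+p≤n = ≤-trans (+-monoʳ-≤ i (≮⇒≥ n-i≮p)) (≤-reflexive (m+[n∸m]≡n i≤n))
      n≡p+p : n ≡ p + p
      n≡p+p = ≤-antisym n≤p+p (≤-trans (+-monoˡ-≤ p (≮⇒≥ i≮p)) i+p≤n)
      i≡p : i ≡ p
      i≡p = ≤-antisym (+-cancelʳ-≤ p i p (≤-trans i+p≤n (≤-reflexive n≡p+p))) (≮⇒≥ i≮p)

  ψℕ-left : ∀ (v : SPerm p) i → i < p → ψℕ n v i ≡ fold n (v ‼ i)
  ψℕ-left v i i<p rewrite <ᵇ-true i<p = refl

  ψℕ-right : ∀ (v : SPerm p) i a → a < p → i + a ≡ n → ψℕ n v i ≡ n ∸ fold n (v ‼ a)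
  ψℕ-right v i a a<p i+a≡n
    rewrite <ᵇ-false {i} {p} (right⇒p≤ a<p i+a≡n) | <ᵇ-true {n} {i + p} (subst (_< i + p) i+a≡n (+-monoʳ-< i a<p)) =
    cong (λ k → n ∸ fold n (v ‼ k)) (trans (cong (_∸ i) (sym i+a≡n)) (m+n∸m≡n i a))

  ψℕ-middle : ∀ (v : SPerm p) → n ≡ p + p → ψℕ n v p ≡ p
  ψℕ-middle v n≡p+p rewrite <ᵇ-false {p} {p} ≤-refl | <ᵇ-false {n} {p + p} (≤-reflexive (sym n≡p+p)) = refl

  toℕ-‼≤n : ∀ {l′} (v : Vec (Signed p) l′) a → toℕ (proj₁ (v ‼ a)) ≤ n
  toℕ-‼≤n v a = ≤-trans (<⇒≤ (toℕ-‼< v a)) p≤n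

  ψℕ≤n : ∀ (v : SPerm p) i → i ≤ n → ψℕ n v i ≤ n
  ψℕ≤n v i i≤n with region i i≤n
  ... | left i<p = subst (_≤ n) (sym (ψℕ-left v i i<p)) (fold≤ n (v ‼ i) (toℕ-‼≤n v i))
  ... | right a a<p i+a≡n = subst (_≤ n) (sym (ψℕ-right v i a a<p i+a≡n)) (m∸n≤m n (fold n (v ‼ a)))
  ... | middle refl n≡p+p = subst (_≤ n) (sym (ψℕ-middle v n≡p+p)) p≤n

  toℕ-ψ‼ : ∀ (v : SPerm p) i → i ≤ n → toℕ (lookupℕ zero (ψ n v) i) ≡ ψℕ n v i
  toℕ-ψ‼ v i i≤n = begin
    toℕ (lookupℕ zero (ψ n v) i)
      ≡⟨ cong toℕ (lookupℕ-tabulate zero (λ k → toFin n (ψℕ n v (toℕ k))) i (s≤s i≤n)) ⟩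
    toℕ (toFin n (ψℕ n v (toℕ (fromℕ< (s≤s i≤n)))))
      ≡⟨ cong (λ k → toℕ (toFin n (ψℕ n v k))) (Fin.toℕ-fromℕ< (s≤s i≤n)) ⟩
    toℕ (toFin n (ψℕ n v i))
      ≡⟨ toℕ-toFin n _ (ψℕ≤n v i i≤n) ⟩
    ψℕ n v i ∎
    where open ≡-Reasoning

  ψℕ-idB : ∀ i → i ≤ n → ψℕ n (idB {p}) i ≡ i
  ψℕ-idB i i≤n with region i i≤n
  ... | left i<p = trans (ψℕ-left (idB {p}) i i<p) (fold-idB n i i<p)
  ... | right a a<p i+a≡n = begin
    ψℕ n (idB {p}) i         ≡⟨ ψℕ-right (idB {p}) i a a<p i+a≡n ⟩
    n ∸ fold n (idB {p} ‼ a) ≡⟨ cong (n ∸_) (fold-idB n a a<p) ⟩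
    n ∸ a                    ≡⟨ cong (_∸ a) i+a≡n ⟨
    i + a ∸ a                ≡⟨ m+n∸n≡m i a ⟩
    i                        ∎
    where open ≡-Reasoning
  ... | middle refl n≡p+p = ψℕ-middle (idB {p}) n≡p+p

  ψ-idB : ψ n (idB {p}) ≡ idA
  ψ-idB = lookup-ext _ _ λ i → begin
    lookup (ψ n (idB {p})) i         ≡⟨ lookup-ψ n (idB {p}) i ⟩
    toFin n (ψℕ n (idB {p}) (toℕ i)) ≡⟨ cong (toFin n) (ψℕ-idB (toℕ i) (s≤s⁻¹ (Fin.toℕ<n i))) ⟩
    toFin n (toℕ i)                  ≡⟨ toFin-toℕ n i ⟩
    i                                ≡⟨ lookup-idA i ⟨
    lookup idA i                     ∎
    where open ≡-Reasoning

  -- Swapping positions k, k + 1 of x swaps the positions k, k + 1 and their mirror images K, K + 1 of ψ x.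
  module MirroredSwap (k : ℕ) (2+k≤p : suc (suc k) ≤ p) where
    K : ℕ
    K = n ∸ suc k

    p+1+k≤n : p + suc k ≤ n
    p+1+k≤n = ≤-trans (+-monoʳ-≤ p (s≤s⁻¹ 2+k≤p)) p+l≤n

    K+1+k≡n : K + suc k ≡ n
    K+1+k≡n = m∸n+n≡m (≤-trans (m≤n+m (suc k) p) p+1+k≤n)

    p≤K : p ≤ K
    p≤K = +-cancelʳ-≤ (suc k) p K (≤-trans p+1+k≤n (≤-reflexive (sym K+1+k≡n)))

    k<n : k < n
    k<n = ≤-trans (≤-trans (n≤1+n _) 2+k≤p) p≤n

    K<n : K < n
    K<n = ≤-trans (s≤s (m≤m+n K k)) (≤-reflexive (trans (sym (+-suc K k)) K+1+k≡n))

    middle⇒p<K : n ≡ p + p → p < K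
    middle⇒p<K n≡p+p = +-cancelʳ-≤ (suc k) (suc p) K (begin
      suc p + suc k ≤⟨ +-monoʳ-≤ (suc p) (s≤s⁻¹ 2+k≤p) ⟩
      suc p + l     ≡⟨ cong suc p+l≡2p-1 ⟩
      p + p         ≡⟨ n≡p+p ⟨
      n             ≡⟨ K+1+k≡n ⟨
      K + suc k     ∎)
      where open ≤-Reasoning

    transpose-k< : ∀ a → a < p → transpose k a < p
    transpose-k< a a<p with transpose-cases k a
    ... | inj₁ (_ , eq) = subst (_< p) (sym eq) 2+k≤p
    ... | inj₂ (inj₁ (_ , eq)) = subst (_< p) (sym eq) (<-trans (n<1+n k) 2+k≤p)
    ... | inj₂ (inj₂ (_ , _ , eq)) = subst (_< p) (sym eq) a<p

    transpose-K-mirror : ∀ i a → i + a ≡ n → transpose K i + transpose k a ≡ n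
    transpose-K-mirror i a i+a≡n with transpose-cases k a
    ... | inj₁ (refl , eq) = trans (cong₂ _+_ (trans (cong (transpose K) i≡1+K) (transpose-suc-k K)) eq) K+1+k≡n
      where
        i≡1+K : i ≡ suc K
        i≡1+K = +-cancelʳ-≡ a i (suc K) (trans i+a≡n (trans (sym K+1+k≡n) (+-suc K a)))
    ... | inj₂ (inj₁ (refl , eq)) = trans (cong₂ _+_ (trans (cong (transpose K) i≡K) (transpose-k K)) eq)
                                          (trans (sym (+-suc K k)) K+1+k≡n)
      where
        i≡K : i ≡ K
        i≡K = +-cancelʳ-≡ a i K (trans i+a≡n (sym K+1+k≡n))
    ... | inj₂ (inj₂ (a≢k , a≢1+k , eq)) = trans (cong₂ _+_ (transpose-fix i≢K i≢1+K) eq) i+a≡n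
      where
        i≢K : i ≢ K
        i≢K i≡K = a≢1+k (+-cancelˡ-≡ i a (suc k) (trans i+a≡n (trans (sym K+1+k≡n) (cong (_+ suc k) (sym i≡K)))))
        i≢1+K : i ≢ suc K
        i≢1+K i≡1+K = a≢k (+-cancelˡ-≡ (suc K) a k
          (trans (cong (_+ a) (sym i≡1+K)) (trans i+a≡n (trans (sym K+1+k≡n) (+-suc K k)))))

    ψℕ-swapAt : ∀ (x : SPerm p) i → i ≤ n → ψℕ n (swapAt k x) i ≡ ψℕ n x (transpose k (transpose K i))
    ψℕ-swapAt x i i≤n with region i i≤n
    ... | left i<p = begin
      ψℕ n (swapAt k x) i                  ≡⟨ ψℕ-left (swapAt k x) i i<p ⟩
      fold n (swapAt k x ‼ i)              ≡⟨ cong (fold n) (lookupℕ-swapAt (zero , false) k x 2+k≤p i) ⟩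
      fold n (x ‼ transpose k i)           ≡⟨ ψℕ-left x (transpose k i) (transpose-k< i i<p) ⟨
      ψℕ n x (transpose k i)               ≡⟨ cong (λ j → ψℕ n x (transpose k j)) (transpose-fix< (<-≤-trans i<p p≤K)) ⟨
      ψℕ n x (transpose k (transpose K i)) ∎
      where open ≡-Reasoning
    ... | right a a<p i+a≡n = begin
      ψℕ n (swapAt k x) i            ≡⟨ ψℕ-right (swapAt k x) i a a<p i+a≡n ⟩
      n ∸ fold n (swapAt k x ‼ a)    ≡⟨ cong (λ c → n ∸ fold n c) (lookupℕ-swapAt (zero , false) k x 2+k≤p a) ⟩
      n ∸ fold n (x ‼ transpose k a) ≡⟨ ψℕ-right x i′ (transpose k a) (transpose-k< a a<p) i′+a′≡n ⟨
      ψℕ n x i′                      ≡⟨ cong (ψℕ n x) (transpose-fix> (<-≤-trans 2+k≤p (right⇒p≤ a′<p i′+a′≡n))) ⟨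
      ψℕ n x (transpose k i′)        ∎
      where
        open ≡-Reasoning
        i′ = transpose K i
        i′+a′≡n = transpose-K-mirror i a i+a≡n
        a′<p = transpose-k< a a<p
    ... | middle refl n≡p+p = begin
      ψℕ n (swapAt k x) p                  ≡⟨ ψℕ-middle (swapAt k x) n≡p+p ⟩
      p                                    ≡⟨ ψℕ-middle x n≡p+p ⟨
      ψℕ n x p                             ≡⟨ cong (ψℕ n x) (transpose-fix> 2+k≤p) ⟨
      ψℕ n x (transpose k p)               ≡⟨ cong (λ j → ψℕ n x (transpose k j)) (transpose-fix< p<K) ⟨
      ψℕ n x (transpose k (transpose K p)) ∎
      where
        open ≡-Reasoning
        p<K = middle⇒p<K n≡p+p

    ψ-swapAt : ∀ (x : SPerm p) → ψ n (swapAt k x) ≡ ψ n x ·A (sN k ·A sN K)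
    ψ-swapAt x = ψ≡ψ·A n x (swapAt k x) (sN k ·A sN K) (λ i → transpose k (transpose K i)) sN·sN≗ (ψℕ-swapAt x)
      where
        sN·sN≗ : ∀ i → toℕ (lookup (sN k ·A sN K) i) ≡ transpose k (transpose K (toℕ i))
        sN·sN≗ i = trans (cong toℕ (lookup-·A (sN k) (sN K) i))
                     (trans (toℕ-lookup-sN k (lookup (sN K) i) k<n) (cong (transpose k) (toℕ-lookup-sN K i K<n)))

  n∸l+l≡n : n ∸ l + l ≡ n
  n∸l+l≡n = m∸n+n≡m (<⇒≤ l<n)

  fold‼≤n : ∀ (x : SPerm p) a → fold n (x ‼ a) ≤ n
  fold‼≤n x a = fold≤ n (x ‼ a) (toℕ-‼≤n x a)

  fold-flipSign‼ : ∀ (x : SPerm p) a → fold n (flipSign (x ‼ a)) ≡ n ∸ fold n (x ‼ a)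
  fold-flipSign‼ x a = fold-flipSign n (x ‼ a) (toℕ-‼≤n x a)

  ψℕ-negateLast-l : ∀ (x : SPerm p) → ψℕ n (negateLast x) l ≡ ψℕ n x (n ∸ l)
  ψℕ-negateLast-l x = begin
    ψℕ n (negateLast x) l     ≡⟨ ψℕ-left (negateLast x) l (n<1+n l) ⟩
    fold n (negateLast x ‼ l) ≡⟨ cong (fold n) (‼-negateLast-last x) ⟩
    fold n (flipSign (x ‼ l)) ≡⟨ fold-flipSign‼ x l ⟩
    n ∸ fold n (x ‼ l)        ≡⟨ ψℕ-right x (n ∸ l) l (n<1+n l) n∸l+l≡n ⟨
    ψℕ n x (n ∸ l)            ∎
    where open ≡-Reasoning

  ψℕ-negateLast-mirror : ∀ (x : SPerm p) → ψℕ n (negateLast x) (n ∸ l) ≡ ψℕ n x l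
  ψℕ-negateLast-mirror x = begin
    ψℕ n (negateLast x) (n ∸ l)   ≡⟨ ψℕ-right (negateLast x) (n ∸ l) l (n<1+n l) n∸l+l≡n ⟩
    n ∸ fold n (negateLast x ‼ l) ≡⟨ cong (λ c → n ∸ fold n c) (‼-negateLast-last x) ⟩
    n ∸ fold n (flipSign (x ‼ l)) ≡⟨ cong (n ∸_) (fold-flipSign‼ x l) ⟩
    n ∸ (n ∸ fold n (x ‼ l))      ≡⟨ m∸[m∸n]≡n (fold‼≤n x l) ⟩
    fold n (x ‼ l)                ≡⟨ ψℕ-left x l (n<1+n l) ⟨
    ψℕ n x l                      ∎
    where open ≡-Reasoning

  ψℕ-negateLast-other : ∀ (x : SPerm p) i → i ≤ n → i ≢ l → i ≢ n ∸ l → ψℕ n (negateLast x) i ≡ ψℕ n x i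
  ψℕ-negateLast-other x i i≤n i≢l i≢n∸l with region i i≤n
  ... | left i<p = begin
    ψℕ n (negateLast x) i     ≡⟨ ψℕ-left (negateLast x) i i<p ⟩
    fold n (negateLast x ‼ i) ≡⟨ cong (fold n) (‼-negateLast x i i≢l) ⟩
    fold n (x ‼ i)            ≡⟨ ψℕ-left x i i<p ⟨
    ψℕ n x i                  ∎
    where open ≡-Reasoning
  ... | right a a<p i+a≡n = begin
    ψℕ n (negateLast x) i         ≡⟨ ψℕ-right (negateLast x) i a a<p i+a≡n ⟩
    n ∸ fold n (negateLast x ‼ a) ≡⟨ cong (λ c → n ∸ fold n c) (‼-negateLast x a a≢l) ⟩
    n ∸ fold n (x ‼ a)            ≡⟨ ψℕ-right x i a a<p i+a≡n ⟨
    ψℕ n x i                      ∎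
    where
      open ≡-Reasoning
      a≢l : a ≢ l
      a≢l refl = i≢n∸l (trans (sym (m+n∸n≡m i l)) (cong (_∸ l) i+a≡n))
  ... | middle refl n≡p+p = trans (ψℕ-middle (negateLast x) n≡p+p) (sym (ψℕ-middle x n≡p+p))

  -- Negating the last letter of x exchanges the values of ψ x at l and at its mirror image n ∸ l.
  ψℕ-negateLast : ∀ (σ : ℕ → ℕ) → σ l ≡ n ∸ l → σ (n ∸ l) ≡ l → (∀ i → i ≢ l → i ≢ n ∸ l → σ i ≡ i) →
                  ∀ (x : SPerm p) i → i ≤ n → ψℕ n (negateLast x) i ≡ ψℕ n x (σ i)
  ψℕ-negateLast σ σl σm σ-fix x i i≤n with i ℕ.≟ l | i ℕ.≟ n ∸ l
  ... | yes refl | _ = trans (ψℕ-negateLast-l x) (cong (ψℕ n x) (sym σl))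
  ... | no _ | yes refl = trans (ψℕ-negateLast-mirror x) (cong (ψℕ n x) (sym σm))
  ... | no i≢l | no i≢n∸l = trans (ψℕ-negateLast-other x i i≤n i≢l i≢n∸l) (cong (ψℕ n x) (sym (σ-fix i i≢l i≢n∸l)))

  ψ-negateLast-odd : n ≡ l + suc l → ∀ (x : SPerm p) → ψ n (negateLast x) ≡ ψ n x ·A sN l
  ψ-negateLast-odd n≡2p-1 x = ψ≡ψ·A n x (negateLast x) (sN l) (transpose l) (λ i → toℕ-lookup-sN l i l<n)
    (ψℕ-negateLast (transpose l) (trans (transpose-k l) (sym n∸l≡1+l)) (trans (cong (transpose l) n∸l≡1+l) (transpose-suc-k l))
      (λ i i≢l i≢n∸l → transpose-fix i≢l (λ i≡1+l → i≢n∸l (trans i≡1+l (sym n∸l≡1+l)))) x)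
    where
      n∸l≡1+l : n ∸ l ≡ suc l
      n∸l≡1+l = trans (cong (_∸ l) n≡2p-1) (m+n∸m≡n l (suc l))

  -- the transposition of l and p + 1, which is sN l ·A (sN p ·A sN l) = φ(r_p) when n = 2p
  τ : ℕ → ℕ
  τ i = transpose l (transpose p (transpose l i))

  ψ-negateLast-even : n ≡ p + p → ∀ (x : SPerm p) → ψ n (negateLast x) ≡ ψ n x ·A (sN l ·A (sN p ·A sN l))
  ψ-negateLast-even n≡p+p x = ψ≡ψ·A n x (negateLast x) (sN l ·A (sN p ·A sN l)) τ s-s-s≗τ
    (ψℕ-negateLast τ (trans τl≡1+p (sym n∸l≡1+p)) (trans (cong τ n∸l≡1+p) τ1+p≡l) τ-fix x)
    where
      n∸l≡1+p : n ∸ l ≡ suc p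
      n∸l≡1+p = trans (cong (_∸ l) (trans n≡p+p (sym (+-suc l p)))) (m+n∸m≡n l (suc p))
      p<n : p < n
      p<n = subst (p <_) (sym n≡p+p) (m<m+n p (s≤s z≤n))
      τl≡1+p : τ l ≡ suc p
      τl≡1+p = trans (cong (λ j → transpose l (transpose p j)) (transpose-k l))
                 (trans (cong (transpose l) (transpose-k p)) (transpose-fix> (n<1+n p)))
      τ1+p≡l : τ (suc p) ≡ l
      τ1+p≡l = trans (cong (λ j → transpose l (transpose p j)) (transpose-fix> (n<1+n p)))
                 (trans (cong (transpose l) (transpose-suc-k p)) (transpose-suc-k l))
      τ-fix : ∀ i → i ≢ l → i ≢ n ∸ l → τ i ≡ i
      τ-fix i i≢l i≢n∸l with i ℕ.≟ p
      ... | yes refl = trans (cong (λ j → transpose l (transpose p j)) (transpose-suc-k l))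
                         (trans (cong (transpose l) (transpose-fix< (n<1+n l))) (transpose-k l))
      ... | no i≢p = trans (cong (λ j → transpose l (transpose p j)) fix-l)
                       (trans (cong (transpose l) (transpose-fix i≢p (λ i≡1+p → i≢n∸l (trans i≡1+p (sym n∸l≡1+p))))) fix-l)
        where
          fix-l : transpose l i ≡ i
          fix-l = transpose-fix i≢l i≢p
      s-s-s≗τ : ∀ i → toℕ (lookup (sN l ·A (sN p ·A sN l)) i) ≡ τ (toℕ i)
      s-s-s≗τ i = begin
        toℕ (lookup (sN l ·A (sN p ·A sN l)) i)             ≡⟨ cong toℕ (lookup-·A (sN l) (sN p ·A sN l) i) ⟩
        toℕ (lookup (sN l) (lookup (sN p ·A sN l) i))       ≡⟨ toℕ-lookup-sN l (lookup (sN p ·A sN l) i) l<n ⟩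
        transpose l (toℕ (lookup (sN p ·A sN l) i))         ≡⟨ cong (λ j → transpose l (toℕ j)) (lookup-·A (sN p) (sN l) i) ⟩
        transpose l (toℕ (lookup (sN p) (lookup (sN l) i))) ≡⟨ cong (transpose l) (toℕ-lookup-sN p (lookup (sN l) i) p<n) ⟩
        transpose l (transpose p (toℕ (lookup (sN l) i)))   ≡⟨ cong (λ j → transpose l (transpose p j)) (toℕ-lookup-sN l i l<n) ⟩
        τ (toℕ i)                                           ∎
        where open ≡-Reasoning

  ψ-·rB : ∀ (x : SPerm p) j → ψ n (x ·B rB p j) ≡ ψ n x ·A φgen n p j
  ψ-·rB x j with rB-cases j
  ... | inj₂ adjacent = begin
    ψ n (x ·B rB p j)                 ≡⟨ cong (ψ n) (·rB≡swapAt x j adjacent) ⟩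
    ψ n (swapAt k x)                  ≡⟨ MirroredSwap.ψ-swapAt k 2+k≤p x ⟩
    ψ n x ·A (sN k ·A sN (n ∸ suc k)) ≡⟨ cong (ψ n x ·A_) φgen≡ ⟨
    ψ n x ·A φgen n p j               ∎
    where
      open ≡-Reasoning
      k = toℕ j
      2+k≤p = ≡ᵇ-false⇒< j adjacent
      φgen≡ : φgen n p j ≡ sN k ·A sN (n ∸ suc k)
      φgen≡ rewrite <ᵇ-true 2+k≤p = refl
  ... | inj₁ last = trans (cong (ψ n) (·rB≡negateLast x j last)) ([ odd , even ]′ parity)
    where
      p≡1+j : p ≡ suc (toℕ j)
      p≡1+j = sym (≡ᵇ⇒≡ _ _ (Equivalence.from T-≡ last))
      φgen-last : φgen n p j ≡ (if n ≡ᵇ (2 * p ∸ 1) then sN l else sN l ·A (sN p ·A sN l))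
      φgen-last rewrite <ᵇ-false (≤-reflexive p≡1+j) = refl
      2p-1≡ : 2 * p ∸ 1 ≡ l + suc l
      2p-1≡ = cong (l +_) (+-identityʳ (suc l))
      odd : n ≡ l + suc l → ψ n (negateLast x) ≡ ψ n x ·A φgen n p j
      odd n≡2p-1 rewrite φgen-last | trans (cong (n ≡ᵇ_) (trans 2p-1≡ (sym n≡2p-1))) (≡ᵇ-refl n) =
        ψ-negateLast-odd n≡2p-1 x
      even : n ≡ p + p → ψ n (negateLast x) ≡ ψ n x ·A φgen n p j
      even n≡p+p rewrite φgen-last | ≡ᵇ-false {n} {2 * p ∸ 1} (λ n≡ → <-irrefl (trans (sym (trans n≡ 2p-1≡)) n≡p+p) (n<1+n _)) =
        ψ-negateLast-even n≡p+p x

-- φ is the folding, and the length of the folding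

IsSPerm-rB : ∀ {l} j → IsSPerm (rB (suc l) j)
IsSPerm-rB j = subst IsSPerm (·B-identityˡ (rB _ j)) (IsSPerm-·rB idB j IsSPerm-idB)

SPerm-induction : ∀ {l} (P : SPerm (suc l) → Set) → P idB →
                  (∀ x j → IsSPerm x → P x → P (x ·B rB (suc l) j)) → ∀ v → IsSPerm v → P v
SPerm-induction {l} P P-id P-step v v-perm with WordLengthB.word-of-length-stat l (invB v) v v-perm refl
... | w , eval-w≡v , _ = subst P (trans (sym (WordLengthB.eval≡foldl l w)) eval-w≡v) (along w idB IsSPerm-idB P-id)
  where
    along : ∀ w x → IsSPerm x → P x → P (foldl (WordLengthB.step l) x w)
    along [] x _ Px = Px
    along (j ∷ w) x x-perm Px = along w (x ·B rB (suc l) j) (IsSPerm-·rB x j x-perm) (P-step x j x-perm Px)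

IsPerm-if : ∀ {m} b (x y : Perm m) → IsPerm x → IsPerm y → IsPerm (if b then x else y)
IsPerm-if true x y x-perm _ = x-perm
IsPerm-if false x y _ y-perm = y-perm

IsPerm-φgen : ∀ n p j → IsPerm (φgen n p j)
IsPerm-φgen n p j = IsPerm-if (suc (toℕ j) <ᵇ p) _ _ (IsPerm-·A _ _ (IsPerm-sN _) (IsPerm-sN _))
  (IsPerm-if (n ≡ᵇ (2 * p ∸ 1)) _ _ (IsPerm-sN _) (IsPerm-·A _ _ (IsPerm-sN _) (IsPerm-·A _ _ (IsPerm-sN _) (IsPerm-sN _))))

module Homomorphism (l n : ℕ) (parity : n ≡ l + suc l ⊎ n ≡ suc l + suc l)
                    (φ : SPerm (suc l) → Perm (suc n)) (isφ : IsPhi n (suc l) φ) where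
  open Folding l n parity

  φ-hom : ∀ x y → IsSPerm x → IsSPerm y → φ (x ·B y) ≡ φ x ·A φ y
  φ-hom = proj₁ isφ

  φ-rB : ∀ j → φ (rB p j) ≡ φgen n p j
  φ-rB = proj₂ isφ

  IsPerm-ψ : ∀ v → IsSPerm v → IsPerm (ψ n v)
  IsPerm-ψ = SPerm-induction (IsPerm ∘ ψ n) (subst IsPerm (sym ψ-idB) IsPerm-idA)
    λ x j _ ψx-perm → subst IsPerm (sym (ψ-·rB x j)) (IsPerm-·A _ _ ψx-perm (IsPerm-φgen n p j))

  -- φ and ψ agree on idB = r₁ r₁ because they agree on r₁.
  φ-idB : φ idB ≡ ψ n (idB {p})
  φ-idB = begin
    φ idB                          ≡⟨ cong φ r₁r₁≡idB ⟨
    φ (r₁ ·B r₁)                   ≡⟨ φ-hom r₁ r₁ (IsSPerm-rB zero) (IsSPerm-rB zero) ⟩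
    φ r₁ ·A φ r₁                   ≡⟨ cong₂ _·A_ (φ-rB zero) (φ-rB zero) ⟩
    φgen n p zero ·A φgen n p zero ≡⟨ cong (_·A φgen n p zero) ψr₁≡ ⟨
    ψ n r₁ ·A φgen n p zero        ≡⟨ ψ-·rB r₁ zero ⟨
    ψ n (r₁ ·B r₁)                 ≡⟨ cong (ψ n) r₁r₁≡idB ⟩
    ψ n (idB {p})                  ∎
    where
      open ≡-Reasoning
      r₁ = rB p zero
      r₁r₁≡idB : r₁ ·B r₁ ≡ idB
      r₁r₁≡idB = trans (cong (_·B r₁) (sym (·B-identityˡ r₁))) (·rB-involutive idB zero)
      ψr₁≡ : ψ n r₁ ≡ φgen n p zero
      ψr₁≡ = begin
        ψ n r₁                         ≡⟨ cong (ψ n) (·B-identityˡ r₁) ⟨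
        ψ n (idB {p} ·B r₁)            ≡⟨ ψ-·rB idB zero ⟩
        ψ n (idB {p}) ·A φgen n p zero ≡⟨ cong (_·A φgen n p zero) ψ-idB ⟩
        idA ·A φgen n p zero           ≡⟨ ·A-identityˡ (φgen n p zero) ⟩
        φgen n p zero                  ∎

  φ≡ψ : ∀ v → IsSPerm v → φ v ≡ ψ n v
  φ≡ψ = SPerm-induction (λ v → φ v ≡ ψ n v) φ-idB λ x j x-perm φx≡ψx → begin
    φ (x ·B rB p j)     ≡⟨ φ-hom x (rB p j) x-perm (IsSPerm-rB j) ⟩
    φ x ·A φ (rB p j)   ≡⟨ cong₂ _·A_ φx≡ψx (φ-rB j) ⟩
    ψ n x ·A φgen n p j ≡⟨ ψ-·rB x j ⟨
    ψ n (x ·B rB p j)   ∎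
    where open ≡-Reasoning

negatives : ∀ {m l} → Vec (Signed m) l → ℕ
negatives [] = 0
negatives (h ∷ t) = 𝟙 (proj₂ h) + negatives t

negatives-swapAt : ∀ {m l} k (v : Vec (Signed m) l) → negatives (swapAt k v) ≡ negatives v
negatives-swapAt zero [] = refl
negatives-swapAt zero (a ∷ []) = refl
negatives-swapAt zero (a ∷ b ∷ v) = x∙yz≈y∙xz (𝟙 (proj₂ b)) (𝟙 (proj₂ a)) (negatives v)
negatives-swapAt (suc k) [] = refl
negatives-swapAt (suc k) (a ∷ v) = cong (𝟙 (proj₂ a) +_) (negatives-swapAt k v)

negatives-negateLast : ∀ {m l} (v : Vec (Signed m) (suc l)) → proj₂ (lastEntry v) ≡ true →
                       negatives (negateLast v) + 1 ≡ negatives v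
negatives-negateLast ((j , .true) ∷ []) refl = refl
negatives-negateLast (a ∷ b ∷ v) last-neg =
  trans (+-assoc (𝟙 (proj₂ a)) _ 1) (cong (𝟙 (proj₂ a) +_) (negatives-negateLast (b ∷ v) last-neg))

negatives-positive : ∀ {m l} (v : Vec (Signed m) l) → All Positive (toList v) → negatives v ≡ 0
negatives-positive [] _ = refl
negatives-positive ((j , .false) ∷ v) (refl ∷ pos) = negatives-positive v pos

fold-≺ᵇ : ∀ {n m} (a b : Signed m) → m + m ≤ suc n → (a ≺ᵇ b) ≡ true → fold n a < fold n b
fold-≺ᵇ (j , false) (j′ , false) _ a≺b = <ᵇ-true⁻¹ _ _ a≺b
fold-≺ᵇ {n} {m} (j , false) (j′ , true) m+m≤1+n _ = m+n≤o⇒m≤o∸n (suc (toℕ j)) (s≤s⁻¹ (begin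
  suc (suc (toℕ j) + toℕ j′) ≡⟨ +-suc (suc (toℕ j)) (toℕ j′) ⟨
  suc (toℕ j) + suc (toℕ j′) ≤⟨ +-mono-≤ (Fin.toℕ<n j) (Fin.toℕ<n j′) ⟩
  m + m                      ≤⟨ m+m≤1+n ⟩
  suc n                      ∎))
  where open ≤-Reasoning
fold-≺ᵇ {n} {m} (j , true) (j′ , true) m+m≤1+n a≺b =
  ∸-monoʳ-< (<ᵇ-true⁻¹ _ _ a≺b) (s≤s⁻¹ (≤-trans (Fin.toℕ<n j) (≤-trans (m≤m+n m m) m+m≤1+n)))

descent-induction : ∀ {l} (P : SPerm (suc l) → Set) → P idB →
  (∀ v k → suc (suc k) ≤ suc l → (v ‼ suc k ≺ᵇ v ‼ k) ≡ true → P (swapAt k v) → P v) →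
  (∀ v → proj₂ (lastEntry v) ≡ true → P (negateLast v) → P v) →
  ∀ v → IsSPerm v → P v
descent-induction {l} P P-idB P-swapAt P-negateLast v v-perm = go (invB v) v v-perm refl
  where
    go : ∀ m v → IsSPerm v → invB v ≡ m → P v
    go zero v v-perm invB≡0 = subst P (sym (invB≡0⇒idB v v-perm invB≡0)) P-idB
    go (suc m) v v-perm invB≡1+m with invB≢0⇒descent v (λ invB≡0 → 1+n≢0 (trans (sym invB≡1+m) invB≡0))
    ... | inj₁ last-neg = P-negateLast v last-neg (go m (negateLast v) (IsSPerm-negateLast v v-perm)
          (+-cancelʳ-≡ 1 _ _ (trans (invB-negateLast-descent v last-neg) (trans invB≡1+m (+-comm 1 m)))))
    ... | inj₂ (k , 1+k<1+l , desc) = P-swapAt v k 1+k<1+l desc (go m (swapAt k v) (IsSPerm-swapAt k v v-perm)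
          (+-cancelʳ-≡ 1 _ _ (trans (invB-swapAt-descent v k 1+k<1+l desc) (trans invB≡1+m (+-comm 1 m)))))

module FoldedInversions (l n : ℕ) (parity : n ≡ l + suc l ⊎ n ≡ suc l + suc l) where
  open Folding l n parity

  p+p≤1+n : p + p ≤ suc n
  p+p≤1+n = s≤s (≤-trans (≤-reflexive (sym p+l≡2p-1)) p+l≤n)

  ψ‼-left : ∀ (v : SPerm p) i → i < p → toℕ (lookupℕ zero (ψ n v) i) ≡ fold n (v ‼ i)
  ψ‼-left v i i<p = trans (toℕ-ψ‼ v i (<⇒≤ (<-≤-trans i<p p≤n))) (ψℕ-left v i i<p)

  ψ‼-right : ∀ (v : SPerm p) i a → a < p → i + a ≡ n → toℕ (lookupℕ zero (ψ n v) i) ≡ n ∸ fold n (v ‼ a)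
  ψ‼-right v i a a<p i+a≡n = trans (toℕ-ψ‼ v i (subst (i ≤_) i+a≡n (m≤m+n i a))) (ψℕ-right v i a a<p i+a≡n)

  inv-ψ-swapAt : ∀ (v : SPerm p) k → suc (suc k) ≤ p → (v ‼ suc k ≺ᵇ v ‼ k) ≡ true →
                 inv (ψ n (swapAt k v)) + 2 ≡ inv (ψ n v)
  inv-ψ-swapAt v k 2+k≤p desc = begin
    inv (ψ n (swapAt k v)) + 2 ≡⟨ cong (λ y → inv y + 2) ψ-swapAt≡ ⟩
    inv (swapAt K y₁) + 2      ≡⟨ +-assoc (inv (swapAt K y₁)) 1 1 ⟨
    inv (swapAt K y₁) + 1 + 1  ≡⟨ cong (_+ 1) (inv-swapAt-descent y₁ K (s≤s K<n , descent-K)) ⟩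
    inv y₁ + 1                 ≡⟨ inv-swapAt-descent y k (s≤s k<n , descent-k) ⟩
    inv y                      ∎
    where
      open ≡-Reasoning
      open MirroredSwap k 2+k≤p
      y = ψ n v
      y₁ = swapAt k y
      ψ-swapAt≡ : ψ n (swapAt k v) ≡ swapAt K y₁
      ψ-swapAt≡ = begin
        ψ n (swapAt k v)    ≡⟨ ψ-swapAt v ⟩
        y ·A (sN k ·A sN K) ≡⟨ ·A-assoc y (sN k) (sN K) ⟨
        (y ·A sN k) ·A sN K ≡⟨ cong (_·A sN K) (·A-sN y k) ⟩
        y₁ ·A sN K          ≡⟨ ·A-sN y₁ K ⟩
        swapAt K y₁         ∎
      folds< : fold n (v ‼ suc k) < fold n (v ‼ k)
      folds< = fold-≺ᵇ (v ‼ suc k) (v ‼ k) p+p≤1+n desc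
      descent-k : toℕ (lookupℕ zero y (suc k)) < toℕ (lookupℕ zero y k)
      descent-k = subst₂ _<_ (sym (ψ‼-left v (suc k) 2+k≤p)) (sym (ψ‼-left v k (<-trans (n<1+n k) 2+k≤p))) folds<
      1+k<K : suc k < K
      1+k<K = <-≤-trans 2+k≤p p≤K
      y₁‼ : ∀ i → suc k < i → toℕ (lookupℕ zero y₁ i) ≡ toℕ (lookupℕ zero y i)
      y₁‼ i 1+k<i = cong toℕ (trans (lookupℕ-swapAt zero k y (s≤s k<n) i) (cong (lookupℕ zero y) (transpose-fix> 1+k<i)))
      descent-K : toℕ (lookupℕ zero y₁ (suc K)) < toℕ (lookupℕ zero y₁ K)
      descent-K = subst₂ _<_
        (sym (trans (y₁‼ (suc K) (<-trans 1+k<K (n<1+n K)))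
                    (ψ‼-right v (suc K) k (<-trans (n<1+n k) 2+k≤p) (trans (sym (+-suc K k)) K+1+k≡n))))
        (sym (trans (y₁‼ K 1+k<K) (ψ‼-right v K (suc k) 2+k≤p K+1+k≡n)))
        (∸-monoʳ-< folds< (fold‼≤n v k))

  module NegativeLast (v : SPerm p) (last-neg : proj₂ (lastEntry v) ≡ true) where
    y : Perm (suc n)
    y = ψ n v

    j : ℕ
    j = toℕ (proj₁ (v ‼ l))

    j≤l : j ≤ l
    j≤l = s≤s⁻¹ (toℕ-‼< v l)

    fold-last : fold n (v ‼ l) ≡ n ∸ j
    fold-last with v ‼ l | ‼-last v
    ... | (_ , true) | _ = refl
    ... | (_ , false) | eq = contradiction (trans (cong proj₂ eq) last-neg) λ ()

    y‼l : toℕ (lookupℕ zero y l) ≡ n ∸ j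
    y‼l = trans (ψ‼-left v l (n<1+n l)) fold-last

    y‼mirror : toℕ (lookupℕ zero y (n ∸ l)) ≡ j
    y‼mirror = begin
      toℕ (lookupℕ zero y (n ∸ l)) ≡⟨ ψ‼-right v (n ∸ l) l (n<1+n l) n∸l+l≡n ⟩
      n ∸ fold n (v ‼ l)           ≡⟨ cong (n ∸_) fold-last ⟩
      n ∸ (n ∸ j)                  ≡⟨ m∸[m∸n]≡n (≤-trans j≤l (<⇒≤ l<n)) ⟩
      j                            ∎
      where open ≡-Reasoning

    <n∸j : ∀ o → j + o < n → o < n ∸ j
    <n∸j o j+o<n = m+n≤o⇒m≤o∸n (suc o) (subst (_≤ n) (cong suc (+-comm j o)) j+o<n)

  inv-ψ-negateLast-odd : n ≡ l + suc l → ∀ (v : SPerm p) → proj₂ (lastEntry v) ≡ true →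
                         inv (ψ n (negateLast v)) + 1 ≡ inv (ψ n v)
  inv-ψ-negateLast-odd n≡2p-1 v last-neg = begin
    inv (ψ n (negateLast v)) + 1 ≡⟨ cong (λ z → inv z + 1) (trans (ψ-negateLast-odd n≡2p-1 v) (·A-sN y l)) ⟩
    inv (swapAt l y) + 1         ≡⟨ inv-swapAt-descent y l (s≤s l<n , descent) ⟩
    inv y                        ∎
    where
      open ≡-Reasoning
      open NegativeLast v last-neg
      n∸l≡1+l : n ∸ l ≡ suc l
      n∸l≡1+l = trans (cong (_∸ l) n≡2p-1) (m+n∸m≡n l (suc l))
      descent : toℕ (lookupℕ zero y (suc l)) < toℕ (lookupℕ zero y l)
      descent = subst₂ _<_ (sym (trans (cong (λ i → toℕ (lookupℕ zero y i)) (sym n∸l≡1+l)) y‼mirror)) (sym y‼l)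
        (<n∸j j (≤-trans (s≤s (+-mono-≤ j≤l j≤l)) (≤-reflexive (trans (sym (+-suc l l)) (sym n≡2p-1)))))

  module NegativeLastEven (n≡p+p : n ≡ p + p) (v : SPerm p) (last-neg : proj₂ (lastEntry v) ≡ true) where
    open NegativeLast v last-neg public

    y₁ y₂ : Perm (suc n)
    y₁ = swapAt l y
    y₂ = swapAt p y₁

    p<n : p < n
    p<n = subst (p <_) (sym n≡p+p) (m<m+n p (s≤s z≤n))

    ψ-negateLast≡ : ψ n (negateLast v) ≡ swapAt l y₂
    ψ-negateLast≡ = begin
      ψ n (negateLast v)            ≡⟨ ψ-negateLast-even n≡p+p v ⟩
      y ·A (sN l ·A (sN p ·A sN l)) ≡⟨ ·A-assoc y (sN l) (sN p ·A sN l) ⟨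
      (y ·A sN l) ·A (sN p ·A sN l) ≡⟨ ·A-assoc (y ·A sN l) (sN p) (sN l) ⟨
      ((y ·A sN l) ·A sN p) ·A sN l ≡⟨ cong (λ z → (z ·A sN p) ·A sN l) (·A-sN y l) ⟩
      (y₁ ·A sN p) ·A sN l          ≡⟨ cong (_·A sN l) (·A-sN y₁ p) ⟩
      y₂ ·A sN l                    ≡⟨ ·A-sN y₂ l ⟩
      swapAt l y₂                   ∎
      where open ≡-Reasoning

    at : Perm (suc n) → ℕ → ℕ
    at z i = toℕ (lookupℕ zero z i)

    at-swapAt : ∀ k z → k < n → ∀ i → at (swapAt k z) i ≡ at z (transpose k i)
    at-swapAt k z k<n i = cong toℕ (lookupℕ-swapAt zero k z (s≤s k<n) i)

    y‼p : at y p ≡ p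
    y‼p = trans (toℕ-ψ‼ v p (<⇒≤ p<n)) (ψℕ-middle v n≡p+p)

    y‼1+p : at y (suc p) ≡ j
    y‼1+p = trans (cong (at y) (sym n∸l≡1+p)) y‼mirror
      where
        n∸l≡1+p : n ∸ l ≡ suc p
        n∸l≡1+p = trans (cong (_∸ l) (trans n≡p+p (sym (+-suc l p)))) (m+n∸m≡n l (suc p))

    y₁‼p : at y₁ p ≡ n ∸ j
    y₁‼p = trans (at-swapAt l y l<n p) (trans (cong (at y) (transpose-suc-k l)) y‼l)

    y₁‼1+p : at y₁ (suc p) ≡ j
    y₁‼1+p = trans (at-swapAt l y l<n (suc p)) (trans (cong (at y) (transpose-fix> (n<1+n p))) y‼1+p)

    y₂‼l : at y₂ l ≡ p
    y₂‼l = trans (at-swapAt p y₁ p<n l) (trans (cong (at y₁) (transpose-fix< (n<1+n l)))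
             (trans (at-swapAt l y l<n l) (trans (cong (at y) (transpose-k l)) y‼p)))

    y₂‼p : at y₂ p ≡ j
    y₂‼p = trans (at-swapAt p y₁ p<n p) (trans (cong (at y₁) (transpose-k p)) y₁‼1+p)

    j+p<n : j + p < n
    j+p<n = ≤-trans (s≤s (+-monoˡ-≤ p j≤l)) (≤-reflexive (sym n≡p+p))

    descent₁ : at y p < at y l
    descent₁ = subst₂ _<_ (sym y‼p) (sym y‼l) (<n∸j p j+p<n)

    descent₂ : at y₁ (suc p) < at y₁ p
    descent₂ = subst₂ _<_ (sym y₁‼1+p) (sym y₁‼p) (<n∸j j (≤-<-trans (+-monoʳ-≤ j (≤-trans j≤l (n≤1+n l))) j+p<n))

    descent₃ : at y₂ p < at y₂ l
    descent₃ = subst₂ _<_ (sym y₂‼p) (sym y₂‼l) (s≤s j≤l)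

  inv-ψ-negateLast-even : n ≡ p + p → ∀ (v : SPerm p) → proj₂ (lastEntry v) ≡ true →
                          inv (ψ n (negateLast v)) + 3 ≡ inv (ψ n v)
  inv-ψ-negateLast-even n≡p+p v last-neg = begin
    inv (ψ n (negateLast v)) + 3 ≡⟨ cong (λ z → inv z + 3) ψ-negateLast≡ ⟩
    inv (swapAt l y₂) + 3        ≡⟨ +-assoc (inv (swapAt l y₂)) 1 2 ⟨
    inv (swapAt l y₂) + 1 + 2    ≡⟨ cong (_+ 2) (inv-swapAt-descent y₂ l (s≤s l<n , descent₃)) ⟩
    inv y₂ + 2                   ≡⟨ +-assoc (inv y₂) 1 1 ⟨
    inv y₂ + 1 + 1               ≡⟨ cong (_+ 1) (inv-swapAt-descent y₁ p (s≤s p<n , descent₂)) ⟩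
    inv y₁ + 1                   ≡⟨ inv-swapAt-descent y l (s≤s l<n , descent₁) ⟩
    inv y                        ∎
    where
      open ≡-Reasoning
      open NegativeLastEven n≡p+p v last-neg

  -- the length of φ(r_p) = sN l or sN l ·A (sN p ·A sN l)
  c : ℕ
  c = [ (λ _ → 1) , (λ _ → 3) ]′ parity

  inv-ψ-negateLast : ∀ (v : SPerm p) → proj₂ (lastEntry v) ≡ true → inv (ψ n (negateLast v)) + c ≡ inv (ψ n v)
  inv-ψ-negateLast v last-neg =
    [_,_] {C = λ parity → inv (ψ n (negateLast v)) + [ (λ _ → 1) , (λ _ → 3) ]′ parity ≡ inv (ψ n v)}
      (λ n≡2p-1 → inv-ψ-negateLast-odd n≡2p-1 v last-neg) (λ n≡p+p → inv-ψ-negateLast-even n≡p+p v last-neg) parity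

  inv-ψ-idB : inv (ψ n (idB {p})) ≡ 0
  inv-ψ-idB = trans (cong inv ψ-idB) (inv-idA (suc n))

  negatives-idB : negatives (idB {p}) ≡ 0
  negatives-idB = negatives-positive (idB {p}) positive-idB

  -- Induct along descents: one at r_{k+1} lowers inv ∘ ψ by 2 (a transposition and its mirror image),
  -- one at r_p lowers it by c.
  inv-ψ : ∀ v → IsSPerm v → inv (ψ n v) + 2 * negatives v ≡ 2 * invB v + c * negatives v
  inv-ψ = descent-induction P
    (begin
      inv (ψ n (idB {p})) + 2 * negatives (idB {p}) ≡⟨ cong₂ (λ a m → a + 2 * m) inv-ψ-idB negatives-idB ⟩
      0                                             ≡⟨ *-zeroʳ c ⟨
      c * 0                                         ≡⟨ cong₂ (λ b m → 2 * b + c * m) (invB-idB p) negatives-idB ⟨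
      2 * invB (idB {p}) + c * negatives (idB {p})  ∎)
    (λ v k 2+k≤p desc → step 2 0 (inv-ψ-swapAt v k 2+k≤p desc)
                          (trans (+-identityʳ _) (negatives-swapAt k v)) (invB-swapAt-descent v k 2+k≤p desc)
                          (cong (2 +_) (sym (*-zeroʳ c))))
    (λ v last-neg → step c 1 (inv-ψ-negateLast v last-neg)
                      (negatives-negateLast v last-neg) (invB-negateLast-descent v last-neg) (c+2≡2+c*1 c))
    where
      open ≡-Reasoning
      P : SPerm p → Set
      P v = inv (ψ n v) + 2 * negatives v ≡ 2 * invB v + c * negatives v
      c+2≡2+c*1 : ∀ c → c + 2 * 1 ≡ 2 + c * 1
      c+2≡2+c*1 = solve-∀
      step : ∀ {a m b a′ m′ b′} da dm → a′ + da ≡ a → m′ + dm ≡ m → b′ + 1 ≡ b → da + 2 * dm ≡ 2 + c * dm →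
             a′ + 2 * m′ ≡ 2 * b′ + c * m′ → a + 2 * m ≡ 2 * b + c * m
      step {a′ = a′} {m′} {b′} da dm refl refl refl d≡ ih = begin
        a′ + da + 2 * (m′ + dm)          ≡⟨ shuffle a′ da m′ dm ⟩
        (a′ + 2 * m′) + (da + 2 * dm)    ≡⟨ cong₂ _+_ ih d≡ ⟩
        (2 * b′ + c * m′) + (2 + c * dm) ≡⟨ shuffle′ b′ c m′ dm ⟩
        2 * (b′ + 1) + c * (m′ + dm)     ∎
        where
          shuffle : ∀ a da m dm → a + da + 2 * (m + dm) ≡ (a + 2 * m) + (da + 2 * dm)
          shuffle = solve-∀
          shuffle′ : ∀ b c m dm → (2 * b + c * m) + (2 + c * dm) ≡ 2 * (b + 1) + c * (m + dm)
          shuffle′ = solve-∀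

-- Sums and Lehmer codes

∑ : ∀ {A : Set} → List A → (A → ℤ) → ℤ
∑ xs f = sumℤ (L.map f xs)

syntax ∑ xs (λ x → e) = ∑[ x ∈ xs ] e

sumℤ-↭ : ∀ {xs ys : List ℤ} → xs ↭ ys → sumℤ xs ≡ sumℤ ys
sumℤ-↭ ↭.refl = refl
sumℤ-↭ (↭.prep x xs↭ys) = cong (x +ℤ_) (sumℤ-↭ xs↭ys)
sumℤ-↭ (↭.swap x y xs↭ys) =
  trans (sym (ℤP.+-assoc x y _)) (trans (cong₂ _+ℤ_ (ℤP.+-comm x y) (sumℤ-↭ xs↭ys)) (ℤP.+-assoc y x _))
sumℤ-↭ (↭.trans xs↭ys ys↭zs) = trans (sumℤ-↭ xs↭ys) (sumℤ-↭ ys↭zs)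

sumℤ-++ : ∀ (xs ys : List ℤ) → sumℤ (xs ++ ys) ≡ sumℤ xs +ℤ sumℤ ys
sumℤ-++ [] ys = sym (ℤP.+-identityˡ _)
sumℤ-++ (x ∷ xs) ys = trans (cong (x +ℤ_) (sumℤ-++ xs ys)) (sym (ℤP.+-assoc x _ _))

∑-cong : ∀ {A : Set} {f g : A → ℤ} (xs : List A) → (∀ x → x ∈ xs → f x ≡ g x) → ∑ xs f ≡ ∑ xs g
∑-cong [] _ = refl
∑-cong (x ∷ xs) f≗g = cong₂ _+ℤ_ (f≗g x (here refl)) (∑-cong xs (λ y y∈xs → f≗g y (there y∈xs)))

∑-*ˡ : ∀ {A : Set} (c : ℤ) (f : A → ℤ) (xs : List A) → ∑[ x ∈ xs ] (c *ℤ f x) ≡ c *ℤ ∑ xs f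
∑-*ˡ c f [] = sym (ℤP.*-zeroʳ c)
∑-*ˡ c f (x ∷ xs) = trans (cong (c *ℤ f x +ℤ_) (∑-*ˡ c f xs)) (sym (ℤP.*-distribˡ-+ c (f x) _))

∑-*ʳ : ∀ {A : Set} (c : ℤ) (f : A → ℤ) (xs : List A) → ∑[ x ∈ xs ] (f x *ℤ c) ≡ ∑ xs f *ℤ c
∑-*ʳ c f xs = trans (∑-cong xs (λ x _ → ℤP.*-comm (f x) c)) (trans (∑-*ˡ c f xs) (ℤP.*-comm c _))

∑-+ : ∀ {A : Set} (f g : A → ℤ) (xs : List A) → ∑[ x ∈ xs ] (f x +ℤ g x) ≡ ∑ xs f +ℤ ∑ xs g
∑-+ f g [] = refl
∑-+ f g (x ∷ xs) = trans (cong (f x +ℤ g x +ℤ_) (∑-+ f g xs)) (interchange (f x) (g x) (∑ xs f) (∑ xs g))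
  where
    interchange : ∀ a b c d → a +ℤ b +ℤ (c +ℤ d) ≡ a +ℤ c +ℤ (b +ℤ d)
    interchange = ℤSolver.solve-∀

∑-map : ∀ {A B : Set} (f : B → ℤ) (g : A → B) (xs : List A) → ∑ (L.map g xs) f ≡ ∑ xs (f ∘ g)
∑-map f g xs = cong sumℤ (sym (LP.map-∘ xs))

∑-cartesianProduct : ∀ {A B : Set} (f : A × B → ℤ) (xs : List A) (ys : List B) →
                     ∑ (L.cartesianProduct xs ys) f ≡ ∑[ x ∈ xs ] ∑[ y ∈ ys ] f (x , y)
∑-cartesianProduct f [] ys = refl
∑-cartesianProduct f (x ∷ xs) ys = begin
  sumℤ (L.map f (L.map (x ,_) ys ++ L.cartesianProduct xs ys))
    ≡⟨ cong sumℤ (LP.map-++ f (L.map (x ,_) ys) (L.cartesianProduct xs ys)) ⟩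
  sumℤ (L.map f (L.map (x ,_) ys) ++ L.map f (L.cartesianProduct xs ys))
    ≡⟨ sumℤ-++ (L.map f (L.map (x ,_) ys)) _ ⟩
  ∑ (L.map (x ,_) ys) f +ℤ ∑ (L.cartesianProduct xs ys) f
    ≡⟨ cong₂ _+ℤ_ (∑-map f (x ,_) ys) (∑-cartesianProduct f xs ys) ⟩
  ∑[ y ∈ ys ] f (x , y) +ℤ ∑[ x ∈ xs ] ∑[ y ∈ ys ] f (x , y) ∎
  where open ≡-Reasoning

∑-product : ∀ {A B : Set} (f : A → ℤ) (g : B → ℤ) (xs : List A) (ys : List B) →
            ∑[ z ∈ L.cartesianProduct xs ys ] (f (proj₁ z) *ℤ g (proj₂ z)) ≡ ∑ xs f *ℤ ∑ ys g
∑-product f g xs ys = begin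
  ∑[ z ∈ L.cartesianProduct xs ys ] (f (proj₁ z) *ℤ g (proj₂ z)) ≡⟨ ∑-cartesianProduct _ xs ys ⟩
  ∑[ x ∈ xs ] ∑[ y ∈ ys ] (f x *ℤ g y)                           ≡⟨ ∑-cong xs (λ x _ → ∑-*ˡ (f x) g ys) ⟩
  ∑[ x ∈ xs ] (f x *ℤ ∑ ys g)                                    ≡⟨ ∑-*ʳ (∑ ys g) f xs ⟩
  ∑ xs f *ℤ ∑ ys g                                               ∎
  where open ≡-Reasoning

∑-same-members : ∀ {A : Set} (f : A → ℤ) {xs ys : List A} → Unique xs → Unique ys → (∀ {x} → x ∈ xs ⇔ x ∈ ys) →
                 ∑ xs f ≡ ∑ ys f
∑-same-members f xs-unique ys-unique same = sumℤ-↭ (↭ₚ.map⁺ f (∼bag⇒↭ (unique∧set⇒bag xs-unique ys-unique same)))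

∈-vecs : ∀ {A : Set} (xs : List A) n (v : Vec A n) → All (_∈ xs) (toList v) → v ∈ vecs xs n
∈-vecs xs zero [] _ = here refl
∈-vecs xs (suc n) (a ∷ v) (a∈xs ∷ v⊆xs) =
  ∈ₚ.∈-concat⁺′ (∈ₚ.∈-map⁺ (_∷ v) a∈xs) (∈ₚ.∈-map⁺ (λ w → L.map (_∷ w) xs) (∈-vecs xs n v v⊆xs))

Unique-vecs : ∀ {A : Set} (xs : List A) n → Unique xs → Unique (vecs xs n)
Unique-vecs xs zero _ = [] ∷ []
Unique-vecs xs (suc n) xs-unique =
  Uniqueₚ.concat⁺ (Allₚ.map⁺ (All.universal (λ v → Uniqueₚ.map⁺ VP.∷-injectiveˡ xs-unique) (vecs xs n)))
                  (AllPairsₚ.map⁺ (AllPairs.map disjoint (Unique-vecs xs n xs-unique)))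
  where
    disjoint : ∀ {v w : Vec _ n} → v ≢ w → Disjoint (L.map (_∷ v) xs) (L.map (_∷ w) xs)
    disjoint v≢w (∈v , ∈w) with ∈ₚ.∈-map⁻ (_∷ _) ∈v | ∈ₚ.∈-map⁻ (_∷ _) ∈w
    ... | _ , _ , eq | _ , _ , eq′ = v≢w (VP.∷-injectiveʳ (trans (sym eq) eq′))

∈-filter-vecs : ∀ {A : Set} {n} {P : Vec A n → Set} (P? : ∀ v → Dec (P v)) (xs : List A) → (∀ a → a ∈ xs) →
                ∀ {v : Vec A n} → v ∈ L.filter P? (vecs xs n) ⇔ P v
∈-filter-vecs {n = n} P? xs complete {v} = mk⇔ (proj₂ ∘ ∈ₚ.∈-filter⁻ P? {xs = vecs xs n})
  (∈ₚ.∈-filter⁺ P? (∈-vecs xs n v (All.universal complete (toList v))))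

All-insertAt : ∀ {A : Set} {P : A → Set} {l} (xs : Vec A l) i v → All P (toList xs) → P v →
               All P (toList (V.insertAt xs i v))
All-insertAt xs zero v ps pv = pv ∷ ps
All-insertAt (x ∷ xs) (suc i) v (px ∷ ps) pv = px ∷ All-insertAt xs i v ps pv

Unique-insertAt : ∀ {A : Set} {l} (xs : Vec A l) i v → Unique (toList xs) → All (v ≢_) (toList xs) →
                  Unique (toList (V.insertAt xs i v))
Unique-insertAt xs zero v u v∉xs = v∉xs ∷ u
Unique-insertAt (x ∷ xs) (suc i) v (x∉xs ∷ u) (v≢x ∷ v∉xs) =
  All-insertAt xs i v x∉xs (≢-sym v≢x) ∷ Unique-insertAt xs i v u v∉xs

Unique-map : ∀ {A B : Set} {l} (f : A → B) → (∀ {x y} → f x ≡ f y → x ≡ y) → (xs : Vec A l) →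
             Unique (toList xs) → Unique (toList (V.map f xs))
Unique-map f f-injective xs u = subst Unique (sym (VP.toList-map f xs)) (Uniqueₚ.map⁺ f-injective u)

map-injective : ∀ {A B : Set} {l} (f : A → B) → (∀ {x y} → f x ≡ f y → x ≡ y) → (xs ys : Vec A l) →
                V.map f xs ≡ V.map f ys → xs ≡ ys
map-injective f f-injective [] [] _ = refl
map-injective f f-injective (x ∷ xs) (y ∷ ys) eq =
  cong₂ _∷_ (f-injective (VP.∷-injectiveˡ eq)) (map-injective f f-injective xs ys (VP.∷-injectiveʳ eq))

lookup-removeAt : ∀ {A : Set} {l} (x : Vec A (suc l)) i k → lookup (V.removeAt x i) k ≡ lookup x (punchIn i k)
lookup-removeAt x i k = trans (sym (VP.insertAt-punchIn (V.removeAt x i) i (lookup x i) k))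
                              (cong (λ w → lookup w (punchIn i k)) (VP.insertAt-removeAt x i))

levelSum : ∀ {Label : Set} → List Label → (ℕ → ℕ → Label → ℕ) → ℤ → ℕ → ℤ
levelSum labels incr t m = ∑[ z ∈ L.cartesianProduct (L.allFin (suc m)) labels ] (t ^ℤ incr m (toℕ (proj₁ z)) (proj₂ z))

levelProduct : ∀ {Label : Set} → List Label → (ℕ → ℕ → Label → ℕ) → ℤ → ℕ → ℤ
levelProduct labels incr t zero = 1ℤ
levelProduct labels incr t (suc m) = levelSum labels incr t m *ℤ levelProduct labels incr t m

-- Lehmer codes: every valid vector arises uniquely by inserting a new least letter, with a label,
-- into a shifted valid vector of one size less.
module InsertionCode {E : ℕ → Set} {Label : Set}
  (key : ∀ {m} → E m → Fin m)
  (shift : ∀ {m} → E m → E (suc m))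
  (new : ∀ {m} → Label → E (suc m))
  (key-shift : ∀ {m} (e : E m) → key (shift e) ≡ suc (key e))
  (key-new : ∀ {m} b → key (new {m} b) ≡ zero)
  (shift-injective : ∀ {m} {e e′ : E m} → shift e ≡ shift e′ → e ≡ e′)
  (new-injective : ∀ {m} {b b′} → new {m} b ≡ new b′ → b ≡ b′)
  (unshift : ∀ {m} (e : E (suc m)) → key e ≢ zero → Σ (E m) λ e′ → shift e′ ≡ e)
  (unnew : ∀ {m} (e : E (suc m)) → key e ≡ zero → Σ Label λ b → new b ≡ e)
  where

  Valid : ∀ {m} → Vec (E m) m → Set
  Valid x = Unique (toList (V.map key x))

  Code : ℕ → Set
  Code zero = ⊤
  Code (suc m) = (Fin (suc m) × Label) × Code m

  decode : ∀ m → Code m → Vec (E m) m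
  decode zero _ = []
  decode (suc m) ((i , b) , c) = V.insertAt (V.map shift (decode m c)) i (new b)

  codes : List Label → ∀ m → List (Code m)
  codes labels zero = tt ∷ []
  codes labels (suc m) = L.cartesianProduct (L.cartesianProduct (L.allFin (suc m)) labels) (codes labels m)

  Unique-codes : ∀ {labels} → Unique labels → ∀ m → Unique (codes labels m)
  Unique-codes u zero = [] ∷ []
  Unique-codes u (suc m) = Uniqueₚ.cartesianProduct⁺ (Uniqueₚ.cartesianProduct⁺ (Uniqueₚ.allFin⁺ (suc m)) u) (Unique-codes u m)

  ∈-codes : ∀ {labels} → (∀ b → b ∈ labels) → ∀ m c → c ∈ codes labels m
  ∈-codes complete zero tt = here refl
  ∈-codes complete (suc m) ((i , b) , c) =
    ∈ₚ.∈-cartesianProduct⁺ (∈ₚ.∈-cartesianProduct⁺ (∈ₚ.∈-allFin i) (complete b)) (∈-codes complete m c)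

  map-key-shift : ∀ {m l} (u : Vec (E m) l) → V.map key (V.map shift u) ≡ V.map suc (V.map key u)
  map-key-shift [] = refl
  map-key-shift (e ∷ u) = cong₂ _∷_ (key-shift e) (map-key-shift u)

  decode-valid : ∀ m c → Valid (decode m c)
  decode-valid zero _ = []
  decode-valid (suc m) ((i , b) , c) = subst (λ w → Unique (toList w)) (sym keys≡)
    (Unique-insertAt _ i zero (Unique-map suc Fin.suc-injective _ (decode-valid m c))
      (All-toList⁺ (V.map suc (V.map key (decode m c))) λ k eq → Fin.0≢1+n (trans eq (VP.lookup-map k suc (V.map key (decode m c))))))
    where
      keys≡ : V.map key (decode (suc m) ((i , b) , c)) ≡ V.insertAt (V.map suc (V.map key (decode m c))) i zero
      keys≡ = trans (VP.map-insertAt key (new b) (V.map shift (decode m c)) i)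
                    (cong₂ (λ w z → V.insertAt w i z) (map-key-shift (decode m c)) (key-new b))

  decode-injective : ∀ m c c′ → decode m c ≡ decode m c′ → c ≡ c′
  decode-injective zero tt tt _ = refl
  decode-injective (suc m) ((i , b) , c) ((i′ , b′) , c′) eq with i Fin.≟ i′
  ... | no i≢i′ = contradiction key≡0 (λ key≡0 → Fin.0≢1+n (trans (sym key≡0) key-shifted))
    where
      key≡0 : key (lookup (decode (suc m) ((i , b) , c)) i′) ≡ zero
      key≡0 = trans (cong (λ w → key (lookup w i′)) eq) (trans (cong key (VP.insertAt-lookup _ i′ (new b′))) (key-new b′))
      key-shifted : key (lookup (decode (suc m) ((i , b) , c)) i′) ≡ suc (key (lookup (decode m c) (punchOut i≢i′)))
      key-shifted = begin
        key (lookup (decode (suc m) ((i , b) , c)) i′)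
          ≡⟨ cong (λ k → key (lookup (decode (suc m) ((i , b) , c)) k)) (Fin.punchIn-punchOut i≢i′) ⟨
        key (lookup (decode (suc m) ((i , b) , c)) (punchIn i (punchOut i≢i′)))
          ≡⟨ cong key (VP.insertAt-punchIn _ i (new b) (punchOut i≢i′)) ⟩
        key (lookup (V.map shift (decode m c)) (punchOut i≢i′))
          ≡⟨ cong key (VP.lookup-map (punchOut i≢i′) shift (decode m c)) ⟩
        key (shift (lookup (decode m c) (punchOut i≢i′)))
          ≡⟨ key-shift _ ⟩
        suc (key (lookup (decode m c) (punchOut i≢i′))) ∎
        where open ≡-Reasoning
  ... | yes refl = cong₂ (λ b c → ((i , b) , c)) b≡b′
      (decode-injective m c c′ (map-injective shift shift-injective _ _ (begin
        V.map shift (decode m c)                      ≡⟨ VP.removeAt-insertAt _ i (new b) ⟨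
        V.removeAt (decode (suc m) ((i , b) , c)) i   ≡⟨ cong (λ w → V.removeAt w i) eq ⟩
        V.removeAt (decode (suc m) ((i , b′) , c′)) i ≡⟨ VP.removeAt-insertAt _ i (new b′) ⟩
        V.map shift (decode m c′)                     ∎)))
    where
      open ≡-Reasoning
      b≡b′ : b ≡ b′
      b≡b′ = new-injective (trans (sym (VP.insertAt-lookup _ i (new b)))
                                  (trans (cong (λ w → lookup w i) eq) (VP.insertAt-lookup _ i (new b′))))

  unshiftAll : ∀ {m l} (u : Vec (E (suc m)) l) → (∀ k → key (lookup u k) ≢ zero) →
               Σ (Vec (E m) l) λ u′ → V.map shift u′ ≡ u
  unshiftAll [] _ = [] , refl
  unshiftAll (e ∷ u) nonzero with unshift e (nonzero zero) | unshiftAll u (nonzero ∘ suc)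
  ... | e′ , shift-e′≡e | u′ , shift-u′≡u = e′ ∷ u′ , cong₂ _∷_ shift-e′≡e shift-u′≡u

  key-injective : ∀ {m l} (x : Vec (E m) l) → Unique (toList (V.map key x)) →
                  ∀ i j → key (lookup x i) ≡ key (lookup x j) → i ≡ j
  key-injective x u i j eq = Unique⇒lookup-injective (V.map key x) u i j
    (trans (VP.lookup-map i key x) (trans eq (sym (VP.lookup-map j key x))))

  -- by pigeonhole: without the key zero, m + 1 distinct keys would lie in Fin m
  Valid⇒key-zero : ∀ {m} (x : Vec (E (suc m)) (suc m)) → Valid x → Σ (Fin (suc m)) λ i → key (lookup x i) ≡ zero
  Valid⇒key-zero {m} x valid with Fin.any? (λ i → key (lookup x i) Fin.≟ zero)
  ... | yes key-zero = key-zero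
  ... | no no-zero with unshiftAll x (λ k eq → no-zero (k , eq))
  ...   | x′ , shift-x′≡x with Fin.pigeonhole (n<1+n m) (key ∘ lookup x′)
  ...     | i , j , i<j , eq = contradiction (key-injective x valid i j (begin
    key (lookup x i)                ≡⟨ cong (λ w → key (lookup w i)) shift-x′≡x ⟨
    key (lookup (V.map shift x′) i) ≡⟨ cong key (VP.lookup-map i shift x′) ⟩
    key (shift (lookup x′ i))       ≡⟨ key-shift _ ⟩
    suc (key (lookup x′ i))         ≡⟨ cong suc eq ⟩
    suc (key (lookup x′ j))         ≡⟨ key-shift _ ⟨
    key (shift (lookup x′ j))       ≡⟨ cong key (VP.lookup-map j shift x′) ⟨
    key (lookup (V.map shift x′) j) ≡⟨ cong (λ w → key (lookup w j)) shift-x′≡x ⟩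
    key (lookup x j)                ∎)) (Fin.<⇒≢ i<j)
    where open ≡-Reasoning

  decode-surjective : ∀ m (x : Vec (E m) m) → Valid x → Σ (Code m) λ c → decode m c ≡ x
  decode-surjective zero [] _ = tt , refl
  decode-surjective (suc m) x valid with Valid⇒key-zero x valid
  ... | i , key≡0 = ((i , b) , proj₁ rest) , (begin
    V.insertAt (V.map shift (decode m (proj₁ rest))) i (new b) ≡⟨ cong (λ w → V.insertAt (V.map shift w) i (new b)) (proj₂ rest) ⟩
    V.insertAt (V.map shift r′) i (new b)                      ≡⟨ cong (λ w → V.insertAt w i (new b)) shift-r′≡r ⟩
    V.insertAt r i (new b)                                     ≡⟨ cong (V.insertAt r i) new-b≡ ⟩
    V.insertAt r i (lookup x i)                                ≡⟨ VP.insertAt-removeAt x i ⟩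
    x                                                          ∎)
    where
      open ≡-Reasoning
      b = proj₁ (unnew (lookup x i) key≡0)
      new-b≡ : new b ≡ lookup x i
      new-b≡ = proj₂ (unnew (lookup x i) key≡0)
      r = V.removeAt x i
      key-r : ∀ k → key (lookup r k) ≡ key (lookup x (punchIn i k))
      key-r k = cong key (lookup-removeAt x i k)
      r-nonzero : ∀ k → key (lookup r k) ≢ zero
      r-nonzero k eq = Fin.punchInᵢ≢i i k (key-injective x valid _ _ (trans (sym (key-r k)) (trans eq (sym key≡0))))
      r′ = proj₁ (unshiftAll r r-nonzero)
      shift-r′≡r : V.map shift r′ ≡ r
      shift-r′≡r = proj₂ (unshiftAll r r-nonzero)
      suc-key-r′ : ∀ k → suc (key (lookup r′ k)) ≡ key (lookup x (punchIn i k))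
      suc-key-r′ k = begin
        suc (key (lookup r′ k))               ≡⟨ key-shift _ ⟨
        key (shift (lookup r′ k))             ≡⟨ cong key (VP.lookup-map k shift r′) ⟨
        key (lookup (V.map shift r′) k)       ≡⟨ cong (λ w → key (lookup w k)) shift-r′≡r ⟩
        key (lookup r k)                      ≡⟨ key-r k ⟩
        key (lookup x (punchIn i k)) ∎
      r′-valid : Valid r′
      r′-valid = lookup-injective⇒Unique (V.map key r′) λ k k′ eq →
        Fin.punchIn-injective i k k′ (key-injective x valid _ _ (begin
          key (lookup x (punchIn i k))  ≡⟨ suc-key-r′ k ⟨
          suc (key (lookup r′ k))                ≡⟨ cong suc (trans (sym (VP.lookup-map k key r′)) (trans eq (VP.lookup-map k′ key r′))) ⟩
          suc (key (lookup r′ k′))               ≡⟨ suc-key-r′ k′ ⟩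
          key (lookup x (punchIn i k′)) ∎))
      rest = decode-surjective m r′ r′-valid

  ∑-valid≡∑-codes : ∀ {labels} → Unique labels → (∀ b → b ∈ labels) → ∀ {m} (xs : List (Vec (E m) m)) →
    Unique xs → (∀ {x} → x ∈ xs ⇔ Valid x) → ∀ (F : Vec (E m) m → ℤ) → ∑ xs F ≡ ∑[ c ∈ codes labels m ] F (decode m c)
  ∑-valid≡∑-codes {labels} labels-unique labels-complete {m} xs xs-unique ∈xs⇔valid F =
    trans (∑-same-members F xs-unique decoded-unique (mk⇔ to from)) (∑-map F (decode m) (codes labels m))
    where
      decoded-unique : Unique (L.map (decode m) (codes labels m))
      decoded-unique = Uniqueₚ.map⁺ (λ {c} {c′} → decode-injective m c c′) (Unique-codes labels-unique m)
      to : ∀ {x} → x ∈ xs → x ∈ L.map (decode m) (codes labels m)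
      to {x} x∈xs with decode-surjective m x (Equivalence.to ∈xs⇔valid x∈xs)
      ... | c , refl = ∈ₚ.∈-map⁺ (decode m) (∈-codes labels-complete m c)
      from : ∀ {x} → x ∈ L.map (decode m) (codes labels m) → x ∈ xs
      from x∈ with ∈ₚ.∈-map⁻ (decode m) x∈
      ... | c , _ , refl = Equivalence.from ∈xs⇔valid (decode-valid m c)

  ∑-codes-pow : ∀ labels (stat : ∀ {m} → Vec (E m) m → ℕ) (incr : ℕ → ℕ → Label → ℕ) → stat [] ≡ 0 →
    (∀ m i b c → stat (decode (suc m) ((i , b) , c)) ≡ incr m (toℕ i) b + stat (decode m c)) →
    ∀ t m → ∑[ c ∈ codes labels m ] (t ^ℤ stat (decode m c)) ≡ levelProduct labels incr t m
  ∑-codes-pow labels stat incr stat-[] stat-decode t zero = trans (ℤP.+-identityʳ _) (cong (t ^ℤ_) stat-[])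
  ∑-codes-pow labels stat incr stat-decode-zero stat-decode t (suc m) = begin
    ∑[ z ∈ codes labels (suc m) ] (t ^ℤ stat (decode (suc m) z))
      ≡⟨ ∑-cong (codes labels (suc m)) (λ z _ → split z) ⟩
    ∑[ z ∈ codes labels (suc m) ] (f (proj₁ z) *ℤ g (proj₂ z))
      ≡⟨ ∑-product f g (L.cartesianProduct (L.allFin (suc m)) labels) (codes labels m) ⟩
    levelSum labels incr t m *ℤ ∑[ c ∈ codes labels m ] g c
      ≡⟨ cong (levelSum labels incr t m *ℤ_) (∑-codes-pow labels stat incr stat-decode-zero stat-decode t m) ⟩
    levelProduct labels incr t (suc m) ∎
    where
      open ≡-Reasoning
      f : Fin (suc m) × Label → ℤ
      f z = t ^ℤ incr m (toℕ (proj₁ z)) (proj₂ z)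
      g : Code m → ℤ
      g c = t ^ℤ stat (decode m c)
      split : ∀ z → t ^ℤ stat (decode (suc m) z) ≡ f (proj₁ z) *ℤ g (proj₂ z)
      split ((i , b) , c) = trans (cong (t ^ℤ_) (stat-decode m i b c)) (ℤP.^-distribˡ-+-* t (incr m (toℕ i) b) _)

unshiftFin : ∀ {m} (e : Fin (suc m)) → e ≢ zero → Σ (Fin m) λ e′ → suc e′ ≡ e
unshiftFin zero e≢0 = contradiction refl e≢0
unshiftFin (suc e) _ = e , refl

unnewFin : ∀ {m} (e : Fin (suc m)) → e ≡ zero → Σ ⊤ λ _ → zero ≡ e
unnewFin e e≡0 = tt , sym e≡0

module CodeA = InsertionCode {Fin} {⊤} (λ e → e) suc (λ _ → zero) (λ _ → refl) (λ _ → refl)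
  Fin.suc-injective (λ _ → refl) unshiftFin unnewFin

shiftSigned : ∀ {m} → Signed m → Signed (suc m)
shiftSigned (j , b) = (suc j , b)

shiftSigned-injective : ∀ {m} {e e′ : Signed m} → shiftSigned e ≡ shiftSigned e′ → e ≡ e′
shiftSigned-injective {e = j , b} {j′ , b′} eq = cong₂ _,_ (Fin.suc-injective (cong proj₁ eq)) (cong proj₂ eq)

unshiftSigned : ∀ {m} (e : Signed (suc m)) → proj₁ e ≢ zero → Σ (Signed m) λ e′ → shiftSigned e′ ≡ e
unshiftSigned (zero , b) j≢0 = contradiction refl j≢0
unshiftSigned (suc j , b) _ = (j , b) , refl

unnewSigned : ∀ {m} (e : Signed (suc m)) → proj₁ e ≡ zero → Σ Bool λ b → (zero , b) ≡ e
unnewSigned (.zero , b) refl = b , refl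

module CodeB = InsertionCode {Signed} {Bool} proj₁ shiftSigned (λ b → zero , b) (λ _ → refl) (λ _ → refl)
  shiftSigned-injective (cong proj₂) unshiftSigned unnewSigned

bools : List Bool
bools = true ∷ false ∷ []

Unique-bools : Unique bools
Unique-bools = ((λ ()) ∷ []) ∷ [] ∷ []

∈-bools : ∀ b → b ∈ bools
∈-bools true = here refl
∈-bools false = there (here refl)

Unique-elemsA : ∀ n → Unique (elemsA n)
Unique-elemsA n = Uniqueₚ.filter⁺ (λ x → UD.unique? Fin._≟_ (toList x)) (Unique-vecs _ (suc n) (Uniqueₚ.allFin⁺ (suc n)))

∈-elemsA : ∀ n {x} → x ∈ elemsA n ⇔ IsPerm x
∈-elemsA n = ∈-filter-vecs (λ x → UD.unique? Fin._≟_ (toList x)) (L.allFin (suc n)) ∈ₚ.∈-allFin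

Unique-elemsB : ∀ p → Unique (elemsB p)
Unique-elemsB p = Uniqueₚ.filter⁺ (λ x → UD.unique? Fin._≟_ (toList (V.map proj₁ x)))
  (Unique-vecs _ p (Uniqueₚ.cartesianProduct⁺ (Uniqueₚ.allFin⁺ p) Unique-bools))

∈-elemsB : ∀ p {x} → x ∈ elemsB p ⇔ IsSPerm x
∈-elemsB p = ∈-filter-vecs (λ x → UD.unique? Fin._≟_ (toList (V.map proj₁ x))) _
  (λ (j , b) → ∈ₚ.∈-cartesianProduct⁺ (∈ₚ.∈-allFin j) (∈-bools b))

∑-elemsA : ∀ n (F : Perm (suc n) → ℤ) → ∑ (elemsA n) F ≡ ∑[ c ∈ CodeA.codes (tt ∷ []) (suc n) ] F (CodeA.decode (suc n) c)
∑-elemsA n = CodeA.∑-valid≡∑-codes ([] ∷ []) (λ _ → here refl) (elemsA n) (Unique-elemsA n)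
  (λ {x} → subst (λ y → x ∈ elemsA n ⇔ Unique (toList y)) (sym (VP.map-id x)) (∈-elemsA n))

∑-elemsB : ∀ p (F : SPerm p → ℤ) → ∑ (elemsB p) F ≡ ∑[ c ∈ CodeB.codes bools p ] F (CodeB.decode p c)
∑-elemsB p = CodeB.∑-valid≡∑-codes Unique-bools ∈-bools (elemsB p) (Unique-elemsB p) (∈-elemsB p)

incrA : ℕ → ℕ → ⊤ → ℕ
incrA m a _ = a

poincaréA : ℤ → ℕ → ℤ
poincaréA = levelProduct (tt ∷ []) incrA

inv-decodeA : ∀ m i c → inv (CodeA.decode (suc m) ((i , tt) , c)) ≡ incrA m (toℕ i) tt + inv (CodeA.decode m c)
inv-decodeA m i c = begin
  inv (V.insertAt (V.map suc d) i zero)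
    ≡⟨ inv-insertAt suc d i zero 1 0 (λ _ → refl) (λ _ → refl) ⟩
  inv (V.map suc d) + toℕ i * 1 + (m ∸ toℕ i) * 0 + 0
    ≡⟨ cong (λ s → s + toℕ i * 1 + (m ∸ toℕ i) * 0 + 0) (inv-map suc (λ _ _ → refl) (λ _ → refl) d) ⟩
  inv d + toℕ i * 1 + (m ∸ toℕ i) * 0 + 0
    ≡⟨ simplify (inv d) (toℕ i) (m ∸ toℕ i) ⟩
  toℕ i + inv d ∎
  where
    open ≡-Reasoning
    d = CodeA.decode m c
    simplify : ∀ s a r → s + a * 1 + r * 0 + 0 ≡ a + s
    simplify = solve-∀

∑-pow-inv : ∀ n t → ∑[ x ∈ elemsA n ] (t ^ℤ inv x) ≡ poincaréA t (suc n)
∑-pow-inv n t = trans (∑-elemsA n (λ x → t ^ℤ inv x))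
  (CodeA.∑-codes-pow (tt ∷ []) inv incrA refl (λ m i _ c → inv-decodeA m i c) t (suc n))

invertedB-shift : ∀ {m} (h x : Signed m) → invertedB (shiftSigned h) (shiftSigned x) ≡ invertedB h x
invertedB-shift (j , false) (j′ , false) = refl
invertedB-shift (j , false) (j′ , true) = refl
invertedB-shift (j , true) (j′ , false) = refl
invertedB-shift (j , true) (j′ , true) = refl

invertedB-shift-new : ∀ {m} (h : Signed m) b → invertedB (shiftSigned h) (zero , b) ≡ 1
invertedB-shift-new (j , false) false = refl
invertedB-shift-new (j , false) true = refl
invertedB-shift-new (j , true) false = refl
invertedB-shift-new (j , true) true = refl

invertedB-new-shift : ∀ {m} b (h : Signed m) → invertedB (zero , b) (shiftSigned h) ≡ 2 * 𝟙 b
invertedB-new-shift false (j , false) = refl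
invertedB-new-shift false (j , true) = refl
invertedB-new-shift true (j , false) = refl
invertedB-new-shift true (j , true) = refl

incrB : ℕ → ℕ → Bool → ℕ
incrB m a b = a + (m ∸ a) * (2 * 𝟙 b) + 𝟙 b

poincaréB : ℤ → ℕ → ℤ
poincaréB = levelProduct bools incrB

invB-decodeB : ∀ m i b c → invB (CodeB.decode (suc m) ((i , b) , c)) ≡ incrB m (toℕ i) b + invB (CodeB.decode m c)
invB-decodeB m i b c = begin
  invB (V.insertAt (V.map shiftSigned d) i (zero , b))
    ≡⟨ invB-insertAt shiftSigned d i (zero , b) 1 (2 * 𝟙 b) (λ h → invertedB-shift-new h b) (invertedB-new-shift b) ⟩
  invB (V.map shiftSigned d) + toℕ i * 1 + (m ∸ toℕ i) * (2 * 𝟙 b) + 𝟙 b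
    ≡⟨ cong (λ s → s + toℕ i * 1 + (m ∸ toℕ i) * (2 * 𝟙 b) + 𝟙 b) (invB-map shiftSigned invertedB-shift (λ _ → refl) d) ⟩
  invB d + toℕ i * 1 + (m ∸ toℕ i) * (2 * 𝟙 b) + 𝟙 b
    ≡⟨ shuffle (invB d) (toℕ i) (m ∸ toℕ i) (𝟙 b) ⟩
  incrB m (toℕ i) b + invB d ∎
  where
    open ≡-Reasoning
    d = CodeB.decode m c
    shuffle : ∀ s a r e → s + a * 1 + r * (2 * e) + e ≡ a + r * (2 * e) + e + s
    shuffle = solve-∀

∑-pow-invB : ∀ p t → ∑[ x ∈ elemsB p ] (t ^ℤ invB x) ≡ poincaréB t p
∑-pow-invB p t = trans (∑-elemsB p (λ x → t ^ℤ invB x))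
  (CodeB.∑-codes-pow bools invB incrB refl invB-decodeB t p)

-- The statistic 2 invB - (2 - c) negatives, i.e. inv ∘ ψ (c = 1 for n odd, c = 3 for n even),
-- as a pair statistic.
module FoldedInv (c : ℕ) = PairStatistic {Signed} (λ h x → 2 * invertedB h x) (λ h → c * 𝟙 (proj₂ h))

foldedInv : ℕ → ∀ {m l} → Vec (Signed m) l → ℕ
foldedInv c = FoldedInv.pairStat c

foldedInv-negatives : ∀ c {m l} (v : Vec (Signed m) l) → foldedInv c v + 2 * negatives v ≡ 2 * invB v + c * negatives v
foldedInv-negatives c [] = sym (*-zeroʳ c)
foldedInv-negatives c (h ∷ t) = begin
  2r + c * s + foldedInv c t + 2 * (s + negatives t)        ≡⟨ cong (λ r → r + c * s + foldedInv c t + 2 * (s + negatives t)) (row≡ t) ⟩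
  2 * r + c * s + foldedInv c t + 2 * (s + negatives t)     ≡⟨ shuffle c r s (foldedInv c t) (negatives t) ⟩
  2 * r + c * s + 2 * s + (foldedInv c t + 2 * negatives t) ≡⟨ cong (2 * r + c * s + 2 * s +_) (foldedInv-negatives c t) ⟩
  2 * r + c * s + 2 * s + (2 * invB t + c * negatives t)    ≡⟨ shuffle′ c r s (invB t) (negatives t) ⟩
  2 * (r + s + invB t) + c * (s + negatives t)              ∎
  where
    open ≡-Reasoning
    r = invRowB h t
    2r = FoldedInv.rowSum c h t
    s = 𝟙 (proj₂ h)
    row≡ : ∀ {l} (t : Vec _ l) → FoldedInv.rowSum c h t ≡ 2 * invRowB h t
    row≡ [] = refl
    row≡ (x ∷ t) = trans (cong (2 * invertedB h x +_) (row≡ t)) (sym (*-distribˡ-+ 2 (invertedB h x) (invRowB h t)))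
    shuffle : ∀ c r s f n → 2 * r + c * s + f + 2 * (s + n) ≡ 2 * r + c * s + 2 * s + (f + 2 * n)
    shuffle = solve-∀
    shuffle′ : ∀ c r s b n → 2 * r + c * s + 2 * s + (2 * b + c * n) ≡ 2 * (r + s + b) + c * (s + n)
    shuffle′ = solve-∀

incrF : ℕ → ℕ → ℕ → Bool → ℕ
incrF c m a b = 2 * a + (m ∸ a) * (2 * (2 * 𝟙 b)) + c * 𝟙 b

poincaréψ : ℕ → ℤ → ℕ → ℤ
poincaréψ c = levelProduct bools (incrF c)

foldedInv-decodeB : ∀ c m i b d → foldedInv c (CodeB.decode (suc m) ((i , b) , d)) ≡ incrF c m (toℕ i) b + foldedInv c (CodeB.decode m d)
foldedInv-decodeB c m i b d = begin
  foldedInv c (V.insertAt (V.map shiftSigned x) i (zero , b))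
    ≡⟨ FoldedInv.pairStat-insertAt c shiftSigned x i (zero , b) 2 (2 * (2 * 𝟙 b))
         (λ h → cong (2 *_) (invertedB-shift-new h b)) (λ h → cong (2 *_) (invertedB-new-shift b h)) ⟩
  foldedInv c (V.map shiftSigned x) + toℕ i * 2 + (m ∸ toℕ i) * (2 * (2 * 𝟙 b)) + c * 𝟙 b
    ≡⟨ cong (λ s → s + toℕ i * 2 + (m ∸ toℕ i) * (2 * (2 * 𝟙 b)) + c * 𝟙 b)
            (FoldedInv.pairStat-map c shiftSigned (λ h y → cong (2 *_) (invertedB-shift h y)) (λ _ → refl) x) ⟩
  foldedInv c x + toℕ i * 2 + (m ∸ toℕ i) * (2 * (2 * 𝟙 b)) + c * 𝟙 b
    ≡⟨ shuffle (foldedInv c x) (toℕ i) (m ∸ toℕ i) (2 * (2 * 𝟙 b)) (c * 𝟙 b) ⟩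
  incrF c m (toℕ i) b + foldedInv c x ∎
  where
    open ≡-Reasoning
    x = CodeB.decode m d
    shuffle : ∀ s a r e f → s + a * 2 + r * e + f ≡ 2 * a + r * e + f + s
    shuffle = solve-∀

∑-pow-foldedInv : ∀ c p t → ∑[ x ∈ elemsB p ] (t ^ℤ foldedInv c x) ≡ poincaréψ c t p
∑-pow-foldedInv c p t = trans (∑-elemsB p (λ x → t ^ℤ foldedInv c x))
  (CodeB.∑-codes-pow bools (foldedInv c) (incrF c) refl (foldedInv-decodeB c) t p)

-- Poincaré polynomials

[_]_ : ℕ → ℤ → ℤ
[ zero ] t = 0ℤ
[ suc k ] t = 1ℤ +ℤ t *ℤ [ k ] t

[+]-split : ∀ t a b → [ a + b ] t ≡ [ a ] t +ℤ t ^ℤ a *ℤ [ b ] t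
[+]-split t zero b = sym (trans (ℤP.+-identityˡ _) (ℤP.*-identityˡ _))
[+]-split t (suc a) b = trans (cong (λ s → 1ℤ +ℤ t *ℤ s) ([+]-split t a b)) (distrib t ([ a ] t) (t ^ℤ a) ([ b ] t))
  where
    distrib : ∀ t g ta gb → 1ℤ +ℤ t *ℤ (g +ℤ ta *ℤ gb) ≡ 1ℤ +ℤ t *ℤ g +ℤ t *ℤ ta *ℤ gb
    distrib = ℤSolver.solve-∀

^-double : ∀ t k → t ^ℤ (k + k) ≡ (t *ℤ t) ^ℤ k
^-double t zero = refl
^-double t (suc k) = begin
  t *ℤ t ^ℤ (k + suc k)     ≡⟨ cong (λ e → t *ℤ t ^ℤ e) (+-suc k k) ⟩
  t *ℤ (t *ℤ t ^ℤ (k + k))  ≡⟨ cong (λ s → t *ℤ (t *ℤ s)) (^-double t k) ⟩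
  t *ℤ (t *ℤ (t *ℤ t) ^ℤ k) ≡⟨ ℤP.*-assoc t t _ ⟨
  t *ℤ t *ℤ (t *ℤ t) ^ℤ k   ∎
  where open ≡-Reasoning

[double] : ∀ t k → [ k + k ] t ≡ (1ℤ +ℤ t) *ℤ [ k ] (t *ℤ t)
[double] t zero = sym (ℤP.*-zeroʳ (1ℤ +ℤ t))
[double] t (suc k) = begin
  [ suc (k + suc k) ] t                    ≡⟨ cong (λ e → [ suc e ] t) (+-suc k k) ⟩
  1ℤ +ℤ t *ℤ (1ℤ +ℤ t *ℤ [ k + k ] t)      ≡⟨ cong (λ s → 1ℤ +ℤ t *ℤ (1ℤ +ℤ t *ℤ s)) ([double] t k) ⟩
  1ℤ +ℤ t *ℤ (1ℤ +ℤ t *ℤ ((1ℤ +ℤ t) *ℤ g)) ≡⟨ regroup t g ⟩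
  (1ℤ +ℤ t) *ℤ (1ℤ +ℤ t *ℤ t *ℤ g)         ∎
  where
    open ≡-Reasoning
    g = [ k ] (t *ℤ t)
    regroup : ∀ t g → 1ℤ +ℤ t *ℤ (1ℤ +ℤ t *ℤ ((1ℤ +ℤ t) *ℤ g)) ≡ (1ℤ +ℤ t) *ℤ (1ℤ +ℤ t *ℤ t *ℤ g)
    regroup = ℤSolver.solve-∀

[]-telescope : ∀ s k → (1ℤ -ℤ s) *ℤ [ k ] s ≡ 1ℤ -ℤ s ^ℤ k
[]-telescope s zero = ℤP.*-zeroʳ (1ℤ -ℤ s)
[]-telescope s (suc k) = begin
  (1ℤ -ℤ s) *ℤ (1ℤ +ℤ s *ℤ [ k ] s)      ≡⟨ expand s ([ k ] s) ⟩
  1ℤ -ℤ s +ℤ s *ℤ ((1ℤ -ℤ s) *ℤ [ k ] s) ≡⟨ cong (λ z → 1ℤ -ℤ s +ℤ s *ℤ z) ([]-telescope s k) ⟩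
  1ℤ -ℤ s +ℤ s *ℤ (1ℤ -ℤ s ^ℤ k)         ≡⟨ collapse s (s ^ℤ k) ⟩
  1ℤ -ℤ s *ℤ s ^ℤ k                      ∎
  where
    open ≡-Reasoning
    expand : ∀ s g → (1ℤ -ℤ s) *ℤ (1ℤ +ℤ s *ℤ g) ≡ 1ℤ -ℤ s +ℤ s *ℤ ((1ℤ -ℤ s) *ℤ g)
    expand = ℤSolver.solve-∀
    collapse : ∀ s sk → 1ℤ -ℤ s +ℤ s *ℤ (1ℤ -ℤ sk) ≡ 1ℤ -ℤ s *ℤ sk
    collapse = ℤSolver.solve-∀

[odd]-neg : ∀ q k → (1ℤ +ℤ q) *ℤ [ suc (k + k) ] (- q) ≡ 1ℤ +ℤ q ^ℤ suc (k + k)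
[odd]-neg q k = begin
  (1ℤ +ℤ q) *ℤ (1ℤ +ℤ (- q) *ℤ [ k + k ] (- q))              ≡⟨ cong (λ z → (1ℤ +ℤ q) *ℤ (1ℤ +ℤ (- q) *ℤ z)) ([double] (- q) k) ⟩
  (1ℤ +ℤ q) *ℤ (1ℤ +ℤ (- q) *ℤ ((1ℤ +ℤ - q) *ℤ [ k ] (- q *ℤ - q)))
    ≡⟨ cong (λ s → (1ℤ +ℤ q) *ℤ (1ℤ +ℤ (- q) *ℤ ((1ℤ +ℤ - q) *ℤ [ k ] s))) (neg-square q) ⟩
  (1ℤ +ℤ q) *ℤ (1ℤ +ℤ (- q) *ℤ ((1ℤ +ℤ - q) *ℤ [ k ] (q *ℤ q))) ≡⟨ expand q ([ k ] (q *ℤ q)) ⟩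
  1ℤ +ℤ q -ℤ q *ℤ ((1ℤ -ℤ q *ℤ q) *ℤ [ k ] (q *ℤ q))            ≡⟨ cong (λ z → 1ℤ +ℤ q -ℤ q *ℤ z) ([]-telescope (q *ℤ q) k) ⟩
  1ℤ +ℤ q -ℤ q *ℤ (1ℤ -ℤ (q *ℤ q) ^ℤ k)                         ≡⟨ collapse q ((q *ℤ q) ^ℤ k) ⟩
  1ℤ +ℤ q *ℤ (q *ℤ q) ^ℤ k                                      ≡⟨ cong (λ z → 1ℤ +ℤ q *ℤ z) (^-double q k) ⟨
  1ℤ +ℤ q ^ℤ suc (k + k)                                        ∎
  where
    open ≡-Reasoning
    neg-square : ∀ q → (- q) *ℤ (- q) ≡ q *ℤ q
    neg-square = ℤSolver.solve-∀
    expand : ∀ q g → (1ℤ +ℤ q) *ℤ (1ℤ +ℤ (- q) *ℤ ((1ℤ +ℤ - q) *ℤ g)) ≡ 1ℤ +ℤ q -ℤ q *ℤ ((1ℤ -ℤ q *ℤ q) *ℤ g)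
    expand = ℤSolver.solve-∀
    collapse : ∀ q s → 1ℤ +ℤ q -ℤ q *ℤ (1ℤ -ℤ s) ≡ 1ℤ +ℤ q *ℤ s
    collapse = ℤSolver.solve-∀

∑< : ℕ → (ℕ → ℤ) → ℤ
∑< k f = ∑[ a ∈ L.allFin k ] f (toℕ a)

syntax ∑< k (λ a → e) = ∑[ a < k ] e

∑<-suc : ∀ k f → ∑< (suc k) f ≡ f 0 +ℤ ∑< k (f ∘ suc)
∑<-suc k f = cong (f 0 +ℤ_) (cong sumℤ (trans (LP.map-tabulate {n = k} suc (λ a → f (toℕ a)))
                                              (sym (LP.map-tabulate {n = k} (λ a → a) (λ a → f (suc (toℕ a)))))))

∑<-cong : ∀ k {f g} → (∀ a → a < k → f a ≡ g a) → ∑< k f ≡ ∑< k g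
∑<-cong zero _ = refl
∑<-cong (suc k) {f} {g} f≗g = begin
  ∑< (suc k) f          ≡⟨ ∑<-suc k f ⟩
  f 0 +ℤ ∑< k (f ∘ suc) ≡⟨ cong₂ _+ℤ_ (f≗g 0 (s≤s z≤n)) (∑<-cong k (λ a a<k → f≗g (suc a) (s≤s a<k))) ⟩
  g 0 +ℤ ∑< k (g ∘ suc) ≡⟨ ∑<-suc k g ⟨
  ∑< (suc k) g          ∎
  where open ≡-Reasoning

∑<-snoc : ∀ k f → ∑< (suc k) f ≡ ∑< k f +ℤ f k
∑<-snoc zero f = trans (∑<-suc 0 f) (trans (ℤP.+-identityʳ (f 0)) (sym (ℤP.+-identityˡ (f 0))))
∑<-snoc (suc k) f = begin
  ∑< (suc (suc k)) f                   ≡⟨ ∑<-suc (suc k) f ⟩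
  f 0 +ℤ ∑< (suc k) (f ∘ suc)          ≡⟨ cong (f 0 +ℤ_) (∑<-snoc k (f ∘ suc)) ⟩
  f 0 +ℤ (∑< k (f ∘ suc) +ℤ f (suc k)) ≡⟨ ℤP.+-assoc (f 0) _ _ ⟨
  f 0 +ℤ ∑< k (f ∘ suc) +ℤ f (suc k)   ≡⟨ cong (_+ℤ f (suc k)) (∑<-suc k f) ⟨
  ∑< (suc k) f +ℤ f (suc k)            ∎
  where open ≡-Reasoning

∑<-reverse : ∀ m f → ∑[ a < suc m ] f (m ∸ a) ≡ ∑< (suc m) f
∑<-reverse zero f = refl
∑<-reverse (suc m) f = begin
  ∑[ a < suc (suc m) ] f (suc m ∸ a)    ≡⟨ ∑<-suc (suc m) (λ a → f (suc m ∸ a)) ⟩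
  f (suc m) +ℤ ∑[ a < suc m ] f (m ∸ a) ≡⟨ cong (f (suc m) +ℤ_) (∑<-reverse m f) ⟩
  f (suc m) +ℤ ∑< (suc m) f             ≡⟨ ℤP.+-comm (f (suc m)) _ ⟩
  ∑< (suc m) f +ℤ f (suc m)             ≡⟨ ∑<-snoc (suc m) f ⟨
  ∑< (suc (suc m)) f                    ∎
  where open ≡-Reasoning

∑<-geometric : ∀ t k → ∑[ a < k ] (t ^ℤ a) ≡ [ k ] t
∑<-geometric t zero = refl
∑<-geometric t (suc k) = trans (∑<-suc k (t ^ℤ_))
  (cong (1ℤ +ℤ_) (trans (∑-*ˡ t (λ a → t ^ℤ toℕ a) (L.allFin k)) (cong (t *ℤ_) (∑<-geometric t k))))

∑<-reversed-geometric : ∀ (K t : ℤ) m (g : ℕ → ℤ) → (∀ a → a < suc m → g a ≡ K *ℤ t ^ℤ (m ∸ a)) →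
                        ∑< (suc m) g ≡ K *ℤ [ suc m ] t
∑<-reversed-geometric K t m g g≡ = begin
  ∑< (suc m) g                       ≡⟨ ∑<-cong (suc m) g≡ ⟩
  ∑[ a < suc m ] (K *ℤ t ^ℤ (m ∸ a)) ≡⟨ ∑-*ˡ K (λ a → t ^ℤ (m ∸ toℕ a)) (L.allFin (suc m)) ⟩
  K *ℤ ∑[ a < suc m ] (t ^ℤ (m ∸ a)) ≡⟨ cong (K *ℤ_) (trans (∑<-reverse m (t ^ℤ_)) (∑<-geometric t (suc m))) ⟩
  K *ℤ [ suc m ] t                   ∎
  where open ≡-Reasoning

levelSum-⊤ : ∀ incr t m → levelSum (tt ∷ []) incr t m ≡ ∑[ a < suc m ] (t ^ℤ incr m a tt)
levelSum-⊤ incr t m = trans (∑-cartesianProduct (λ z → t ^ℤ incr m (toℕ (proj₁ z)) (proj₂ z)) (L.allFin (suc m)) (tt ∷ []))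
  (∑-cong {g = λ a → t ^ℤ incr m (toℕ a) tt} (L.allFin (suc m)) (λ a _ → ℤP.+-identityʳ _))

levelSum-bools : ∀ incr t m → levelSum bools incr t m ≡ ∑[ a < suc m ] (t ^ℤ incr m a true) +ℤ ∑[ a < suc m ] (t ^ℤ incr m a false)
levelSum-bools incr t m = begin
  levelSum bools incr t m
    ≡⟨ ∑-cartesianProduct (λ z → t ^ℤ incr m (toℕ (proj₁ z)) (proj₂ z)) (L.allFin (suc m)) bools ⟩
  ∑[ a ∈ L.allFin (suc m) ] (t ^ℤ incr m (toℕ a) true +ℤ (t ^ℤ incr m (toℕ a) false +ℤ 0ℤ))
    ≡⟨ ∑-cong (L.allFin (suc m)) (λ a _ → cong (t ^ℤ incr m (toℕ a) true +ℤ_) (ℤP.+-identityʳ _)) ⟩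
  ∑[ a ∈ L.allFin (suc m) ] (t ^ℤ incr m (toℕ a) true +ℤ t ^ℤ incr m (toℕ a) false)
    ≡⟨ ∑-+ (λ a → t ^ℤ incr m (toℕ a) true) (λ a → t ^ℤ incr m (toℕ a) false) (L.allFin (suc m)) ⟩
  ∑[ a < suc m ] (t ^ℤ incr m a true) +ℤ ∑[ a < suc m ] (t ^ℤ incr m a false) ∎
  where open ≡-Reasoning

a+[m∸a] : ∀ {m a} → a < suc m → a + (m ∸ a) ≡ m
a+[m∸a] a<1+m = m+[n∸m]≡n (s≤s⁻¹ a<1+m)

levelSum-A : ∀ t m → levelSum (tt ∷ []) incrA t m ≡ [ suc m ] t
levelSum-A t m = trans (levelSum-⊤ incrA t m) (∑<-geometric t (suc m))

levelSum-B : ∀ t m → levelSum bools incrB t m ≡ [ suc m + suc m ] t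
levelSum-B t m = begin
  levelSum bools incrB t m                                      ≡⟨ levelSum-bools incrB t m ⟩
  ∑[ a < suc m ] (t ^ℤ incrB m a true) +ℤ ∑[ a < suc m ] (t ^ℤ incrB m a false)
    ≡⟨ cong₂ _+ℤ_ (∑<-reversed-geometric (t ^ℤ suc m) t m _ negative) (∑<-cong (suc m) positive) ⟩
  t ^ℤ suc m *ℤ [ suc m ] t +ℤ ∑[ a < suc m ] (t ^ℤ a) ≡⟨ cong (t ^ℤ suc m *ℤ [ suc m ] t +ℤ_) (∑<-geometric t (suc m)) ⟩
  t ^ℤ suc m *ℤ [ suc m ] t +ℤ [ suc m ] t             ≡⟨ ℤP.+-comm _ ([ suc m ] t) ⟩
  [ suc m ] t +ℤ t ^ℤ suc m *ℤ [ suc m ] t             ≡⟨ [+]-split t (suc m) (suc m) ⟨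
  [ suc m + suc m ] t                                  ∎
  where
    open ≡-Reasoning
    exponent : ∀ a d → a + d * (2 * 1) + 1 ≡ suc (a + d) + d
    exponent = solve-∀
    negative : ∀ a → a < suc m → t ^ℤ incrB m a true ≡ t ^ℤ suc m *ℤ t ^ℤ (m ∸ a)
    negative a a<1+m = trans (cong (t ^ℤ_) (trans (exponent a (m ∸ a)) (cong (λ k → suc k + (m ∸ a)) (a+[m∸a] a<1+m))))
                             (ℤP.^-distribˡ-+-* t (suc m) (m ∸ a))
    positive : ∀ a → a < suc m → t ^ℤ incrB m a false ≡ t ^ℤ a
    positive a _ = cong (t ^ℤ_) (trans (+-identityʳ _) (trans (cong (a +_) (*-zeroʳ (m ∸ a))) (+-identityʳ a)))

levelSum-F : ∀ c q m → levelSum bools (incrF c) q m ≡ q ^ℤ (c + (m + m)) *ℤ [ suc m ] (q *ℤ q) +ℤ [ suc m ] (q *ℤ q)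
levelSum-F c q m = begin
  levelSum bools (incrF c) q m                                  ≡⟨ levelSum-bools (incrF c) q m ⟩
  ∑[ a < suc m ] (q ^ℤ incrF c m a true) +ℤ ∑[ a < suc m ] (q ^ℤ incrF c m a false)
    ≡⟨ cong₂ _+ℤ_ (∑<-reversed-geometric (q ^ℤ (c + (m + m))) (q *ℤ q) m _ negative)
                  (trans (∑<-cong (suc m) positive) (∑<-geometric (q *ℤ q) (suc m))) ⟩
  q ^ℤ (c + (m + m)) *ℤ [ suc m ] (q *ℤ q) +ℤ [ suc m ] (q *ℤ q) ∎
  where
    open ≡-Reasoning
    exponent : ∀ c a d → 2 * a + d * (2 * (2 * 1)) + c * 1 ≡ c + ((a + d) + (a + d)) + (d + d)
    exponent = solve-∀
    negative : ∀ a → a < suc m → q ^ℤ incrF c m a true ≡ q ^ℤ (c + (m + m)) *ℤ (q *ℤ q) ^ℤ (m ∸ a)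
    negative a a<1+m = begin
      q ^ℤ incrF c m a true
        ≡⟨ cong (q ^ℤ_) (trans (exponent c a (m ∸ a)) (cong (λ k → c + (k + k) + (m ∸ a + (m ∸ a))) (a+[m∸a] a<1+m))) ⟩
      q ^ℤ (c + (m + m) + (m ∸ a + (m ∸ a)))
        ≡⟨ ℤP.^-distribˡ-+-* q (c + (m + m)) _ ⟩
      q ^ℤ (c + (m + m)) *ℤ q ^ℤ (m ∸ a + (m ∸ a))
        ≡⟨ cong (q ^ℤ (c + (m + m)) *ℤ_) (^-double q (m ∸ a)) ⟩
      q ^ℤ (c + (m + m)) *ℤ (q *ℤ q) ^ℤ (m ∸ a) ∎
    double : ∀ a d → 2 * a + d * (2 * (2 * 0)) + 0 ≡ a + a
    double = solve-∀
    positive : ∀ a → a < suc m → q ^ℤ incrF c m a false ≡ (q *ℤ q) ^ℤ a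
    positive a _ = trans (cong (q ^ℤ_) (trans (cong (2 * a + (m ∸ a) * (2 * (2 * 0)) +_) (*-zeroʳ c)) (double a (m ∸ a))))
                         (^-double q a)

-- [2m + 2]_q = (1 + q) [m + 1]_{q²} and (1 + q) [e]_{-q} = 1 + q^e for the odd exponent e
levelSum-identity : ∀ q m j → levelSum bools incrB (- q) m *ℤ levelSum bools (incrF (suc (j + j))) q m
                              ≡ [ suc (j + j) + (m + m) ] (- q) *ℤ [ suc m + suc m ] (- q) *ℤ levelSum bools incrB q m
levelSum-identity q m j = begin
  levelSum bools incrB (- q) m *ℤ levelSum bools (incrF (suc (j + j))) q m
    ≡⟨ cong₂ _*ℤ_ (levelSum-B (- q) m) (levelSum-F (suc (j + j)) q m) ⟩
  X *ℤ (q ^ℤ e *ℤ h +ℤ h)            ≡⟨ factor X h (q ^ℤ e) ⟩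
  X *ℤ h *ℤ (1ℤ +ℤ q ^ℤ e)           ≡⟨ cong (λ z → X *ℤ h *ℤ (1ℤ +ℤ q ^ℤ z)) e≡ ⟩
  X *ℤ h *ℤ (1ℤ +ℤ q ^ℤ suc (k + k)) ≡⟨ cong (X *ℤ h *ℤ_) ([odd]-neg q k) ⟨
  X *ℤ h *ℤ ((1ℤ +ℤ q) *ℤ Y′)        ≡⟨ regroup X h q Y′ ⟩
  Y′ *ℤ X *ℤ ((1ℤ +ℤ q) *ℤ h)        ≡⟨ cong (λ z → [ z ] (- q) *ℤ X *ℤ ((1ℤ +ℤ q) *ℤ h)) e≡ ⟨
  Y *ℤ X *ℤ ((1ℤ +ℤ q) *ℤ h)         ≡⟨ cong (Y *ℤ X *ℤ_) (trans (sym ([double] q (suc m))) (sym (levelSum-B q m))) ⟩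
  Y *ℤ X *ℤ levelSum bools incrB q m ∎
  where
    open ≡-Reasoning
    k = j + m
    e = suc (j + j) + (m + m)
    e≡ : e ≡ suc (k + k)
    e≡ = cong suc (shuffle j m)
      where
        shuffle : ∀ j m → j + j + (m + m) ≡ j + m + (j + m)
        shuffle = solve-∀
    X = [ suc m + suc m ] (- q)
    Y = [ e ] (- q)
    Y′ = [ suc (k + k) ] (- q)
    h = [ suc m ] (q *ℤ q)
    factor : ∀ X h Q → X *ℤ (Q *ℤ h +ℤ h) ≡ X *ℤ h *ℤ (1ℤ +ℤ Q)
    factor = ℤSolver.solve-∀
    regroup : ∀ X h q Y → X *ℤ h *ℤ ((1ℤ +ℤ q) *ℤ Y) ≡ Y *ℤ X *ℤ ((1ℤ +ℤ q) *ℤ h)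
    regroup = ℤSolver.solve-∀

levelSum-A-double : ∀ t m → [ suc m + suc m ] t ≡ levelSum (tt ∷ []) incrA t (suc (m + m))
levelSum-A-double t m = trans (cong (λ k → [ suc k ] t) (+-suc m m)) (sym (levelSum-A t (suc (m + m))))

private
  interchange : ∀ a b c d → a *ℤ b *ℤ (c *ℤ d) ≡ a *ℤ c *ℤ (b *ℤ d)
  interchange = ℤSolver.solve-∀

Poincaré-identity-odd : ∀ q p → poincaréB (- q) p *ℤ poincaréψ 1 q p
                                ≡ poincaréA (- q) (p + p) *ℤ poincaréB q p
Poincaré-identity-odd q zero = refl
Poincaré-identity-odd q (suc m) = begin
  B⁻ *ℤ PB⁻ *ℤ (F *ℤ PF)                     ≡⟨ interchange B⁻ PB⁻ F PF ⟩
  B⁻ *ℤ F *ℤ (PB⁻ *ℤ PF)                     ≡⟨ cong₂ _*ℤ_ (levelSum-identity q m 0) (Poincaré-identity-odd q m) ⟩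
  Y *ℤ X *ℤ B *ℤ (PA *ℤ PB)                  ≡⟨ regroup Y X B PA PB ⟩
  X *ℤ (Y *ℤ PA) *ℤ (B *ℤ PB)
    ≡⟨ cong₂ (λ x y → x *ℤ (y *ℤ PA) *ℤ (B *ℤ PB)) (levelSum-A-double (- q) m) (sym (levelSum-A (- q) (m + m))) ⟩
  poincaréA (- q) (suc (suc (m + m))) *ℤ (B *ℤ PB)
    ≡⟨ cong (λ k → poincaréA (- q) (suc k) *ℤ (B *ℤ PB)) (+-suc m m) ⟨
  poincaréA (- q) (suc m + suc m) *ℤ (B *ℤ PB) ∎
  where
    open ≡-Reasoning
    B⁻ = levelSum bools incrB (- q) m
    PB⁻ = poincaréB (- q) m
    F = levelSum bools (incrF 1) q m
    PF = poincaréψ 1 q m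
    B = levelSum bools incrB q m
    PB = poincaréB q m
    PA = poincaréA (- q) (m + m)
    X = [ suc m + suc m ] (- q)
    Y = [ suc (m + m) ] (- q)
    regroup : ∀ y x b a c → y *ℤ x *ℤ b *ℤ (a *ℤ c) ≡ x *ℤ (y *ℤ a) *ℤ (b *ℤ c)
    regroup = ℤSolver.solve-∀

Poincaré-identity-even : ∀ q p → poincaréB (- q) p *ℤ poincaréψ 3 q p
                                 ≡ poincaréA (- q) (suc (p + p)) *ℤ poincaréB q p
Poincaré-identity-even q zero = refl
Poincaré-identity-even q (suc m) = begin
  B⁻ *ℤ PB⁻ *ℤ (F *ℤ PF)                     ≡⟨ interchange B⁻ PB⁻ F PF ⟩
  B⁻ *ℤ F *ℤ (PB⁻ *ℤ PF)                     ≡⟨ cong₂ _*ℤ_ (levelSum-identity q m 1) (Poincaré-identity-even q m) ⟩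
  Y *ℤ X *ℤ B *ℤ (PA *ℤ PB)                  ≡⟨ regroup Y X B PA PB ⟩
  Y *ℤ (X *ℤ PA) *ℤ (B *ℤ PB)
    ≡⟨ cong₂ (λ y x → y *ℤ (x *ℤ PA) *ℤ (B *ℤ PB)) (sym (levelSum-A (- q) (suc (suc (m + m))))) (levelSum-A-double (- q) m) ⟩
  poincaréA (- q) (suc (suc (suc (m + m)))) *ℤ (B *ℤ PB)
    ≡⟨ cong (λ k → poincaréA (- q) (suc (suc k)) *ℤ (B *ℤ PB)) (+-suc m m) ⟨
  poincaréA (- q) (suc (suc m + suc m)) *ℤ (B *ℤ PB) ∎
  where
    open ≡-Reasoning
    B⁻ = levelSum bools incrB (- q) m
    PB⁻ = poincaréB (- q) m
    F = levelSum bools (incrF 3) q m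
    PF = poincaréψ 3 q m
    B = levelSum bools incrB q m
    PB = poincaréB q m
    PA = poincaréA (- q) (suc (m + m))
    X = [ suc m + suc m ] (- q)
    Y = [ suc (suc (suc (m + m))) ] (- q)
    regroup : ∀ y x b a c → y *ℤ x *ℤ b *ℤ (a *ℤ c) ≡ y *ℤ (x *ℤ a) *ℤ (b *ℤ c)
    regroup = ℤSolver.solve-∀

sgn*^≡-^ : ∀ (q : ℤ) k → sgn k *ℤ q ^ℤ k ≡ (- q) ^ℤ k
sgn*^≡-^ q zero = refl
sgn*^≡-^ q (suc k) = trans (regroup (sgn k) q (q ^ℤ k)) (cong ((- q) *ℤ_) (sgn*^≡-^ q k))
  where
    regroup : ∀ s q Q → (- s) *ℤ (q *ℤ Q) ≡ (- q) *ℤ (s *ℤ Q)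
    regroup = ℤSolver.solve-∀

signed-monomial : ∀ (q : ℤ) a b → sgn a *ℤ q ^ℤ (a + b) ≡ (- q) ^ℤ a *ℤ q ^ℤ b
signed-monomial q a b = begin
  sgn a *ℤ q ^ℤ (a + b)       ≡⟨ cong (sgn a *ℤ_) (ℤP.^-distribˡ-+-* q a b) ⟩
  sgn a *ℤ (q ^ℤ a *ℤ q ^ℤ b) ≡⟨ ℤP.*-assoc (sgn a) _ _ ⟨
  sgn a *ℤ q ^ℤ a *ℤ q ^ℤ b   ≡⟨ cong (_*ℤ q ^ℤ b) (sgn*^≡-^ q a) ⟩
  (- q) ^ℤ a *ℤ q ^ℤ b        ∎
  where open ≡-Reasoning

∑∑-signedˡ : ∀ {X Y : Set} (xs : List X) (ys : List Y) (f : X → ℕ) (g : Y → ℕ) (q : ℤ) →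
  ∑[ x ∈ xs ] ∑[ y ∈ ys ] (sgn (f x) *ℤ q ^ℤ (f x + g y)) ≡ ∑[ x ∈ xs ] ((- q) ^ℤ f x) *ℤ ∑[ y ∈ ys ] (q ^ℤ g y)
∑∑-signedˡ xs ys f g q = begin
  ∑[ x ∈ xs ] ∑[ y ∈ ys ] (sgn (f x) *ℤ q ^ℤ (f x + g y)) ≡⟨ ∑-cong xs (λ x _ → ∑-cong ys (λ y _ → signed-monomial q (f x) (g y))) ⟩
  ∑[ x ∈ xs ] ∑[ y ∈ ys ] ((- q) ^ℤ f x *ℤ q ^ℤ g y)      ≡⟨ ∑-cong xs (λ x _ → ∑-*ˡ ((- q) ^ℤ f x) (λ y → q ^ℤ g y) ys) ⟩
  ∑[ x ∈ xs ] ((- q) ^ℤ f x *ℤ ∑[ y ∈ ys ] (q ^ℤ g y))    ≡⟨ ∑-*ʳ (∑[ y ∈ ys ] (q ^ℤ g y)) (λ x → (- q) ^ℤ f x) xs ⟩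
  ∑[ x ∈ xs ] ((- q) ^ℤ f x) *ℤ ∑[ y ∈ ys ] (q ^ℤ g y)    ∎
  where open ≡-Reasoning

∑∑-signedʳ : ∀ {X Y : Set} (xs : List X) (ys : List Y) (f : Y → ℕ) (g : X → ℕ) (q : ℤ) →
  ∑[ x ∈ xs ] ∑[ y ∈ ys ] (sgn (f y) *ℤ q ^ℤ (f y + g x)) ≡ ∑[ y ∈ ys ] ((- q) ^ℤ f y) *ℤ ∑[ x ∈ xs ] (q ^ℤ g x)
∑∑-signedʳ xs ys f g q = begin
  ∑[ x ∈ xs ] ∑[ y ∈ ys ] (sgn (f y) *ℤ q ^ℤ (f y + g x)) ≡⟨ ∑-cong xs (λ x _ → ∑-cong ys (λ y _ → signed-monomial q (f y) (g x))) ⟩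
  ∑[ x ∈ xs ] ∑[ y ∈ ys ] ((- q) ^ℤ f y *ℤ q ^ℤ g x)      ≡⟨ ∑-cong xs (λ x _ → ∑-*ʳ (q ^ℤ g x) (λ y → (- q) ^ℤ f y) ys) ⟩
  ∑[ x ∈ xs ] (∑[ y ∈ ys ] ((- q) ^ℤ f y) *ℤ q ^ℤ g x)    ≡⟨ ∑-*ˡ (∑[ y ∈ ys ] ((- q) ^ℤ f y)) (λ x → q ^ℤ g x) xs ⟩
  ∑[ y ∈ ys ] ((- q) ^ℤ f y) *ℤ ∑[ x ∈ xs ] (q ^ℤ g x)    ∎
  where open ≡-Reasoning

∑-pow-ℓA : ∀ n (ℓA : Perm (suc n) → ℕ) → IsLengthFunction (evalA n) IsPerm ℓA →
           ∀ t → ∑[ x ∈ elemsA n ] (t ^ℤ ℓA x) ≡ poincaréA t (suc n)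
∑-pow-ℓA n ℓA isℓA t = trans
  (∑-cong (elemsA n) λ x x∈ → cong (t ^ℤ_) (length≡inv n ℓA isℓA x (Equivalence.to (∈-elemsA n) x∈)))
  (∑-pow-inv n t)

∑-pow-ℓB : ∀ l (ℓB : SPerm (suc l) → ℕ) → IsLengthFunction (evalB (suc l)) IsSPerm ℓB →
           ∀ t → ∑[ x ∈ elemsB (suc l) ] (t ^ℤ ℓB x) ≡ poincaréB t (suc l)
∑-pow-ℓB l ℓB isℓB t = trans
  (∑-cong (elemsB (suc l)) λ x x∈ → cong (t ^ℤ_) (length≡invB l ℓB isℓB x (Equivalence.to (∈-elemsB (suc l)) x∈)))
  (∑-pow-invB (suc l) t)

module FoldedLength (l n : ℕ) (parity : n ≡ l + suc l ⊎ n ≡ suc l + suc l) where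
  open Folding l n parity
  open FoldedInversions l n parity

  inv-ψ≡foldedInv : ∀ v → IsSPerm v → inv (ψ n v) ≡ foldedInv c v
  inv-ψ≡foldedInv v v-perm = +-cancelʳ-≡ (2 * negatives v) _ _ (trans (inv-ψ v v-perm) (sym (foldedInv-negatives c v)))

  ∑-pow-ℓA∘φ : ∀ (φ : SPerm p → Perm (suc n)) → IsPhi n p φ → (ℓA : Perm (suc n) → ℕ) → IsLengthFunction (evalA n) IsPerm ℓA →
               ∀ t → ∑[ v ∈ elemsB p ] (t ^ℤ ℓA (φ v)) ≡ poincaréψ c t p
  ∑-pow-ℓA∘φ φ isφ ℓA isℓA t = trans (∑-cong (elemsB p) λ v v∈ → cong (t ^ℤ_) (ℓA∘φ≡foldedInv v (Equivalence.to (∈-elemsB p) v∈)))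
                                     (∑-pow-foldedInv c p t)
    where
      open Homomorphism l n parity φ isφ
      ℓA∘φ≡foldedInv : ∀ v → IsSPerm v → ℓA (φ v) ≡ foldedInv c v
      ℓA∘φ≡foldedInv v v-perm = begin
        ℓA (φ v)      ≡⟨ cong ℓA (φ≡ψ v v-perm) ⟩
        ℓA (ψ n v)    ≡⟨ length≡inv n ℓA isℓA (ψ n v) (IsPerm-ψ v v-perm) ⟩
        inv (ψ n v)   ≡⟨ inv-ψ≡foldedInv v v-perm ⟩
        foldedInv c v ∎
        where open ≡-Reasoning

  Poincaré-identity : ∀ q → poincaréB (- q) p *ℤ poincaréψ c q p
                            ≡ poincaréA (- q) (suc n) *ℤ poincaréB q p
  Poincaré-identity q = [_,_]
    {C = λ parity → poincaréB (- q) p *ℤ poincaréψ ([ (λ _ → 1) , (λ _ → 3) ]′ parity) q p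
                    ≡ poincaréA (- q) (suc n) *ℤ poincaréB q p}
    (λ { refl → Poincaré-identity-odd q p }) (λ { refl → Poincaré-identity-even q p }) parity

halve : ∀ n → 1 ≤ n → Σ ℕ λ l → suc n / 2 ≡ suc l × (n ≡ l + suc l ⊎ n ≡ suc l + suc l)
halve 1 _ = 0 , refl , inj₁ refl
halve 2 _ = 0 , refl , inj₂ refl
halve (suc (suc (suc n))) _ with halve (suc n) (s≤s z≤n)
... | l , half≡ , parity =
  suc l , trans (m/n≡1+[m∸n]/n {suc (suc (suc (suc n)))} {2} (s≤s (s≤s z≤n))) (cong suc half≡) , Sum.map odd even parity
  where
    odd : suc n ≡ l + suc l → suc (suc (suc n)) ≡ suc l + suc (suc l)
    odd eq = trans (cong (λ k → suc (suc k)) eq) (cong suc (sym (+-suc l (suc l))))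
    even : suc n ≡ suc l + suc l → suc (suc (suc n)) ≡ suc (suc l) + suc (suc l)
    even eq = trans (cong (λ k → suc (suc k)) eq) (cong (λ k → suc (suc k)) (sym (+-suc l (suc l))))

corollary1p5 : (n p : ℕ) → 1 ≤ n → p ≡ suc n / 2 →
    (φ : SPerm p → Perm (suc n)) → IsPhi n p φ →
    (ℓA : Perm (suc n) → ℕ) → IsLengthFunction (evalA n) IsPerm ℓA →
    (ℓB : SPerm p → ℕ) → IsLengthFunction (evalB p) IsSPerm ℓB →
    (q : ℤ) → LHS n p φ ℓA ℓB q ≡ RHS n p ℓA ℓB q
corollary1p5 n p 1≤n p≡ φ isφ ℓA isℓA ℓB isℓB q with halve n 1≤n
... | l , half≡ , parity with trans p≡ half≡
... | refl = begin
  LHS n p φ ℓA ℓB q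
    ≡⟨ ∑∑-signedʳ (elemsB p) (elemsB p) ℓB (ℓA ∘ φ) q ⟩
  ∑[ w ∈ elemsB p ] ((- q) ^ℤ ℓB w) *ℤ ∑[ v ∈ elemsB p ] (q ^ℤ ℓA (φ v))
    ≡⟨ cong₂ _*ℤ_ (∑-pow-ℓB l ℓB isℓB (- q)) (∑-pow-ℓA∘φ φ isφ ℓA isℓA q) ⟩
  poincaréB (- q) p *ℤ poincaréψ c q p
    ≡⟨ Poincaré-identity q ⟩
  poincaréA (- q) (suc n) *ℤ poincaréB q p
    ≡⟨ cong₂ _*ℤ_ (∑-pow-ℓA n ℓA isℓA (- q)) (∑-pow-ℓB l ℓB isℓB q) ⟨
  ∑[ x ∈ elemsA n ] ((- q) ^ℤ ℓA x) *ℤ ∑[ y ∈ elemsB p ] (q ^ℤ ℓB y)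
    ≡⟨ ∑∑-signedˡ (elemsA n) (elemsB p) ℓA ℓB q ⟨
  RHS n p ℓA ℓB q ∎
  where
    open ≡-Reasoning
    open FoldedLength l n parity
    open FoldedInversions l n parity using (c)
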